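{- Let $\pi\in S_n$ be a permutation with orbits $O_1,\ldots,O_m$, listed in increasing order of least element, and let $\ell_i=|O_i|$. Let $F_\pi$ be the set of minimal transitive star factorizations of $\pi$, and let $W_\pi$ be the set of words $w\in\{1,\ldots,m\}^{n+m-2}$ such that the letter $1$ appears exactly $\ell_1-1$ times, the letter $j$ appears exactly $\ell_j+1$ times for each $2\le j\le m$, and $w$ contains no (not necessarily contiguous) subword of the form $abab$ or $a1a$ with $a,b$ distinct and $a,b\neq1$. Then there is a bijection $$\Phi: F_\pi \to W_\pi\times O_2\times\cdots\times O_m.$$
   Context: A star transposition in $S_n$ is a transposition $(1\,i)$ with $2\le i\le n$. Permutations are multiplied as functions, $\rho\sigma(j)=\rho(\sigma(j))$. A star factorization of $\pi\in S_n$ of length $r$ is an ordered list $(\tau_1,\ldots,\tau_r)$ of star transpositions with $\tau_1\cdots\tau_r=\pi$; it is transitive if the group generated by its factors acts transitively on $\{1,\ldots,n\}$. If $\pi$ has $m$ cycles (counting fixed points), a minimal transitive star factorization of $\pi$ is a transitive star factorization of length $n+m-2$. A subword of $w=w_1\cdots w_r$ is a word $w_{i_1}w_{i_2}\cdots w_{i_k}$ with $i_1<\cdots<i_k$. -}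

module Defs where

open import Data.Nat using (ℕ; zero; suc; _+_; _∸_)
open import Data.Fin using (Fin; zero; suc) renaming (_<_ to _<ᶠ_; _≤_ to _≤ᶠ_)
open import Data.Fin.Permutation using (Permutation′; transpose; _⟨$⟩ʳ_; _⟨$⟩ˡ_)
open import Data.List using (List; []; _∷_; length)
open import Data.List.Relation.Unary.All using (All)
open import Data.List.Membership.Propositional using (_∈_)
open import Data.List.Relation.Binary.Sublist.Propositional using (_⊆_)
open import Data.Vec using (Vec; lookup)
open import Data.Product using (Σ; ∃; _×_; _,_; proj₁)
open import Relation.Nullary using (¬_; yes; no)
open import Relation.Binary.PropositionalEquality using (_≡_; _≢_)
import Relation.Binary.PropositionalEquality as PE
open import Relation.Binary.Bundles using (Setoid)
import Relation.Binary.Construct.On as On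
open import Function.Definitions using (Injective)

-- Conventions: S_n acts on Fin n with n = suc k; the paper's point 1 is
-- the element zero, and point i+1 is the element i of Fin n.

iter : {A : Set} → (A → A) → ℕ → A → A
iter f zero    x = x
iter f (suc t) x = f (iter f t x)

InOrbit : {n : ℕ} → Permutation′ n → Fin n → Fin n → Set
InOrbit π a x = ∃ λ t → iter (π ⟨$⟩ʳ_) t a ≡ x

-- A listing O_1,…,O_m of the orbits of π in increasing order of least
-- element: lead j is the least element of O_j (O_j = orbit of lead j).
record OrbitListing {n : ℕ} (π : Permutation′ n) (m : ℕ) : Set where
  field
    lead       : Fin m → Fin n
    increasing : ∀ i j → i <ᶠ j → lead i <ᶠ lead j
    least      : ∀ j x → InOrbit π (lead j) x → lead j ≤ᶠ x
    covers     : ∀ x → ∃ λ j → InOrbit π (lead j) x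
open OrbitListing public

OrbitSize : {n : ℕ} → Permutation′ n → Fin n → ℕ → Set
OrbitSize {n} π a ℓ = Σ (Fin ℓ → Fin n) λ e →
  Injective _≡_ _≡_ e × (∀ x → (InOrbit π a x → ∃ λ i → e i ≡ x) × (∃ (λ i → e i ≡ x) → InOrbit π a x))

-- Star transpositions (1 i), i ≠ 1, encoded by the index i : Fin (suc k)
-- with i ≢ zero.  star i is the transposition as a function.

star : {k : ℕ} → Fin (suc k) → Fin (suc k) → Fin (suc k)
star i x = transpose zero i ⟨$⟩ʳ x

prod : {k : ℕ} → List (Fin (suc k)) → Fin (suc k) → Fin (suc k)
prod []       x = x
prod (i ∷ is) x = star i (prod is x)

data InGen {k : ℕ} (is : List (Fin (suc k))) : (Fin (suc k) → Fin (suc k)) → Set where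
  gen-id  : InGen is (λ x → x)
  gen-mul : ∀ {i g} → i ∈ is → InGen is g → InGen is (λ x → star i (g x))
  gen-inv : ∀ {i g} → i ∈ is → InGen is g → InGen is (λ x → transpose zero i ⟨$⟩ˡ g x)

TransitiveFact : {k : ℕ} → List (Fin (suc k)) → Set
TransitiveFact {k} is = ∀ (x y : Fin (suc k)) → ∃ λ g → InGen is g × g x ≡ y

IsMinTransStarFact : {k : ℕ} → Permutation′ (suc k) → (m : ℕ) → List (Fin (suc k)) → Set
IsMinTransStarFact {k} π m is =
  All (λ i → i ≢ zero) is
  × length is ≡ suc k + m ∸ 2
  × (∀ x → prod is x ≡ π ⟨$⟩ʳ x)
  × TransitiveFact is

FSetoid : {k : ℕ} → Permutation′ (suc k) → (m : ℕ) → Setoid _ _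
FSetoid {k} π m = On.setoid {B = Σ (List (Fin (suc k))) (IsMinTransStarFact π m)}
                    (PE.setoid (List (Fin (suc k)))) proj₁

occ : {m : ℕ} → Fin m → List (Fin m) → ℕ
occ j []       = 0
occ j (a ∷ w) with a Data.Fin.≟ j
... | yes _ = suc (occ j w)
... | no  _ = occ j w

-- W_π (m = suc p): letters Fin m, letter 1 = zero.  ℓ j = |O_{j+1}|.
IsW : (n p : ℕ) → (Fin (suc p) → ℕ) → List (Fin (suc p)) → Set
IsW n p ℓ w =
  length w ≡ n + suc p ∸ 2
  × occ zero w ≡ ℓ zero ∸ 1
  × (∀ (j : Fin (suc p)) → j ≢ zero → occ j w ≡ ℓ j + 1)
  × (∀ (a b : Fin (suc p)) → a ≢ b → a ≢ zero → b ≢ zero → ¬ ((a ∷ b ∷ a ∷ b ∷ []) ⊆ w))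
  × (∀ (a : Fin (suc p)) → a ≢ zero → ¬ ((a ∷ zero ∷ a ∷ []) ⊆ w))

-- W_π × O_2 × ⋯ × O_m, with m = suc p; the vector c has c[i] ∈ O_{i+2}.
TargetCarrier : {k p : ℕ} (π : Permutation′ (suc k)) → OrbitListing π (suc p) → (Fin (suc p) → ℕ) → Set
TargetCarrier {k} {p} π L ℓ =
  Σ (List (Fin (suc p)) × Vec (Fin (suc k)) p) λ where
    (w , c) → IsW (suc k) p ℓ w × (∀ (i : Fin p) → InOrbit π (lead L (suc i)) (lookup c i))

TargetSetoid : {k p : ℕ} (π : Permutation′ (suc k)) → OrbitListing π (suc p) → (Fin (suc p) → ℕ) → Setoid _ _
TargetSetoid {k} {p} π L ℓ = On.setoid {B = TargetCarrier π L ℓ}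
  (PE.setoid (List (Fin (suc p)) × Vec (Fin (suc k)) p)) proj₁

{-# OPTIONS --safe #-}
-- Multiply the factors (1 a₁)(1 a₂)⋯ from the left and follow the cycle structure of the
-- partial products: the cycle through 1 as a list, and the other nontrivial cycles.
-- Multiplying by (1 a) on the right splits the cycle of 1 when a lies on it, merges the cycle
-- of a into it when a is moved elsewhere, and inserts a into it when a is fixed.  The number
-- of moved points plus the number of other cycles grows by one in the first and last case and
-- drops by one in a merge.  At the end it is at least (n − 1) + (m − 1), since transitivity
-- moves every point and π has m cycles, so a factorization of length n + m − 2 never merges.
--
-- Without merges the factors from an orbit O_j, j ≠ 1, run through c, π⁻¹c, …, π^(−ℓ_j)c = c,
-- where c is the first of them, and the cycle of O_j is closed off exactly by the last one;
-- the factors from O₁ run through π⁻¹1, …, π^(1−ℓ₁)1.  Hence a factorization is determined by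
-- its word of orbit indices together with these first points.  That word is read by a stack
-- automaton (an orbit, once started, must be finished before an earlier one continues or 1
-- occurs), which accepts exactly the words of W_π; conversely, the decoding of any such word
-- never merges, which makes it a minimal transitive factorization of π.
module Submission where

open import Defs
open import Data.Empty using (⊥; ⊥-elim)
open import Data.Fin using (Fin; zero; suc; toℕ; fromℕ<; _≟_) renaming (_≤_ to _≤ᶠ_)
import Data.Fin.Properties as Finₚ
open import Data.Fin.Permutation using (Permutation′; transpose; _⟨$⟩ʳ_; _⟨$⟩ˡ_; inverseʳ; inverseˡ)
open import Data.List using (List; []; _∷_; _++_; [_]; concat; length; map; lookup)
open import Data.List.Membership.Propositional using (_∈_; _∉_)
open import Data.List.Membership.Propositional.Properties using (∈-++⁺ˡ; ∈-++⁺ʳ; ∈-++⁻; ∈-concat⁺′; ∈-concat⁻′; ∈-∃++)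
open import Data.List.Properties using (++-assoc; ++-identityʳ; concat-++; length-++; length-map; ∷-injective; ∷ʳ-injectiveˡ)
open import Data.List.Relation.Unary.All using (All; []; _∷_)
import Data.List.Relation.Unary.All as All
import Data.List.Relation.Unary.All.Properties as Allₚ
open import Data.List.Relation.Unary.Any using (here; there; index)
open import Data.List.Relation.Unary.Any.Properties using (lookup-index)
open import Data.List.Relation.Binary.Sublist.Propositional using (_⊆_; []; _∷_; _∷ʳ_; from∈)
open import Data.List.Relation.Binary.Sublist.Propositional.Properties using (++⁺; ++⁺ʳ; Any-resp-⊆)
open import Data.Maybe using (Maybe; just; nothing; fromMaybe)
open import Data.Nat using (ℕ; zero; suc; _+_; _∸_; _*_; _≤_; _<_; z≤n; s≤s; _≤?_; _<?_) renaming (_≟_ to _≟ℕ_)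
open import Data.Nat.DivMod using (_%_; _/_; m%n<n; m≡m%n+[m/n]*n)
open import Data.Nat.Properties hiding (_≟_)
open import Data.Nat.Solver using (module +-*-Solver)
open import Data.Product using (Σ; ∃; _×_; _,_; proj₁; proj₂)
open import Data.Sum using (_⊎_; inj₁; inj₂; [_,_]′)
open import Data.Unit using (⊤; tt)
open import Data.Vec as Vec using (Vec; tabulate)
open import Data.Vec.Properties using (lookup∘tabulate; tabulate∘lookup; tabulate-cong)
open import Function.Bundles using (Inverse)
open import Function.Definitions using (Injective)
open import Relation.Binary.Definitions using (tri<; tri≈; tri>)
open import Relation.Binary.PropositionalEquality using (_≡_; _≢_; refl; sym; trans; cong; cong₂; subst; module ≡-Reasoning)
open import Relation.Nullary using (¬_; yes; no)
open +-*-Solver using (solve; _:+_; _:*_; _:=_; con)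

occ-here : ∀ {m} (x : Fin m) xs → occ x (x ∷ xs) ≡ suc (occ x xs)
occ-here x xs with x ≟ x
... | yes _ = refl
... | no x≢x = ⊥-elim (x≢x refl)

occ-there : ∀ {m} {x y : Fin m} xs → y ≢ x → occ x (y ∷ xs) ≡ occ x xs
occ-there {x = x} {y} xs y≢x with y ≟ x
... | yes y≡x = ⊥-elim (y≢x y≡x)
... | no _ = refl

occ-++ : ∀ {m} (x : Fin m) xs ys → occ x (xs ++ ys) ≡ occ x xs + occ x ys
occ-++ x [] ys = refl
occ-++ x (y ∷ xs) ys with y ≟ x
... | yes _ = cong suc (occ-++ x xs ys)
... | no _ = occ-++ x xs ys

occ-drop : ∀ {m} {x a : Fin m} ys zs → a ≢ x → occ x (ys ++ a ∷ zs) ≡ occ x (ys ++ zs)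
occ-drop [] zs a≢x = occ-there zs a≢x
occ-drop {x = x} (y ∷ ys) zs a≢x with y ≟ x
... | yes _ = cong suc (occ-drop ys zs a≢x)
... | no _ = occ-drop ys zs a≢x

occ-mid : ∀ {m} (x : Fin m) xs ys → occ x (xs ++ x ∷ ys) ≡ suc (occ x (xs ++ ys))
occ-mid x [] ys = occ-here x ys
occ-mid x (y ∷ xs) ys with y ≟ x
... | yes _ = cong suc (occ-mid x xs ys)
... | no _ = occ-mid x xs ys

∈⇒1≤occ : ∀ {m} {x : Fin m} {xs} → x ∈ xs → 1 ≤ occ x xs
∈⇒1≤occ {x = x} {_ ∷ xs} (here refl) rewrite occ-here x xs = s≤s z≤n
∈⇒1≤occ {x = x} {y ∷ xs} (there x∈xs) with y ≟ x
... | yes _ = s≤s z≤n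
... | no _ = ∈⇒1≤occ x∈xs

1≤occ⇒∈ : ∀ {m} {x : Fin m} xs → 1 ≤ occ x xs → x ∈ xs
1≤occ⇒∈ {x = x} (y ∷ xs) h with y ≟ x
... | yes refl = here refl
... | no _ = there (1≤occ⇒∈ xs h)

∉⇒occ≡0 : ∀ {m} {x : Fin m} xs → x ∉ xs → occ x xs ≡ 0
∉⇒occ≡0 [] _ = refl
∉⇒occ≡0 {x = x} (y ∷ xs) x∉ with y ≟ x
... | yes refl = ⊥-elim (x∉ (here refl))
... | no _ = ∉⇒occ≡0 xs (λ p → x∉ (there p))

Distinct : ∀ {m} → List (Fin m) → Set
Distinct xs = ∀ x → occ x xs ≤ 1

distinct-singleton : ∀ {m} (y : Fin m) → Distinct [ y ]
distinct-singleton y x with y ≟ x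
... | yes _ = s≤s z≤n
... | no _ = z≤n

distinct-disjoint : ∀ {m} (xs ys : List (Fin m)) {x} → Distinct (xs ++ ys) → x ∈ xs → x ∈ ys → ⊥
distinct-disjoint xs ys {x} d p q with d x
... | h rewrite occ-++ x xs ys = 1+n≰n {1} (≤-trans (+-mono-≤ (∈⇒1≤occ p) (∈⇒1≤occ q)) h)

distinct-head : ∀ {m} {x : Fin m} xs → Distinct (x ∷ xs) → x ∉ xs
distinct-head {x = x} xs d = distinct-disjoint [ x ] xs d (here refl)

distinct-++⁻ˡ : ∀ {m} (xs ys : List (Fin m)) → Distinct (xs ++ ys) → Distinct xs
distinct-++⁻ˡ xs ys d x = ≤-trans (subst (occ x xs ≤_) (sym (occ-++ x xs ys)) (m≤m+n _ _)) (d x)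

distinct-++⁻ʳ : ∀ {m} (xs ys : List (Fin m)) → Distinct (xs ++ ys) → Distinct ys
distinct-++⁻ʳ xs ys d x = ≤-trans (subst (occ x ys ≤_) (sym (occ-++ x xs ys)) (m≤n+m _ _)) (d x)

distinct-tail : ∀ {m} {x : Fin m} xs → Distinct (x ∷ xs) → Distinct xs
distinct-tail {x = x} xs = distinct-++⁻ʳ [ x ] xs

infix 4 _≈occ_
_≈occ_ : ∀ {m} → List (Fin m) → List (Fin m) → Set
xs ≈occ ys = ∀ x → occ x xs ≡ occ x ys

≈occ-cons : ∀ {m} (y : Fin m) {xs ys} → xs ≈occ ys → y ∷ xs ≈occ y ∷ ys
≈occ-cons y e x with y ≟ x
... | yes _ = cong suc (e x)
... | no _ = e x

≈occ-distinct : ∀ {m} {xs ys : List (Fin m)} → xs ≈occ ys → Distinct xs → Distinct ys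
≈occ-distinct e d x = subst (_≤ 1) (e x) (d x)

≈occ-∈ : ∀ {m} {xs ys : List (Fin m)} {x} → xs ≈occ ys → x ∈ xs → x ∈ ys
≈occ-∈ {ys = ys} {x} e p = 1≤occ⇒∈ ys (subst (1 ≤_) (e x) (∈⇒1≤occ p))

≈occ-length : ∀ {m} (xs ys : List (Fin m)) → xs ≈occ ys → length xs ≡ length ys
≈occ-length [] [] e = refl
≈occ-length [] (y ∷ ys) e with trans (e y) (occ-here y ys)
... | ()
≈occ-length (x ∷ xs) ys e with ∈-∃++ (1≤occ⇒∈ ys (subst (1 ≤_) (trans (sym (occ-here x xs)) (e x)) (s≤s z≤n)))
... | B , C , refl = begin
    suc (length xs)          ≡⟨ cong suc (≈occ-length xs (B ++ C) xs≈BC) ⟩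
    suc (length (B ++ C))    ≡⟨ cong suc (length-++ B) ⟩
    suc (length B + length C) ≡⟨ +-suc (length B) (length C) ⟨
    length B + length (x ∷ C) ≡⟨ length-++ B ⟨
    length (B ++ x ∷ C)      ∎
  where
  open ≡-Reasoning
  xs≈BC : xs ≈occ B ++ C
  xs≈BC z with x ≟ z
  ... | yes refl = suc-injective (trans (sym (occ-here x xs)) (trans (e x) (occ-mid x B C)))
  ... | no x≢z = trans (sym (occ-there xs x≢z)) (trans (e z) (occ-drop B C x≢z))

iter-+ : ∀ {A : Set} (f : A → A) a b x → iter f (a + b) x ≡ iter f a (iter f b x)
iter-+ f zero b x = refl
iter-+ f (suc a) b x = cong f (iter-+ f a b x)

iter-suc-inner : ∀ {A : Set} (f : A → A) t x → iter f (suc t) x ≡ iter f t (f x)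
iter-suc-inner f zero x = refl
iter-suc-inner f (suc t) x = cong f (iter-suc-inner f t x)

iter-comm : ∀ {A : Set} (f : A → A) d t x → iter f d (iter f t x) ≡ iter f t (iter f d x)
iter-comm f d t x = trans (sym (iter-+ f d t x)) (trans (cong (λ z → iter f z x) (+-comm d t)) (iter-+ f t d x))

iter-cancel : ∀ {A : Set} (f g : A → A) → (∀ x → g (f x) ≡ x) → ∀ t x → iter g t (iter f t x) ≡ x
iter-cancel f g g∘f zero x = refl
iter-cancel f g g∘f (suc t) x =
  trans (iter-suc-inner g t (f (iter f t x))) (trans (cong (iter g t) (g∘f (iter f t x))) (iter-cancel f g g∘f t x))

iter-injective : ∀ {A : Set} (f : A → A) → (∀ {x y} → f x ≡ f y → x ≡ y) → ∀ t {x y} → iter f t x ≡ iter f t y → x ≡ y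
iter-injective f inj zero e = e
iter-injective f inj (suc t) e = iter-injective f inj t (inj e)

iter-multiple-of-return : ∀ {A : Set} (f : A → A) q d a → iter f d a ≡ a → iter f (q * d) a ≡ a
iter-multiple-of-return f zero d a e = refl
iter-multiple-of-return f (suc q) d a e = trans (iter-+ f d (q * d) a) (trans (cong (iter f d) (iter-multiple-of-return f q d a e)) e)

iter-mod-return : ∀ {A : Set} (f : A → A) t d′ a → iter f (suc d′) a ≡ a → iter f t a ≡ iter f (t % suc d′) a
iter-mod-return f t d′ a e = trans (cong (λ z → iter f z a) (m≡m%n+[m/n]*n t (suc d′)))
  (trans (iter-+ f (t % suc d′) ((t / suc d′) * suc d′) a) (cong (iter f (t % suc d′)) (iter-multiple-of-return f (t / suc d′) (suc d′) a e)))

Fin-nonempty : ∀ l → Fin l → 1 ≤ l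
Fin-nonempty (suc _) _ = s≤s z≤n

pred< : ∀ l → 1 ≤ l → l ∸ 1 < l
pred< (suc l) _ = n<1+n l

excess≡0 : ∀ {m n} b → m ≡ n + 2 * b → m ≤ n → b ≡ 0
excess≡0 zero _ _ = refl
excess≡0 {n = n} (suc b) e le = ⊥-elim (m+1+n≰m n {b + (suc b + 0)} (≤-trans (≤-reflexive (sym e)) le))

Chain : {A : Set} → (A → A) → A → List A → A → Set
Chain σ x [] z = σ x ≡ z
Chain σ x (y ∷ ys) z = σ x ≡ y × Chain σ y ys z

IsCycle : {A : Set} → (A → A) → List A → Set
IsCycle σ [] = ⊥
IsCycle σ (c ∷ cs) = Chain σ c cs c

module _ {A : Set} (σ : A → A) where

  chain-++⁺ : ∀ x ys y zs z → Chain σ x ys y → Chain σ y zs z → Chain σ x (ys ++ y ∷ zs) z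
  chain-++⁺ x [] y zs z e c = e , c
  chain-++⁺ x (y′ ∷ ys) y zs z (e , c) c′ = e , chain-++⁺ y′ ys y zs z c c′

  chain-++⁻ : ∀ x ys y zs z → Chain σ x (ys ++ y ∷ zs) z → Chain σ x ys y × Chain σ y zs z
  chain-++⁻ x [] y zs z (e , c) = e , c
  chain-++⁻ x (y′ ∷ ys) y zs z (e , c) with chain-++⁻ y′ ys y zs z c
  ... | c₁ , c₂ = (e , c₁) , c₂

  chain-rotate : ∀ xs a ys → IsCycle σ (xs ++ a ∷ ys) → Chain σ a (ys ++ xs) a
  chain-rotate [] a ys h rewrite ++-identityʳ ys = h
  chain-rotate (c ∷ xs) a ys h with chain-++⁻ c xs a ys c h
  ... | h₁ , h₂ = chain-++⁺ a ys c xs a h₂ h₁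

  chain-reaches-end : ∀ x ys z y → y ∈ x ∷ ys → Chain σ x ys z → ∃ λ t → iter σ t y ≡ z
  chain-reaches-end x [] z .x (here refl) c = 1 , c
  chain-reaches-end x (y′ ∷ ys) z .x (here refl) (c₁ , c₂) with chain-reaches-end y′ ys z y′ (here refl) c₂
  ... | t , e = suc t , trans (iter-suc-inner σ t x) (trans (cong (iter σ t) c₁) e)
  chain-reaches-end x (y′ ∷ ys) z y (there p) (c₁ , c₂) = chain-reaches-end y′ ys z y p c₂

  chain-reached-from-start : ∀ x ys z y → y ∈ x ∷ ys → Chain σ x ys z → ∃ λ t → iter σ t x ≡ y
  chain-reached-from-start x ys z .x (here refl) c = 0 , refl
  chain-reached-from-start x (y′ ∷ ys) z y (there p) (c₁ , c₂) with chain-reached-from-start y′ ys z y p c₂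
  ... | t , e = suc t , trans (iter-suc-inner σ t x) (trans (cong (iter σ t) c₁) e)

  cycle-connected : ∀ C → IsCycle σ C → ∀ x y → x ∈ C → y ∈ C → ∃ λ t → iter σ t x ≡ y
  cycle-connected (c ∷ cs) h x y x∈ y∈
    with chain-reaches-end c cs c x x∈ h | chain-reached-from-start c cs c y y∈ h
  ... | t₁ , e₁ | t₂ , e₂ = t₂ + t₁ , trans (iter-+ σ t₂ t₁ x) (trans (cong (iter σ t₂) e₁) e₂)

  chain-closed : ∀ x ys z y → y ∈ x ∷ ys → Chain σ x ys z → σ y ∈ ys ++ [ z ]
  chain-closed x [] z .x (here refl) c = here c
  chain-closed x (y′ ∷ ys) z .x (here refl) (c₁ , c₂) = here c₁
  chain-closed x (y′ ∷ ys) z y (there p) (c₁ , c₂) = there (chain-closed y′ ys z y p c₂)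

  cycle-closed : ∀ C → IsCycle σ C → ∀ y → y ∈ C → σ y ∈ C
  cycle-closed (c ∷ cs) h y p with ∈-++⁻ cs (chain-closed c cs c y p h)
  ... | inj₁ q = there q
  ... | inj₂ (here e) = here e

  cycle-iter-closed : ∀ C → IsCycle σ C → ∀ t y → y ∈ C → iter σ t y ∈ C
  cycle-iter-closed C h zero y p = p
  cycle-iter-closed C h (suc t) y p = cycle-closed C h _ (cycle-iter-closed C h t y p)

chain-transport : ∀ {A : Set} (σ σ′ : A → A) x x′ ys z → Chain σ x ys z → σ′ x′ ≡ σ x →
  (∀ y → y ∈ ys → σ′ y ≡ σ y) → Chain σ′ x′ ys z
chain-transport σ σ′ x x′ [] z c e h = trans e c
chain-transport σ σ′ x x′ (y ∷ ys) z (c₁ , c₂) e h =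
  trans e c₁ , chain-transport σ σ′ y y ys z c₂ (h y (here refl)) (λ w p → h w (there p))

cycle-transport : ∀ {A : Set} (σ σ′ : A → A) C → IsCycle σ C → (∀ y → y ∈ C → σ′ y ≡ σ y) → IsCycle σ′ C
cycle-transport σ σ′ (c ∷ cs) h e = chain-transport σ σ′ c c cs c h (e c (here refl)) (λ y p → e y (there p))

cycles-transport : ∀ {A : Set} (σ σ′ : A → A) D → All (IsCycle σ) D → (∀ y → y ∈ concat D → σ′ y ≡ σ y) → All (IsCycle σ′) D
cycles-transport σ σ′ [] [] e = []
cycles-transport σ σ′ (C ∷ D) (h ∷ hs) e =
  cycle-transport σ σ′ C h (λ y p → e y (∈-++⁺ˡ p)) ∷ cycles-transport σ σ′ D hs (λ y p → e y (∈-++⁺ʳ C p))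

chain-agree : ∀ {A : Set} (σ σ′ : A → A) x ys z → Chain σ x ys z → Chain σ′ x ys z → ∀ y → y ∈ x ∷ ys → σ y ≡ σ′ y
chain-agree σ σ′ x [] z c c′ .x (here refl) = trans c (sym c′)
chain-agree σ σ′ x (y₁ ∷ ys) z c c′ .x (here refl) = trans (proj₁ c) (sym (proj₁ c′))
chain-agree σ σ′ x (y₁ ∷ ys) z c c′ y (there p) = chain-agree σ σ′ y₁ ys z (proj₂ c) (proj₂ c′) y p

shift-into-prefix : ∀ {A : Set} {u pre rest : List A} {x} → u ≡ pre ++ x ∷ rest → u ≡ (pre ++ [ x ]) ++ rest
shift-into-prefix {pre = pre} {rest} {x} eu = trans eu (sym (++-assoc pre [ x ] rest))

++-∷-cases : ∀ {A : Set} (xs ys : List A) {a b : A} {xs′ ys′} → xs ++ a ∷ xs′ ≡ ys ++ b ∷ ys′ →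
  (xs ≡ ys × a ≡ b × xs′ ≡ ys′)
  ⊎ (∃ λ M → xs ≡ ys ++ b ∷ M × ys′ ≡ M ++ a ∷ xs′)
  ⊎ (∃ λ M → ys ≡ xs ++ a ∷ M × xs′ ≡ M ++ b ∷ ys′)
++-∷-cases [] [] refl = inj₁ (refl , refl , refl)
++-∷-cases [] (z ∷ ys) refl = inj₂ (inj₂ (ys , refl , refl))
++-∷-cases (z ∷ xs) [] refl = inj₂ (inj₁ (xs , refl , refl))
++-∷-cases (z ∷ xs) (z′ ∷ ys) e with ∷-injective e
... | refl , e′ with ++-∷-cases xs ys e′
... | inj₁ (refl , e₂ , e₃) = inj₁ (refl , e₂ , e₃)
... | inj₂ (inj₁ (M , refl , e₃)) = inj₂ (inj₁ (M , refl , e₃))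
... | inj₂ (inj₂ (M , refl , e₃)) = inj₂ (inj₂ (M , refl , e₃))

module StarMachine (k : ℕ) where
  open import Data.List.Membership.DecPropositional (_≟_ {suc k}) using (_∈?_)

  Point : Set
  Point = Fin (suc k)

  AllNonZero : List Point → Set
  AllNonZero = All (_≢ zero)

  star-self : ∀ (a : Point) → star a a ≡ zero
  star-self a with a ≟ zero
  ... | yes e = e
  ... | no ne with a ≟ a
  ... | yes _ = refl
  ... | no ne2 = ⊥-elim (ne2 refl)

  star-other : ∀ (a x : Point) → x ≢ zero → x ≢ a → star a x ≡ x
  star-other a x n0 na with x ≟ zero
  ... | yes e = ⊥-elim (n0 e)
  ... | no _ with x ≟ a
  ... | yes e = ⊥-elim (na e)
  ... | no _ = refl

  -- (L , D): the cycle of 0 read as 0 → L₁ → ⋯ → 0, and the other nontrivial cycles.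
  State : Set
  State = List Point × List (List Point)

  points : State → List Point
  points (L , D) = L ++ concat D

  consFront : Point → Maybe (List Point × List Point) → Maybe (List Point × List Point)
  consFront x nothing = nothing
  consFront x (just (X , Y)) = just (x ∷ X , Y)

  cutAt : Point → List Point → Maybe (List Point × List Point)
  cutAt a [] = nothing
  cutAt a (x ∷ xs) with x ≟ a
  ... | yes _ = just ([] , xs)
  ... | no _ = consFront x (cutAt a xs)

  cutAt-just : ∀ a L {X Y} → cutAt a L ≡ just (X , Y) → L ≡ X ++ a ∷ Y × a ∉ X
  cutAt-just a [] ()
  cutAt-just a (x ∷ xs) e with x ≟ a
  cutAt-just a (x ∷ xs) refl | yes refl = refl , λ ()
  ... | no ne with cutAt a xs in eq
  cutAt-just a (x ∷ xs) refl | no ne | just (X , Y) with cutAt-just a xs eq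
  ... | e1 , e2 = cong (x ∷_) e1 , λ { (here p) → ne (sym p) ; (there p) → e2 p }

  cutAt-nothing : ∀ a L → cutAt a L ≡ nothing → a ∉ L
  cutAt-nothing a [] e ()
  cutAt-nothing a (x ∷ xs) e p with x ≟ a
  cutAt-nothing a (x ∷ xs) () p | yes _
  ... | no ne with cutAt a xs in eq
  cutAt-nothing a (x ∷ xs) e (here refl) | no ne | nothing = ne refl
  cutAt-nothing a (x ∷ xs) e (there p) | no ne | nothing = cutAt-nothing a xs eq p

  cutAt-found : ∀ a X Y → a ∉ X → cutAt a (X ++ a ∷ Y) ≡ just (X , Y)
  cutAt-found a [] Y h with a ≟ a
  ... | yes _ = refl
  ... | no ne = ⊥-elim (ne refl)
  cutAt-found a (x ∷ X) Y h with x ≟ a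
  ... | yes refl = ⊥-elim (h (here refl))
  ... | no _ rewrite cutAt-found a X Y (λ p → h (there p)) = refl

  cutAt-none : ∀ a L → a ∉ L → cutAt a L ≡ nothing
  cutAt-none a L h with cutAt a L in eq
  ... | nothing = refl
  ... | just (X , Y) = ⊥-elim (h (subst (a ∈_) (sym (proj₁ (cutAt-just a L eq))) (∈-++⁺ʳ X (here refl))))

  findCycleFrom : List Point → List (List Point) → Maybe (List Point × List Point) → Maybe (List (List Point) × List Point) → Maybe (List (List Point) × List Point)
  findCycleFrom C D (just (Pp , S)) r = just (D , S ++ Pp)
  findCycleFrom C D nothing nothing = nothing
  findCycleFrom C D nothing (just (D′ , Rt)) = just (C ∷ D′ , Rt)

  findCycle : Point → List (List Point) → Maybe (List (List Point) × List Point)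
  findCycle a [] = nothing
  findCycle a (C ∷ D) = findCycleFrom C D (cutAt a C) (findCycle a D)

  findCycle-just : ∀ a D {D′ Rt} → findCycle a D ≡ just (D′ , Rt) →
    Σ (List (List Point)) λ D1 → Σ (List Point) λ Pp → Σ (List Point) λ S → Σ (List (List Point)) λ D2 →
      D ≡ D1 ++ (Pp ++ a ∷ S) ∷ D2 × D′ ≡ D1 ++ D2 × Rt ≡ S ++ Pp
  findCycle-just a [] ()
  findCycle-just a (C ∷ D) e with cutAt a C in eq1
  findCycle-just a (C ∷ D) refl | just (Pp , S) with cutAt-just a C eq1
  ... | e1 , _ = [] , Pp , S , D , cong (_∷ D) e1 , refl , refl
  findCycle-just a (C ∷ D) e | nothing with findCycle a D in eq2
  findCycle-just a (C ∷ D) refl | nothing | just (D′ , Rt) with findCycle-just a D eq2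
  ... | D1 , Pp , S , D2 , e1 , e2 , e3 = C ∷ D1 , Pp , S , D2 , cong (C ∷_) e1 , cong (C ∷_) e2 , e3

  findCycle-nothing : ∀ a D → findCycle a D ≡ nothing → a ∉ concat D
  findCycle-nothing a [] e ()
  findCycle-nothing a (C ∷ D) e p with cutAt a C in eq1
  findCycle-nothing a (C ∷ D) () p | just _
  ... | nothing with findCycle a D in eq2
  findCycle-nothing a (C ∷ D) e p | nothing | nothing with ∈-++⁻ C p
  ... | inj₁ q = cutAt-nothing a C eq1 q
  ... | inj₂ q = findCycle-nothing a D eq2 q

  findCycle-none : ∀ a D → a ∉ concat D → findCycle a D ≡ nothing
  findCycle-none a D h with findCycle a D in eq
  ... | nothing = refl
  ... | just (D′ , Rt) with findCycle-just a D eq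
  ... | D1 , Pp , S , D2 , refl , _ , _ =
    ⊥-elim (h (∈-concat⁺′ (∈-++⁺ʳ Pp (here refl)) (∈-++⁺ʳ D1 (here refl))))

  stepFind : Point → List Point → List (List Point) → Maybe (List (List Point) × List Point) → State
  stepFind a L D (just (D′ , Rt)) = Rt ++ a ∷ L , D′
  stepFind a L D nothing = a ∷ L , D

  stepCut : Point → List Point → List (List Point) → Maybe (List Point × List Point) → State
  stepCut a L D (just (X , Y)) = Y , (a ∷ X) ∷ D
  stepCut a L D nothing = stepFind a L D (findCycle a D)

  step : Point → State → State
  step a (L , D) = stepCut a L D (cutAt a L)

  run : List Point → State → State
  run [] s = s
  run (a ∷ w) s = run w (step a s)

  mergedFind : Maybe (List (List Point) × List Point) → ℕ
  mergedFind (just _) = 1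
  mergedFind nothing = 0

  mergedCut : Maybe (List Point × List Point) → Maybe (List (List Point) × List Point) → ℕ
  mergedCut (just _) _ = 0
  mergedCut nothing r = mergedFind r

  merged : Point → State → ℕ
  merged a (L , D) = mergedCut (cutAt a L) (findCycle a D)

  merges : List Point → State → ℕ
  merges [] s = 0
  merges (a ∷ w) s = merged a s + merges w (step a s)

  NoMergeStep : Point → State → State → Set
  NoMergeStep a s s′ = step a s ≡ s′ × merged a s ≡ 0

  Represents : (Point → Point) → State → Set
  Represents σ (L , D) = Chain σ zero L zero × All (IsCycle σ) D × (∀ x → x ∉ zero ∷ L ++ concat D → σ x ≡ x)

  represents-id : Represents (λ x → x) ([] , [])
  represents-id = refl , [] , (λ x _ → refl)

  data StepView (a : Point) (L : List Point) (D : List (List Point)) : Set where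
    split : ∀ X Y → L ≡ X ++ a ∷ Y → a ∉ X → step a (L , D) ≡ (Y , (a ∷ X) ∷ D) → merged a (L , D) ≡ 0 → StepView a L D
    merge : ∀ D1 Pp S D2 → D ≡ D1 ++ (Pp ++ a ∷ S) ∷ D2 → a ∉ L →
             step a (L , D) ≡ ((S ++ Pp) ++ a ∷ L , D1 ++ D2) → merged a (L , D) ≡ 1 → StepView a L D
    extend : a ∉ L → a ∉ concat D → step a (L , D) ≡ (a ∷ L , D) → merged a (L , D) ≡ 0 → StepView a L D

  stepView : ∀ a L D → StepView a L D
  stepView a L D with cutAt a L in e1
  ... | just (X , Y) with cutAt-just a L e1
  ... | eL , nX = split X Y eL nX (cong (stepCut a L D) e1) (cong (λ r → mergedCut r (findCycle a D)) e1)
  stepView a L D | nothing with findCycle a D in e2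
  ... | just (D′ , Rt) with findCycle-just a D e2
  ... | D1 , Pp , S , D2 , eD , refl , refl =
    merge D1 Pp S D2 eD (cutAt-nothing a L e1)
      (trans (cong (stepCut a L D) e1) (cong (stepFind a L D) e2))
      (trans (cong (λ r → mergedCut r (findCycle a D)) e1) (cong mergedFind e2))
  stepView a L D | nothing | nothing =
    extend (cutAt-nothing a L e1) (findCycle-nothing a D e2)
      (trans (cong (stepCut a L D) e1) (cong (stepFind a L D) e2))
      (trans (cong (λ r → mergedCut r (findCycle a D)) e1) (cong mergedFind e2))

  distinct-∷⇒≢ : ∀ F → Distinct (zero ∷ F) → ∀ (y : Point) → y ∈ F → y ≢ zero
  distinct-∷⇒≢ F U y p refl = distinct-head F U p

  ∘star-other : ∀ (σ : Point → Point) (a y : Point) → y ≢ zero → y ≢ a → σ (star a y) ≡ σ y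
  ∘star-other σ a y h1 h2 = cong σ (star-other a y h1 h2)

  split-≈occ : ∀ (a : Point) X Y cD → (Y ++ (a ∷ X) ++ cD) ≈occ ((X ++ a ∷ Y) ++ cD)
  split-≈occ a X Y cD x = begin
      occ x (Y ++ (a ∷ X) ++ cD)
    ≡⟨ occ-++ x Y _ ⟩
      occ x Y + occ x ((a ∷ X) ++ cD)
    ≡⟨ cong (occ x Y +_) (occ-++ x (a ∷ X) cD) ⟩
      occ x Y + (occ x (a ∷ X) + occ x cD)
    ≡⟨ cong (λ z → occ x Y + (z + occ x cD)) (occ-++ x [ a ] X) ⟩
      occ x Y + ((occ x (a ∷ []) + occ x X) + occ x cD)
    ≡⟨ solve 4 (λ y o a′ d → y :+ ((a′ :+ o) :+ d) := (o :+ (a′ :+ y)) :+ d) refl (occ x Y) (occ x X) (occ x (a ∷ [])) (occ x cD) ⟩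
      (occ x X + (occ x (a ∷ []) + occ x Y)) + occ x cD
    ≡⟨ cong (λ z → (occ x X + z) + occ x cD) (sym (occ-++ x [ a ] Y)) ⟩
      (occ x X + occ x (a ∷ Y)) + occ x cD
    ≡⟨ cong (_+ occ x cD) (sym (occ-++ x X (a ∷ Y))) ⟩
      occ x (X ++ a ∷ Y) + occ x cD
    ≡⟨ sym (occ-++ x (X ++ a ∷ Y) cD) ⟩
      occ x ((X ++ a ∷ Y) ++ cD)
    ∎
    where open ≡-Reasoning

  merge-≈occ : ∀ (a : Point) L Pp S D1 D2 → (((S ++ Pp) ++ a ∷ L) ++ concat (D1 ++ D2)) ≈occ (L ++ concat (D1 ++ (Pp ++ a ∷ S) ∷ D2))
  merge-≈occ a L Pp S D1 D2 x = begin
      occ x (((S ++ Pp) ++ a ∷ L) ++ concat (D1 ++ D2))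
    ≡⟨ cong (λ z → occ x (((S ++ Pp) ++ a ∷ L) ++ z)) (sym (concat-++ D1 D2)) ⟩
      occ x (((S ++ Pp) ++ a ∷ L) ++ (concat D1 ++ concat D2))
    ≡⟨ occ-++ x ((S ++ Pp) ++ a ∷ L) _ ⟩
      occ x ((S ++ Pp) ++ a ∷ L) + occ x (concat D1 ++ concat D2)
    ≡⟨ cong₂ _+_ (occ-++ x (S ++ Pp) (a ∷ L)) (occ-++ x (concat D1) (concat D2)) ⟩
      (occ x (S ++ Pp) + occ x (a ∷ L)) + (occ x (concat D1) + occ x (concat D2))
    ≡⟨ cong₂ (λ u v → (u + v) + (occ x (concat D1) + occ x (concat D2))) (occ-++ x S Pp) (occ-++ x [ a ] L) ⟩
      ((occ x S + occ x Pp) + (occ x (a ∷ []) + occ x L)) + (occ x (concat D1) + occ x (concat D2))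
    ≡⟨ solve 6 (λ s p a′ l d1 d2 → ((s :+ p) :+ (a′ :+ l)) :+ (d1 :+ d2) := l :+ (d1 :+ ((p :+ (a′ :+ s)) :+ d2))) refl
         (occ x S) (occ x Pp) (occ x (a ∷ [])) (occ x L) (occ x (concat D1)) (occ x (concat D2)) ⟩
      occ x L + (occ x (concat D1) + ((occ x Pp + (occ x (a ∷ []) + occ x S)) + occ x (concat D2)))
    ≡⟨ cong (λ z → occ x L + (occ x (concat D1) + ((occ x Pp + z) + occ x (concat D2)))) (sym (occ-++ x [ a ] S)) ⟩
      occ x L + (occ x (concat D1) + ((occ x Pp + occ x (a ∷ S)) + occ x (concat D2)))
    ≡⟨ cong (λ z → occ x L + (occ x (concat D1) + (z + occ x (concat D2)))) (sym (occ-++ x Pp (a ∷ S))) ⟩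
      occ x L + (occ x (concat D1) + (occ x (Pp ++ a ∷ S) + occ x (concat D2)))
    ≡⟨ cong (λ z → occ x L + (occ x (concat D1) + z)) (sym (occ-++ x (Pp ++ a ∷ S) (concat D2))) ⟩
      occ x L + (occ x (concat D1) + occ x ((Pp ++ a ∷ S) ++ concat D2))
    ≡⟨ cong (occ x L +_) (sym (occ-++ x (concat D1) _)) ⟩
      occ x L + occ x (concat D1 ++ (Pp ++ a ∷ S) ++ concat D2)
    ≡⟨ cong (λ z → occ x L + occ x z) (concat-++ D1 ((Pp ++ a ∷ S) ∷ D2)) ⟩
      occ x L + occ x (concat (D1 ++ (Pp ++ a ∷ S) ∷ D2))
    ≡⟨ sym (occ-++ x L _) ⟩
      occ x (L ++ concat (D1 ++ (Pp ++ a ∷ S) ∷ D2))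
    ∎
    where open ≡-Reasoning

  extend-distinct : ∀ (a : Point) F → a ≢ zero → a ∉ F → Distinct (zero ∷ F) → Distinct (zero ∷ a ∷ F)
  extend-distinct a F az aF U x with a ≟ x
  ... | no ne rewrite occ-drop {x = x} {a = a} [ zero ] F ne = U x
  ... | yes refl rewrite occ-there {x = a} {y = zero} (a ∷ F) (λ e → az (sym e)) | occ-here a F | ∉⇒occ≡0 {x = a} F aF = ≤-refl

  step-distinct : ∀ a L D → a ≢ zero → Distinct (zero ∷ L ++ concat D) → Distinct (zero ∷ points (step a (L , D)))
  step-distinct a L D az U with stepView a L D
  ... | split X Y refl nX eS _ rewrite eS =
    ≈occ-distinct {xs = zero ∷ (X ++ a ∷ Y) ++ concat D} {ys = zero ∷ Y ++ (a ∷ X) ++ concat D} (λ x → sym (≈occ-cons zero (split-≈occ a X Y (concat D)) x)) U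
  ... | merge D1 Pp S D2 refl nL eS _ rewrite eS =
    ≈occ-distinct {xs = zero ∷ L ++ concat (D1 ++ (Pp ++ a ∷ S) ∷ D2)} {ys = zero ∷ ((S ++ Pp) ++ a ∷ L) ++ concat (D1 ++ D2)}
      (λ x → sym (≈occ-cons zero (merge-≈occ a L Pp S D1 D2) x)) U
  ... | extend nL nD eS _ rewrite eS =
    extend-distinct a (L ++ concat D) az (λ p → [ nL , nD ]′ (∈-++⁻ L p)) U

  step-points⁺ : ∀ a L D y → y ∈ L ++ concat D → y ∈ points (step a (L , D))
  step-points⁺ a L D y p with stepView a L D
  ... | split X Y refl nX eS _ rewrite eS = ≈occ-∈ (λ x → sym (split-≈occ a X Y (concat D) x)) p
  ... | merge D1 Pp S D2 refl nL eS _ rewrite eS = ≈occ-∈ (λ x → sym (merge-≈occ a L Pp S D1 D2 x)) p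
  ... | extend nL nD eS _ rewrite eS = there p

  step-points-new : ∀ a L D → a ∈ points (step a (L , D))
  step-points-new a L D with stepView a L D
  ... | split X Y refl nX eS _ rewrite eS = ∈-++⁺ʳ Y (∈-++⁺ˡ {ys = (concat D)} (here refl))
  ... | merge D1 Pp S D2 refl nL eS _ rewrite eS = ∈-++⁺ˡ {ys = (concat (D1 ++ D2))} (∈-++⁺ʳ (S ++ Pp) (here refl))
  ... | extend nL nD eS _ rewrite eS = here refl

  step-points⁻ : ∀ a L D y → y ∈ points (step a (L , D)) → y ∈ L ++ concat D ⊎ y ≡ a
  step-points⁻ a L D y p with stepView a L D
  ... | split X Y refl nX eS _ rewrite eS = inj₁ (≈occ-∈ (split-≈occ a X Y (concat D)) p)
  ... | merge D1 Pp S D2 refl nL eS _ rewrite eS = inj₁ (≈occ-∈ (merge-≈occ a L Pp S D1 D2) p)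
  ... | extend nL nD eS _ rewrite eS with p
  ... | here e = inj₂ e
  ... | there q = inj₁ q

  split-represents : ∀ σ a X Y D → a ∉ X → Distinct (zero ∷ (X ++ a ∷ Y) ++ concat D) →
    Represents σ (X ++ a ∷ Y , D) → Represents (λ x → σ (star a x)) (Y , (a ∷ X) ∷ D)
  split-represents σ a X Y D nX U (ch , cs , oth) = chain₀ , (cycle ∷ cycles) , fixed
    where
    σ′ : Point → Point
    σ′ x = σ (star a x)
    F = (X ++ a ∷ Y) ++ concat D
    U′ = distinct-tail {x = zero} F U
    UL = distinct-++⁻ˡ (X ++ a ∷ Y) (concat D) U′
    aY : a ∉ Y
    aY = distinct-head Y (distinct-++⁻ʳ X (a ∷ Y) UL)
    aD : a ∉ concat D
    aD p = distinct-disjoint (X ++ a ∷ Y) (concat D) U′ (∈-++⁺ʳ X (here refl)) p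
    c12 = chain-++⁻ σ zero X a Y zero ch
    chain₀ : Chain σ′ zero Y zero
    chain₀ = chain-transport σ σ′ a zero Y zero (proj₂ c12) refl
      (λ y p → ∘star-other σ a y (distinct-∷⇒≢ F U y (∈-++⁺ˡ {ys = (concat D)} (∈-++⁺ʳ X (there p)))) (λ e → aY (subst (_∈ Y) e p)))
    cycle : Chain σ′ a X a
    cycle = chain-transport σ σ′ zero a X a (proj₁ c12) (cong σ (star-self a))
      (λ y p → ∘star-other σ a y (distinct-∷⇒≢ F U y (∈-++⁺ˡ {ys = (concat D)} (∈-++⁺ˡ {ys = (a ∷ Y)} p))) (λ e → nX (subst (_∈ X) e p)))
    cycles : All (IsCycle σ′) D
    cycles = cycles-transport σ σ′ D cs
      (λ y p → ∘star-other σ a y (distinct-∷⇒≢ F U y (∈-++⁺ʳ (X ++ a ∷ Y) p)) (λ e → aD (subst (_∈ concat D) e p)))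
    fixed : ∀ x → x ∉ zero ∷ Y ++ (a ∷ X) ++ concat D → σ′ x ≡ x
    fixed x h = trans (∘star-other σ a x (λ e → h (here e)) (λ e → h (there (subst (_∈ Y ++ (a ∷ X) ++ concat D) (sym e) (∈-++⁺ʳ Y (here refl))))))
      (oth x (λ { (here e) → h (here e) ; (there q) → h (there (≈occ-∈ (λ z → sym (split-≈occ a X Y (concat D) z)) q)) }))

  merge-represents : ∀ σ a L Pp S D1 D2 → a ∉ L → Distinct (zero ∷ L ++ concat (D1 ++ (Pp ++ a ∷ S) ∷ D2)) →
    Represents σ (L , D1 ++ (Pp ++ a ∷ S) ∷ D2) → Represents (λ x → σ (star a x)) ((S ++ Pp) ++ a ∷ L , D1 ++ D2)
  merge-represents σ a L Pp S D1 D2 nL U (ch , cs , oth) = chain₀ , cycles , fixed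
    where
    σ′ : Point → Point
    σ′ x = σ (star a x)
    C = Pp ++ a ∷ S
    F = L ++ concat (D1 ++ C ∷ D2)
    U′ = distinct-tail {x = zero} F U
    UD : Distinct (concat D1 ++ C ++ concat D2)
    UD = subst Distinct (sym (concat-++ D1 (C ∷ D2))) (distinct-++⁻ʳ L _ U′)
    UC2 = distinct-++⁻ʳ (concat D1) _ UD
    UC = distinct-++⁻ˡ C (concat D2) UC2
    aS : a ∉ S
    aS = distinct-head S (distinct-++⁻ʳ Pp (a ∷ S) UC)
    aPp : a ∉ Pp
    aPp p = distinct-disjoint Pp (a ∷ S) UC p (here refl)
    aSP : a ∉ S ++ Pp
    aSP p = [ aS , aPp ]′ (∈-++⁻ S p)
    aC : a ∈ C
    aC = ∈-++⁺ʳ Pp (here refl)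
    inF-C : ∀ {y : Point} → y ∈ C → y ∈ F
    inF-C {y} p = ∈-++⁺ʳ L (subst (y ∈_) (concat-++ D1 (C ∷ D2)) (∈-++⁺ʳ (concat D1) (∈-++⁺ˡ {ys = (concat D2)} p)))
    inC-SP : ∀ {y : Point} → y ∈ S ++ Pp → y ∈ C
    inC-SP {y} p with ∈-++⁻ S p
    ... | inj₁ q = ∈-++⁺ʳ Pp (there q)
    ... | inj₂ q = ∈-++⁺ˡ {ys = (a ∷ S)} q
    cs1 = Allₚ.++⁻ˡ D1 cs
    cs2 = Allₚ.++⁻ʳ D1 cs
    hC : IsCycle σ C
    hC with cs2
    ... | h ∷ _ = h
    csD2 : All (IsCycle σ) D2
    csD2 with cs2
    ... | _ ∷ t = t
    rot = chain-rotate σ Pp a S hC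
    chain₀ : Chain σ′ zero ((S ++ Pp) ++ a ∷ L) zero
    chain₀ = chain-++⁺ σ′ zero (S ++ Pp) a L zero
      (chain-transport σ σ′ a zero (S ++ Pp) a rot refl
        (λ y p → ∘star-other σ a y (distinct-∷⇒≢ F U y (inF-C (inC-SP p))) (λ e → aSP (subst (_∈ S ++ Pp) e p))))
      (chain-transport σ σ′ zero a L zero ch (cong σ (star-self a))
        (λ y p → ∘star-other σ a y (distinct-∷⇒≢ F U y (∈-++⁺ˡ {ys = _} p)) (λ e → nL (subst (_∈ L) e p))))
    inF-D12 : ∀ {y : Point} → y ∈ concat (D1 ++ D2) → (y ∈ F) × (y ≢ a)
    inF-D12 {y} p with ∈-++⁻ (concat D1) (subst (y ∈_) (sym (concat-++ D1 D2)) p)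
    ... | inj₁ q = ∈-++⁺ʳ L (subst (y ∈_) (concat-++ D1 (C ∷ D2)) (∈-++⁺ˡ {ys = _} q)) ,
                   (λ e → distinct-disjoint (concat D1) (C ++ concat D2) UD (subst (_∈ concat D1) e q) (∈-++⁺ˡ {ys = (concat D2)} aC))
    ... | inj₂ q = ∈-++⁺ʳ L (subst (y ∈_) (concat-++ D1 (C ∷ D2)) (∈-++⁺ʳ (concat D1) (∈-++⁺ʳ C q))) ,
                   (λ e → distinct-disjoint C (concat D2) UC2 aC (subst (_∈ concat D2) e q))
    cycles : All (IsCycle σ′) (D1 ++ D2)
    cycles = cycles-transport σ σ′ (D1 ++ D2) (Allₚ.++⁺ cs1 csD2)
      (λ y p → ∘star-other σ a y (distinct-∷⇒≢ F U y (proj₁ (inF-D12 p))) (proj₂ (inF-D12 p)))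
    fixed : ∀ x → x ∉ zero ∷ ((S ++ Pp) ++ a ∷ L) ++ concat (D1 ++ D2) → σ′ x ≡ x
    fixed x h = trans (∘star-other σ a x (λ e → h (here e))
        (λ e → h (there (subst (_∈ ((S ++ Pp) ++ a ∷ L) ++ concat (D1 ++ D2)) (sym e) (∈-++⁺ˡ {ys = (concat (D1 ++ D2))} (∈-++⁺ʳ (S ++ Pp) (here refl)))))))
      (oth x (λ { (here e) → h (here e) ; (there q) → h (there (≈occ-∈ (λ z → sym (merge-≈occ a L Pp S D1 D2 z)) q)) }))

  extend-represents : ∀ σ a L D → a ≢ zero → a ∉ L → a ∉ concat D → Distinct (zero ∷ L ++ concat D) →
    Represents σ (L , D) → Represents (λ x → σ (star a x)) (a ∷ L , D)
  extend-represents σ a L D az nL nD U (ch , cs , oth) = chain₀ , cycles , fixed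
    where
    σ′ : Point → Point
    σ′ x = σ (star a x)
    F = L ++ concat D
    aF : a ∉ F
    aF p = [ nL , nD ]′ (∈-++⁻ L p)
    σa : σ a ≡ a
    σa = oth a (λ { (here e) → az e ; (there q) → aF q })
    chain₀ : Chain σ′ zero (a ∷ L) zero
    chain₀ = σa , chain-transport σ σ′ zero a L zero ch (cong σ (star-self a))
        (λ y p → ∘star-other σ a y (distinct-∷⇒≢ F U y (∈-++⁺ˡ {ys = _} p)) (λ e → nL (subst (_∈ L) e p)))
    cycles : All (IsCycle σ′) D
    cycles = cycles-transport σ σ′ D cs
      (λ y p → ∘star-other σ a y (distinct-∷⇒≢ F U y (∈-++⁺ʳ L p)) (λ e → nD (subst (_∈ concat D) e p)))
    fixed : ∀ x → x ∉ zero ∷ a ∷ L ++ concat D → σ′ x ≡ x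
    fixed x h = trans (∘star-other σ a x (λ e → h (here e)) (λ e → h (there (here e))))
      (oth x (λ { (here e) → h (here e) ; (there q) → h (there (there q)) }))

  step-represents : ∀ σ a L D → a ≢ zero → Distinct (zero ∷ L ++ concat D) → Represents σ (L , D) →
    Represents (λ x → σ (star a x)) (step a (L , D))
  step-represents σ a L D az U r with stepView a L D
  ... | split X Y refl nX eS _ rewrite eS = split-represents σ a X Y D nX U r
  ... | merge D1 Pp S D2 refl nL eS _ rewrite eS = merge-represents σ a L Pp S D1 D2 nL U r
  ... | extend nL nD eS _ rewrite eS = extend-represents σ a L D az nL nD U r

  run-represents : ∀ w σ L D → AllNonZero w → Distinct (zero ∷ L ++ concat D) → Represents σ (L , D) →
          Represents (λ x → σ (prod w x)) (run w (L , D))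
  run-represents [] σ L D _ U r = r
  run-represents (a ∷ w) σ L D (az ∷ as) U r =
    run-represents w (λ x → σ (star a x)) (proj₁ (step a (L , D))) (proj₂ (step a (L , D))) as (step-distinct a L D az U) (step-represents σ a L D az U r)

  run-distinct : ∀ w s → AllNonZero w → Distinct (zero ∷ points s) → Distinct (zero ∷ points (run w s))
  run-distinct [] s _ U = U
  run-distinct (a ∷ w) (L , D) (az ∷ as) U = run-distinct w (step a (L , D)) as (step-distinct a L D az U)

  represents-unique : ∀ σ σ′ L D → Represents σ (L , D) → Represents σ′ (L , D) → ∀ x → σ x ≡ σ′ x
  represents-unique σ σ′ L D (c , cs , o) (c′ , cs′ , o′) x with x ∈? (zero ∷ L ++ concat D)
  ... | no h = trans (o x h) (sym (o′ x h))
  ... | yes (here refl) = chain-agree σ σ′ zero L zero c c′ zero (here refl)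
  ... | yes (there p) with ∈-++⁻ L p
  ... | inj₁ q = chain-agree σ σ′ zero L zero c c′ x (there q)
  ... | inj₂ q with ∈-concat⁻′ D q
  ... | C , xC , CD with All.lookup cs CD | All.lookup cs′ CD
  ... | h | h′ with C
  ... | c0 ∷ cs0 = chain-agree σ σ′ c0 cs0 c0 h h′ x xC

  represents-resp : ∀ σ σ′ L D → (∀ x → σ x ≡ σ′ x) → Represents σ (L , D) → Represents σ′ (L , D)
  represents-resp σ σ′ L D e (c , cs , o) =
    chain-transport σ σ′ zero zero L zero c (sym (e zero)) (λ y _ → sym (e y)) ,
    cycles-transport σ σ′ D cs (λ y _ → sym (e y)) ,
    (λ x h → trans (sym (e x)) (o x h))

  size : State → ℕ
  size (L , D) = length (L ++ concat D) + length D

  size-step : ∀ a L D → suc (size (L , D)) ≡ size (step a (L , D)) + 2 * merged a (L , D)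
  size-step a L D with stepView a L D
  ... | split X Y refl nX eS em rewrite eS | em =
    trans (cong (λ z → suc (z + length D)) (sym (≈occ-length (Y ++ (a ∷ X) ++ concat D) ((X ++ a ∷ Y) ++ concat D) (split-≈occ a X Y (concat D)))))
          (trans (sym (+-suc _ (length D))) (sym (+-identityʳ _)))
  ... | merge D1 Pp S D2 refl nL eS em rewrite eS | em =
    begin
      suc (length (L ++ concat (D1 ++ (Pp ++ a ∷ S) ∷ D2)) + length (D1 ++ (Pp ++ a ∷ S) ∷ D2))
    ≡⟨ cong₂ (λ u v → suc (u + v)) (sym (≈occ-length (((S ++ Pp) ++ a ∷ L) ++ concat (D1 ++ D2)) (L ++ concat (D1 ++ (Pp ++ a ∷ S) ∷ D2)) (merge-≈occ a L Pp S D1 D2))) (length-++ D1) ⟩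
      suc (length (((S ++ Pp) ++ a ∷ L) ++ concat (D1 ++ D2)) + (length D1 + suc (length D2)))
    ≡⟨ cong (λ v → suc (length (((S ++ Pp) ++ a ∷ L) ++ concat (D1 ++ D2)) + v)) (+-suc (length D1) (length D2)) ⟩
      suc (length (((S ++ Pp) ++ a ∷ L) ++ concat (D1 ++ D2)) + suc (length D1 + length D2))
    ≡⟨ cong (λ v → suc (length (((S ++ Pp) ++ a ∷ L) ++ concat (D1 ++ D2)) + suc v)) (sym (length-++ D1)) ⟩
      suc (length (((S ++ Pp) ++ a ∷ L) ++ concat (D1 ++ D2)) + suc (length (D1 ++ D2)))
    ≡⟨ solve 2 (λ u v → con 1 :+ (u :+ (con 1 :+ v)) := (u :+ v) :+ con 2 :* con 1) refl
         (length (((S ++ Pp) ++ a ∷ L) ++ concat (D1 ++ D2))) (length (D1 ++ D2)) ⟩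
      length (((S ++ Pp) ++ a ∷ L) ++ concat (D1 ++ D2)) + length (D1 ++ D2) + 2 * 1
    ∎
    where open ≡-Reasoning
  ... | extend nL nD eS em rewrite eS | em = sym (+-identityʳ _)

  size-run : ∀ w L D → length w + size (L , D) ≡ size (run w (L , D)) + 2 * merges w (L , D)
  size-run [] L D = sym (+-identityʳ _)
  size-run (a ∷ w) L D =
    begin
      suc (length w + size (L , D))
    ≡⟨ sym (+-suc (length w) _) ⟩
      length w + suc (size (L , D))
    ≡⟨ cong (length w +_) (size-step a L D) ⟩
      length w + (size s′ + 2 * merged a (L , D))
    ≡⟨ sym (+-assoc (length w) _ _) ⟩
      (length w + size s′) + 2 * merged a (L , D)
    ≡⟨ cong (_+ 2 * merged a (L , D)) (size-run w (proj₁ s′) (proj₂ s′)) ⟩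
      (size (run w s′) + 2 * merges w s′) + 2 * merged a (L , D)
    ≡⟨ solve 3 (λ u v m → (u :+ con 2 :* v) :+ con 2 :* m := u :+ con 2 :* (m :+ v)) refl (size (run w s′)) (merges w s′) (merged a (L , D)) ⟩
      size (run w s′) + 2 * (merged a (L , D) + merges w s′)
    ∎
    where
    open ≡-Reasoning
    s′ = step a (L , D)

  nonzero⊆⇒k≤length : ∀ (F : List Point) → (∀ (x : Point) → x ≢ zero → x ∈ F) → k ≤ length F
  nonzero⊆⇒k≤length F h = Finₚ.injective⇒≤ {f = f} inj
    where
    f : Fin k → Fin (length F)
    f i = index (h (suc i) (λ ()))
    inj : Injective _≡_ _≡_ f
    inj {i} {j} e = Finₚ.suc-injective (trans (lookup-index (h (suc i) (λ ()))) (trans (cong (lookup F) e) (sym (lookup-index (h (suc j) (λ ()))))))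

  MergeFree : List Point → State → Set
  MergeFree v s = merges v s ≡ 0

  data MergeFreeStep (a : Point) (L : List Point) (D : List (List Point)) (v : List Point) : Set where
    mf-split : ∀ X Y → L ≡ X ++ a ∷ Y → a ∉ X → step a (L , D) ≡ (Y , (a ∷ X) ∷ D) → MergeFree v (Y , (a ∷ X) ∷ D) → MergeFreeStep a L D v
    mf-extend : a ∉ L → a ∉ concat D → step a (L , D) ≡ (a ∷ L , D) → MergeFree v (a ∷ L , D) → MergeFreeStep a L D v

  mergeFreeStep : ∀ a v L D → MergeFree (a ∷ v) (L , D) → MergeFreeStep a L D v
  mergeFreeStep a v L D h with stepView a L D
  ... | split X Y eL nX eS em = mf-split X Y eL nX eS (subst (MergeFree v) eS (m+n≡0⇒n≡0 (merged a (L , D)) h))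
  ... | extend nL nD eS em = mf-extend nL nD eS (subst (MergeFree v) eS (m+n≡0⇒n≡0 (merged a (L , D)) h))
  ... | merge D1 Pp S D2 eD nL eS em with trans (sym em) (m+n≡0⇒m≡0 (merged a (L , D)) h)
  ... | ()

  run-points⁺ : ∀ v s y → y ∈ points s → y ∈ points (run v s)
  run-points⁺ [] s y p = p
  run-points⁺ (a ∷ v) (L , D) y p = run-points⁺ v (step a (L , D)) y (step-points⁺ a L D y p)

  run-points-new : ∀ v s y → y ∈ v → y ∈ points (run v s)
  run-points-new (a ∷ v) (L , D) .a (here refl) = run-points⁺ v (step a (L , D)) a (step-points-new a L D)
  run-points-new (a ∷ v) (L , D) y (there p) = run-points-new v (step a (L , D)) y p

  run-points⁻ : ∀ v s y → y ∈ points (run v s) → y ∈ points s ⊎ y ∈ v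
  run-points⁻ [] s y p = inj₁ p
  run-points⁻ (a ∷ v) (L , D) y p with run-points⁻ v (step a (L , D)) y p
  ... | inj₂ q = inj₂ (there q)
  ... | inj₁ q with step-points⁻ a L D y q
  ... | inj₁ r = inj₁ r
  ... | inj₂ refl = inj₂ (here refl)

  closed-persist : ∀ v s → MergeFree v s → ∀ C → C ∈ proj₂ s → C ∈ proj₂ (run v s)
  closed-persist [] s _ C p = p
  closed-persist (a ∷ v) (L , D) h C p with mergeFreeStep a v L D h
  ... | mf-split X Y eL nX eS h′ rewrite eS = closed-persist v _ h′ C (there p)
  ... | mf-extend nL nD eS h′ rewrite eS = closed-persist v _ h′ C p

  closed-unused : ∀ v s → MergeFree v s → Distinct (zero ∷ points s) → AllNonZero v → ∀ x → x ∈ concat (proj₂ s) → x ∉ v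
  closed-unused (a ∷ v) (L , D) h U (az ∷ nzs) x p q with mergeFreeStep a v L D h
  ... | mf-split X Y refl nX eS h′ with q
  ... | here refl = distinct-disjoint (X ++ x ∷ Y) (concat D) (distinct-tail {x = zero} _ U) (∈-++⁺ʳ X (here refl)) p
  ... | there q′ = closed-unused v (Y , (a ∷ X) ∷ D) h′ (subst (λ s → Distinct (zero ∷ points s)) eS (step-distinct a _ D az U)) nzs x (∈-++⁺ʳ (a ∷ X) p) q′
  closed-unused (a ∷ v) (L , D) h U (az ∷ nzs) x p q | mf-extend nL nD eS h′ with q
  ... | here refl = nD p
  ... | there q′ = closed-unused v (a ∷ L , D) h′ (subst (λ s → Distinct (zero ∷ points s)) eS (step-distinct a L D az U)) nzs x p q′

  reused-closes : ∀ v s → MergeFree v s → Distinct (zero ∷ points s) → AllNonZero v → ∀ x → x ∈ points s → x ∈ v →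
    ∃ λ C → C ∈ proj₂ (run v s) × x ∈ C
  reused-closes (a ∷ v) (L , D) h U (az ∷ nzs) x p q with mergeFreeStep a v L D h
  ... | mf-split X Y refl nX eS h′ rewrite eS with q
  ... | here refl = (a ∷ X) , closed-persist v _ h′ _ (here refl) , here refl
  ... | there q′ = reused-closes v (Y , (a ∷ X) ∷ D) h′ (subst (λ s → Distinct (zero ∷ points s)) eS (step-distinct a _ D az U)) nzs x
                     (subst (λ s → x ∈ points s) eS (step-points⁺ a _ D x p)) q′
  reused-closes (a ∷ v) (L , D) h U (az ∷ nzs) x p q | mf-extend nL nD eS h′ rewrite eS with q
  ... | here refl = ⊥-elim ([ nL , nD ]′ (∈-++⁻ L p))
  ... | there q′ = reused-closes v (a ∷ L , D) h′ (subst (λ s → Distinct (zero ∷ points s)) eS (step-distinct a L D az U)) nzs x (there p) q′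

  used-separated : ∀ v s → MergeFree v s → Distinct (zero ∷ points s) → AllNonZero v → ∀ A x B y → proj₁ s ≡ A ++ x ∷ B → y ∈ B → x ∈ v →
    ∃ λ C → C ∈ proj₂ (run v s) × x ∈ C × y ∉ C
  used-separated (a ∷ v) (L , D) h U (az ∷ nzs) A x B y eL yB xv with mergeFreeStep a v L D h
  ... | mf-extend nL nD eS h′ rewrite eS with xv
  ... | here refl = ⊥-elim (nL (subst (x ∈_) (sym eL) (∈-++⁺ʳ A (here refl))))
  ... | there q = used-separated v (a ∷ L , D) h′ (subst (λ s → Distinct (zero ∷ points s)) eS (step-distinct a L D az U)) nzs (a ∷ A) x B y (cong (a ∷_) eL) yB q
  used-separated (a ∷ v) (L , D) h U (az ∷ nzs) A x B y eL yB xv | mf-split X Y eL′ nX eS h′ rewrite eS with ++-∷-cases X A (trans (sym eL′) eL)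
  ... | inj₁ (refl , refl , refl) = (a ∷ X) , closed-persist v _ h′ _ (here refl) , here refl , yC
    where
    UL : Distinct (X ++ a ∷ B)
    UL = distinct-++⁻ˡ (X ++ a ∷ B) (concat D) (subst (λ l → Distinct (l ++ concat D)) eL′ (distinct-tail {x = zero} _ U))
    yC : y ∉ a ∷ X
    yC (here refl) = distinct-head B (distinct-++⁻ʳ X (a ∷ B) UL) yB
    yC (there p) = distinct-disjoint X (a ∷ B) UL p (there yB)
  ... | inj₂ (inj₁ (M , refl , e3)) with xv
  ... | here refl = ⊥-elim (nX (∈-++⁺ʳ A (here refl)))
  ... | there q = ⊥-elim (closed-unused v (Y , (a ∷ X) ∷ D) h′ U′ nzs x (∈-++⁺ˡ {ys = (concat D)} (there (∈-++⁺ʳ A (here refl)))) q)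
    where
    U′ = subst (λ s → Distinct (zero ∷ points s)) eS (step-distinct a L D az U)
  used-separated (a ∷ v) (L , D) h U (az ∷ nzs) A x B y eL yB xv | mf-split X Y eL′ nX eS h′ | inj₂ (inj₂ (M , refl , e3)) with xv
  ... | here refl = ⊥-elim (distinct-head Y (distinct-++⁻ʳ X (a ∷ Y) UL) (subst (x ∈_) (sym e3) (∈-++⁺ʳ M (here refl))))
    where
    UL : Distinct (X ++ a ∷ Y)
    UL = distinct-++⁻ˡ (X ++ a ∷ Y) (concat D) (subst (λ l → Distinct (l ++ concat D)) eL′ (distinct-tail {x = zero} _ U))
  ... | there q = used-separated v (Y , (a ∷ X) ∷ D) h′ (subst (λ s → Distinct (zero ∷ points s)) eS (step-distinct a L D az U)) nzs M x B y e3 yB q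

  ChainOff : List Point → (Point → Point) → Point → List Point → Point → Set
  ChainOff v σ x [] z = x ∉ v → σ x ≡ z
  ChainOff v σ x (y ∷ ys) z = (x ∉ v → σ x ≡ y) × ChainOff v σ y ys z

  OpenChainOff : List Point → (Point → Point) → List Point → Set
  OpenChainOff v σ [] = ⊤
  OpenChainOff v σ (y ∷ ys) = ChainOff v σ y ys zero

  chain⇒chainOff : ∀ v σ x ys z → Chain σ x ys z → ChainOff v σ x ys z
  chain⇒chainOff v σ x [] z c = λ _ → c
  chain⇒chainOff v σ x (y ∷ ys) z (c1 , c2) = (λ _ → c1) , chain⇒chainOff v σ y ys z c2

  chainOff-∷ : ∀ a v σ x ys z → ChainOff v σ x ys z → ChainOff (a ∷ v) σ x ys z
  chainOff-∷ a v σ x [] z h = λ n → h (λ p → n (there p))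
  chainOff-∷ a v σ x (y ∷ ys) z (h1 , h2) = (λ n → h1 (λ p → n (there p))) , chainOff-∷ a v σ y ys z h2

  chainOff-++ : ∀ v σ x ys y zs z → ChainOff v σ x ys y → ChainOff v σ y zs z → ChainOff v σ x (ys ++ y ∷ zs) z
  chainOff-++ v σ x [] y zs z h1 h2 = h1 , h2
  chainOff-++ v σ x (y′ ∷ ys) y zs z (h , h1) h2 = h , chainOff-++ v σ y′ ys y zs z h1 h2

  openChainOff-∷ : ∀ a v σ L → OpenChainOff v σ L → OpenChainOff (a ∷ v) σ L
  openChainOff-∷ a v σ [] h = tt
  openChainOff-∷ a v σ (y ∷ ys) h = chainOff-∷ a v σ y ys zero h

  openChainOff-head : ∀ a v σ Y → OpenChainOff v σ Y → ChainOff (a ∷ v) σ a Y zero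
  openChainOff-head a v σ [] h = λ n → ⊥-elim (n (here refl))
  openChainOff-head a v σ (y ∷ Y) h = (λ n → ⊥-elim (n (here refl))) , chainOff-∷ a v σ y Y zero h

  represents-backward : ∀ v s σ → MergeFree v s → Represents σ (run v s) → All (IsCycle σ) (proj₂ s) × OpenChainOff v σ (proj₁ s)
  represents-backward [] ([] , D) σ h (c , cs , o) = cs , tt
  represents-backward [] (y ∷ L , D) σ h (c , cs , o) = cs , chain⇒chainOff [] σ y L zero (proj₂ c)
  represents-backward (a ∷ v) (L , D) σ h r with mergeFreeStep a v L D h
  ... | mf-split X Y refl nX eS h′ rewrite eS with represents-backward v (Y , (a ∷ X) ∷ D) σ h′ r
  ... | (cX ∷ cs) , bY = cs , bilX X cX
    where
    bilX : ∀ X → Chain σ a X a → OpenChainOff (a ∷ v) σ (X ++ a ∷ Y)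
    bilX [] c = openChainOff-head a v σ Y bY
    bilX (x1 ∷ X′) (c1 , c2) = chainOff-++ (a ∷ v) σ x1 X′ a Y zero (chain⇒chainOff (a ∷ v) σ x1 X′ a c2) (openChainOff-head a v σ Y bY)
  represents-backward (a ∷ v) (L , D) σ h r | mf-extend nL nD eS h′ rewrite eS with represents-backward v (a ∷ L , D) σ h′ r
  ... | cs , bL = cs , openChainOff-∷ a v σ L (tl L bL)
    where
    tl : ∀ L → ChainOff v σ a L zero → OpenChainOff v σ L
    tl [] _ = tt
    tl (y ∷ L) (_ , w) = w

  star⁻¹-other : ∀ (a x : Point) → x ≢ zero → x ≢ a → transpose zero a ⟨$⟩ˡ x ≡ x
  star⁻¹-other a x n0 na with x ≟ a
  ... | yes e = ⊥-elim (na e)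
  ... | no _ with x ≟ zero
  ... | yes e = ⊥-elim (n0 e)
  ... | no _ = refl

  unused-fixed : ∀ (w : List Point) (x : Point) → x ∉ w → x ≢ zero → ∀ {h} → InGen w h → h x ≡ x
  unused-fixed w x xw xz gen-id = refl
  unused-fixed w x xw xz (gen-mul {i} iw ig) rewrite unused-fixed w x xw xz ig = star-other i x xz (λ e → xw (subst (_∈ w) (sym e) iw))
  unused-fixed w x xw xz (gen-inv {i} iw ig) rewrite unused-fixed w x xw xz ig = star⁻¹-other i x xz (λ e → xw (subst (_∈ w) (sym e) iw))

  transitive⇒covers : ∀ (w : List Point) → TransitiveFact w → ∀ x → x ≢ zero → x ∈ w
  transitive⇒covers w tr x xz with x ∈? w
  ... | yes q = q
  ... | no nq with tr x zero
  ... | h , ig , e = ⊥-elim (xz (trans (sym (unused-fixed w x nq xz ig)) e))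

  covers⇒transitive : ∀ (w : List Point) → (∀ (x : Point) → x ≢ zero → x ∈ w) → TransitiveFact w
  covers⇒transitive w h x y with x ≟ zero | y ≟ zero
  ... | yes refl | yes refl = (λ z → z) , gen-id , refl
  ... | yes refl | no yz = (λ z → star y z) , gen-mul (h y yz) gen-id , refl
  ... | no xz | yes refl = (λ z → star x z) , gen-mul (h x xz) gen-id , star-self x
  ... | no xz | no yz = (λ z → star y (star x z)) , gen-mul (h y yz) (gen-mul (h x xz) gen-id) , cong (star y) (star-self x)

module Orbits (k p : ℕ) (π : Permutation′ (suc k)) (orbits : OrbitListing π (suc p))
               (ℓ : Fin (suc p) → ℕ) (H : ∀ j → OrbitSize π (lead orbits j) (ℓ j)) where

  open StarMachine k

  f : Point → Point
  f x = π ⟨$⟩ʳ x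

  g : Point → Point
  g x = π ⟨$⟩ˡ x

  f∘g : ∀ x → f (g x) ≡ x
  f∘g x = inverseʳ π

  g∘f : ∀ x → g (f x) ≡ x
  g∘f x = inverseˡ π

  f-injective : ∀ {x y} → f x ≡ f y → x ≡ y
  f-injective {x} {y} e = trans (sym (g∘f x)) (trans (cong g e) (g∘f y))

  iter-f-injective : ∀ t {x y} → iter f t x ≡ iter f t y → x ≡ y
  iter-f-injective = iter-injective f f-injective

  iter-g∘iter-f : ∀ t x → iter g t (iter f t x) ≡ x
  iter-g∘iter-f = iter-cancel f g g∘f

  iter-f∘iter-g : ∀ t x → iter f t (iter g t x) ≡ x
  iter-f∘iter-g = iter-cancel g f f∘g

  record Period (x : Point) (l : ℕ) : Set where
    field
      period-pos : 1 ≤ l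
      period-returns : iter f l x ≡ x
      period-minimal : ∀ d → 1 ≤ d → iter f d x ≡ x → l ≤ d
  open Period public

  module _ (a : Point) (l : ℕ) (os : OrbitSize π a l) where
    private
      e = proj₁ os
      einj = proj₁ (proj₂ os)
      spec = proj₂ (proj₂ os)

    orbitSize≤return : ∀ d → 1 ≤ d → iter f d a ≡ a → l ≤ d
    orbitSize≤return (suc d′) _ ed = Finₚ.injective⇒≤ {f = h} inj
      where
      t : Fin l → ℕ
      t i = proj₁ (proj₂ (spec (e i)) (i , refl))
      te : ∀ i → iter f (t i) a ≡ e i
      te i = proj₂ (proj₂ (spec (e i)) (i , refl))
      h : Fin l → Fin (suc d′)
      h i = fromℕ< (m%n<n (t i) (suc d′))
      inj : Injective _≡_ _≡_ h
      inj {i} {j} eq = einj (trans (sym (te i)) (trans (iter-mod-return f (t i) d′ a ed)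
        (trans (cong (λ z → iter f z a) em) (trans (sym (iter-mod-return f (t j) d′ a ed)) (te j)))))
        where
        em : t i % suc d′ ≡ t j % suc d′
        em = trans (sym (Finₚ.toℕ-fromℕ< (m%n<n (t i) (suc d′)))) (trans (cong toℕ eq) (Finₚ.toℕ-fromℕ< (m%n<n (t j) (suc d′))))

    orbitSize⇒period : Period a l
    orbitSize⇒period = record { period-pos = ps ; period-returns = rt ; period-minimal = orbitSize≤return }
      where
      ps : 1 ≤ l
      ps = Fin-nonempty l (proj₁ (proj₁ (spec a) (0 , refl)))
      h′ : Fin (suc l) → Fin l
      h′ t = proj₁ (proj₁ (spec (iter f (toℕ t) a)) (toℕ t , refl))
      he : ∀ t → e (h′ t) ≡ iter f (toℕ t) a
      he t = proj₂ (proj₁ (spec (iter f (toℕ t) a)) (toℕ t , refl))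
      rt : iter f l a ≡ a
      rt with Finₚ.pigeonhole (n<1+n l) h′
      ... | i , j , i<j , eq = subst (λ z → iter f z a ≡ a) dl ed
        where
        d = toℕ j ∸ toℕ i
        ij : toℕ i + d ≡ toℕ j
        ij = m+[n∸m]≡n (<⇒≤ i<j)
        ed : iter f d a ≡ a
        ed = iter-f-injective (toℕ i) (trans (sym (iter-+ f (toℕ i) d a)) (trans (cong (λ z → iter f z a) ij)
               (trans (sym (he j)) (trans (cong e (sym eq)) (he i)))))
        d1 : 1 ≤ d
        d1 = m<n⇒0<n∸m i<j
        dl : d ≡ l
        dl = ≤-antisym (≤-trans (m∸n≤m (toℕ j) (toℕ i)) (≤-pred (Finₚ.toℕ<n j))) (orbitSize≤return d d1 ed)

  period-along-orbit : ∀ a x l → InOrbit π a x → Period a l → Period x l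
  period-along-orbit a x l (t , refl) pa = record
    { period-pos = period-pos pa
    ; period-returns = trans (iter-comm f l t a) (cong (iter f t) (period-returns pa))
    ; period-minimal = λ d d1 ed → period-minimal pa d d1 (iter-f-injective t (trans (sym (iter-comm f d t a)) ed))
    }

  orbitOf : Point → Fin (suc p)
  orbitOf x = proj₁ (covers orbits x)

  inOrbitOf : ∀ x → InOrbit π (lead orbits (orbitOf x)) x
  inOrbitOf x = proj₂ (covers orbits x)

  period-lead : ∀ j → Period (lead orbits j) (ℓ j)
  period-lead j = orbitSize⇒period (lead orbits j) (ℓ j) (H j)

  period : ∀ x → Period x (ℓ (orbitOf x))
  period x = period-along-orbit _ x _ (inOrbitOf x) (period-lead (orbitOf x))

  f-as-iter-g′ : ∀ {x} l → Period x l → f x ≡ iter g (l ∸ 1) x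
  f-as-iter-g′ {x} (suc l′) px = sym (trans (cong (iter g l′) (sym (period-returns px))) (trans (cong (iter g l′) (iter-suc-inner f l′ x)) (iter-g∘iter-f l′ (f x))))

  iter-g-inOrbit′ : ∀ {x} l → Period x l → ∀ i → InOrbit π x (iter g i x)
  iter-g-inOrbit′ {x} l px zero = 0 , refl
  iter-g-inOrbit′ {x} (suc l′) px (suc i) with iter-g-inOrbit′ (suc l′) px i
  ... | t , e = t + l′ , trans (sym (g∘f _)) (cong g (trans c′ e′))
      where
      c′ : f (iter f (t + l′) x) ≡ iter f (t + suc l′) x
      c′ = cong (λ z → iter f z x) (sym (+-suc t l′))
      e′ : iter f (t + suc l′) x ≡ iter g i x
      e′ = trans (iter-+ f t (suc l′) x) (trans (cong (iter f t) (period-returns px)) e)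

  module _ {x : Point} {l : ℕ} (px : Period x l) where
    iter-g-period : iter g l x ≡ x
    iter-g-period = trans (cong (iter g l) (sym (period-returns px))) (iter-g∘iter-f l x)

    f-as-iter-g : f x ≡ iter g (l ∸ 1) x
    f-as-iter-g = f-as-iter-g′ l px

    iter-g-distinct : ∀ i j → i < j → j < l → iter g i x ≢ iter g j x
    iter-g-distinct i j i<j j<l e = 1+n≰n (≤-trans j<l (≤-trans (period-minimal px d (m<n⇒0<n∸m i<j) ed) (m∸n≤m j i)))
      where
      d = j ∸ i
      ed : iter f d x ≡ x
      ed = trans (sym (cong (iter f d) (iter-f∘iter-g i x)))
           (trans (sym (iter-+ f d i (iter g i x)))
           (trans (cong (λ z → iter f z (iter g i x)) (m∸n+n≡m (<⇒≤ i<j)))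
           (trans (cong (iter f j) e) (iter-f∘iter-g j x))))

    inOrbit⇒iter-g : ∀ t → ∃ λ i → i < l × iter g i x ≡ iter f t x
    inOrbit⇒iter-g zero = 0 , period-pos px , refl
    inOrbit⇒iter-g (suc t) with inOrbit⇒iter-g t
    ... | zero , i<l , e = l ∸ 1 , pred< l (period-pos px) , trans (sym f-as-iter-g) (cong f e)
    ... | suc i , i<l , e = i , ≤-trans (n≤1+n (suc i)) i<l , trans (sym (f∘g (iter g i x))) (cong f e)

    iter-g-inOrbit : ∀ i → InOrbit π x (iter g i x)
    iter-g-inOrbit = iter-g-inOrbit′ l px

  inOrbit-sym : ∀ a x → InOrbit π a x → InOrbit π x a
  inOrbit-sym a x (t , e) = subst (InOrbit π x) (trans (cong (iter g t) (sym e)) (iter-g∘iter-f t a)) (iter-g-inOrbit (period x) t)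

  inOrbit-trans : ∀ {a x y} → InOrbit π a x → InOrbit π x y → InOrbit π a y
  inOrbit-trans {a} (t1 , e1) (t2 , e2) = t2 + t1 , trans (iter-+ f t2 t1 a) (trans (cong (iter f t2) e1) e2)

  lead-inj : ∀ {i j} → lead orbits i ≡ lead orbits j → i ≡ j
  lead-inj {i} {j} e with Finₚ.<-cmp i j
  ... | tri< lt _ _ = ⊥-elim (Finₚ.<-irrefl e (increasing orbits i j lt))
  ... | tri≈ _ e′ _ = e′
  ... | tri> _ _ gt = ⊥-elim (Finₚ.<-irrefl (sym e) (increasing orbits j i gt))

  orbitOf-unique : ∀ j x → InOrbit π (lead orbits j) x → orbitOf x ≡ j
  orbitOf-unique j x oj = lead-inj (Finₚ.≤-antisym le1 le2)
    where
    oi = inOrbitOf x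
    le1 = least orbits (orbitOf x) (lead orbits j) (inOrbit-trans oi (inOrbit-sym _ x oj))
    le2 = least orbits j (lead orbits (orbitOf x)) (inOrbit-trans oj (inOrbit-sym _ x oi))

  orbitOf-lead : ∀ j → orbitOf (lead orbits j) ≡ j
  orbitOf-lead j = orbitOf-unique j _ (0 , refl)

  inOrbit⇒same-orbitOf : ∀ {x y} → InOrbit π x y → orbitOf x ≡ orbitOf y
  inOrbit⇒same-orbitOf {x} {y} o = sym (orbitOf-unique (orbitOf x) y (inOrbit-trans (inOrbitOf x) o))

  same-orbitOf⇒inOrbit : ∀ {x y} → orbitOf x ≡ orbitOf y → InOrbit π x y
  same-orbitOf⇒inOrbit {x} {y} e = inOrbit-trans (inOrbit-sym _ x (inOrbitOf x)) (subst (λ j → InOrbit π (lead orbits j) y) (sym e) (inOrbitOf y))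

  orbitOf-0 : orbitOf zero ≡ zero
  orbitOf-0 = lem (orbitOf zero) (least orbits (orbitOf zero) zero (inOrbitOf zero))
    where
    lem : ∀ j → lead orbits j ≤ᶠ zero {k} → j ≡ zero
    lem zero _ = refl
    lem (suc j) le with ≤-trans (increasing orbits zero (suc j) (s≤s z≤n)) le
    ... | ()

  lead-0 : lead orbits zero ≡ zero
  lead-0 = Finₚ.toℕ-injective (n≤0⇒n≡0 (subst (λ j → lead orbits j ≤ᶠ zero {k}) orbitOf-0 (least orbits (orbitOf zero) zero (inOrbitOf zero))))

  cycle-same-orbitOf : ∀ C → IsCycle f C → ∀ {x y} → x ∈ C → y ∈ C → orbitOf x ≡ orbitOf y
  cycle-same-orbitOf C h {x} {y} px py = inOrbit⇒same-orbitOf (cycle-connected f C h x y px py)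

  cycle-full-orbit : ∀ C → IsCycle f C → ∀ {x y} → x ∈ C → orbitOf y ≡ orbitOf x → y ∈ C
  cycle-full-orbit C h {x} {y} px e with same-orbitOf⇒inOrbit {x} {y} (sym e)
  ... | t , et = subst (_∈ C) et (cycle-iter-closed f C h t x px)

  openChain-orbitOf : ∀ L → Chain f zero L zero → ∀ {y} → y ∈ L → orbitOf y ≡ zero
  openChain-orbitOf L c {y} py = trans (sym (cycle-same-orbitOf (zero ∷ L) c (here refl) (there py))) orbitOf-0

  p≤#cycles : ∀ L D → Represents f (L , D) → (∀ (x : Point) → x ≢ zero → x ∈ L ++ concat D) → p ≤ length D
  p≤#cycles L D (ch , cs , _) hx = ≤-pred (Finₚ.injective⇒≤ {f = h} inj)
    where
    Cs = (zero ∷ L) ∷ D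
    hC : All (IsCycle f) Cs
    hC = ch ∷ cs
    mem : ∀ j → lead orbits j ∈ concat Cs
    mem j with lead orbits j ≟ zero
    ... | yes e = here e
    ... | no ne = there (hx _ ne)
    h : Fin (suc p) → Fin (length Cs)
    h j = index (proj₂ (proj₂ (∈-concat⁻′ Cs (mem j))))
    inj : Injective _≡_ _≡_ h
    inj {i} {j} e = trans (sym (orbitOf-lead i)) (trans le (orbitOf-lead j))
      where
      Ci = ∈-concat⁻′ Cs (mem i)
      Cj = ∈-concat⁻′ Cs (mem j)
      eC : proj₁ Ci ≡ proj₁ Cj
      eC = trans (lookup-index (proj₂ (proj₂ Ci))) (trans (cong (lookup Cs) e) (sym (lookup-index (proj₂ (proj₂ Cj)))))
      le : orbitOf (lead orbits i) ≡ orbitOf (lead orbits j)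
      le = cycle-same-orbitOf (proj₁ Ci) (All.lookup hC (proj₂ (proj₂ Ci))) (proj₁ (proj₂ Ci)) (subst (lead orbits j ∈_) (sym eC) (proj₁ (proj₂ Cj)))

  firstIn : Fin (suc p) → List Point → Maybe Point
  firstIn j [] = nothing
  firstIn j (x ∷ v) with orbitOf x ≟ j
  ... | yes _ = just x
  ... | no _ = firstIn j v

  firstIn-skip : ∀ j x v → orbitOf x ≢ j → firstIn j (x ∷ v) ≡ firstIn j v
  firstIn-skip j x v ne with orbitOf x ≟ j
  ... | yes e = ⊥-elim (ne e)
  ... | no _ = refl

  firstIn-hit : ∀ j x v → orbitOf x ≡ j → firstIn j (x ∷ v) ≡ just x
  firstIn-hit j x v e with orbitOf x ≟ j
  ... | yes _ = refl
  ... | no ne = ⊥-elim (ne e)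

  firstIn-spec : ∀ j v {x} → firstIn j v ≡ just x → orbitOf x ≡ j × x ∈ v
  firstIn-spec j [] ()
  firstIn-spec j (y ∷ v) e with orbitOf y ≟ j
  firstIn-spec j (y ∷ v) refl | yes e′ = e′ , here refl
  ... | no _ with firstIn-spec j v e
  ... | a , b = a , there b

  1≤ℓ : ∀ j → 1 ≤ ℓ j
  1≤ℓ j = period-pos (period-lead j)

module LabelWords (p : ℕ) (ℓ : Fin (suc p) → ℕ) (1≤ℓ : ∀ j → 1 ≤ ℓ j) where

  Letter : Set
  Letter = Fin (suc p)

  bump : (Letter → ℕ) → Letter → Letter → ℕ
  bump c j i with i ≟ j
  ... | yes _ = suc (c i)
  ... | no _ = c i

  bump-same : ∀ c j → bump c j j ≡ suc (c j)
  bump-same c j with j ≟ j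
  ... | yes _ = refl
  ... | no ne = ⊥-elim (ne refl)

  bump-other : ∀ c j i → i ≢ j → bump c j i ≡ c i
  bump-other c j i ne with i ≟ j
  ... | yes e = ⊥-elim (ne e)
  ... | no _ = refl

  -- Reading a word from the left: c counts the letters read, Ks is the stack of letters
  -- j ≢ zero begun but not yet read ℓ j + 1 times (top first), and Cl holds the completed ones.
  data Accepts : (Letter → ℕ) → List Letter → List Letter → List Letter → Set where
    done : ∀ {c Cl} → (∀ j → j ≢ zero → j ∈ Cl) → c zero ≡ ℓ zero ∸ 1 → Accepts c [] Cl []
    one : ∀ {c Cl u} → suc (c zero) < ℓ zero → Accepts (bump c zero) [] Cl u → Accepts c [] Cl (zero ∷ u)
    first : ∀ {c Ks Cl u} j → j ≢ zero → j ∉ Ks → j ∉ Cl → c j ≡ 0 → Accepts (bump c j) (j ∷ Ks) Cl u → Accepts c Ks Cl (j ∷ u)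
    again : ∀ {c Ks Cl u} j → j ≢ zero → c j < ℓ j → Accepts (bump c j) (j ∷ Ks) Cl u → Accepts c (j ∷ Ks) Cl (j ∷ u)
    last : ∀ {c Ks Cl u} j → j ≢ zero → c j ≡ ℓ j → Accepts (bump c j) Ks (j ∷ Cl) u → Accepts c (j ∷ Ks) Cl (j ∷ u)

  record StackInv (Ks Cl : List Letter) : Set where
    field
      stack-distinct : Distinct Ks
      1∉stack : zero ∉ Ks
      1∉closed : zero ∉ Cl
      stack-closed-disjoint : ∀ j → j ∈ Ks → j ∉ Cl
  open StackInv public

  stackInv-init : StackInv [] []
  stackInv-init = record { stack-distinct = λ _ → z≤n ; 1∉stack = λ () ; 1∉closed = λ () ; stack-closed-disjoint = λ _ () }

  stackInv-push : ∀ {Ks Cl} j → j ≢ zero → j ∉ Ks → j ∉ Cl → StackInv Ks Cl → StackInv (j ∷ Ks) Cl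
  stackInv-push {Ks} {Cl} j jz jK jC I = record { stack-distinct = u ; 1∉stack = zk ; 1∉closed = 1∉closed I ; stack-closed-disjoint = d }
    where
    u : Distinct (j ∷ Ks)
    u i with j ≟ i
    ... | yes refl rewrite ∉⇒occ≡0 Ks jK = ≤-refl
    ... | no _ = stack-distinct I i
    zk : zero ∉ j ∷ Ks
    zk (here e) = jz (sym e)
    zk (there q) = 1∉stack I q
    d : ∀ i → i ∈ j ∷ Ks → i ∉ Cl
    d i (here refl) = jC
    d i (there q) = stack-closed-disjoint I i q

  stackInv-pop : ∀ {Ks Cl} j → StackInv (j ∷ Ks) Cl → StackInv Ks (j ∷ Cl)
  stackInv-pop {Ks} {Cl} j I = record { stack-distinct = u ; 1∉stack = λ q → 1∉stack I (there q) ; 1∉closed = zc ; stack-closed-disjoint = d }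
    where
    u : Distinct Ks
    u = distinct-tail {x = j} Ks (stack-distinct I)
    zc : zero ∉ j ∷ Cl
    zc (here e) = 1∉stack I (here e)
    zc (there q) = 1∉closed I q
    d : ∀ i → i ∈ Ks → i ∉ j ∷ Cl
    d i q (here refl) = distinct-head {x = i} _ (stack-distinct I) q
    d i q (there r) = stack-closed-disjoint I i (there q) r

  ⊆-∷⁻ : ∀ {x : Letter} {xs y ys} → (x ∷ xs) ⊆ (y ∷ ys) → (x ≡ y × xs ⊆ ys) ⊎ ((x ∷ xs) ⊆ ys)
  ⊆-∷⁻ (y ∷ʳ r) = inj₂ r
  ⊆-∷⁻ (e ∷ r) = inj₁ (e , r)

  data Above (k j : Letter) : List Letter → Set where
    ab-here : ∀ {Ks} → j ∈ Ks → Above k j (k ∷ Ks)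
    ab-there : ∀ {x Ks} → Above k j Ks → Above k j (x ∷ Ks)

  above⇒∈ : ∀ {k j Ks} → Above k j Ks → j ∈ Ks
  above⇒∈ (ab-here q) = there q
  above⇒∈ (ab-there a) = there (above⇒∈ a)

  above-∷⇒∈ : ∀ {k j x Ks} → Above k j (x ∷ Ks) → j ∈ Ks
  above-∷⇒∈ (ab-here q) = q
  above-∷⇒∈ (ab-there a) = above⇒∈ a

  closed-absent : ∀ {c Ks Cl u} → Accepts c Ks Cl u → StackInv Ks Cl → ∀ j → j ∈ Cl → j ∉ u
  closed-absent (done _ _) I j jC ()
  closed-absent (one _ a) I j jC (here refl) = 1∉closed I jC
  closed-absent (one _ a) I j jC (there q) = closed-absent a I j jC q
  closed-absent (first j′ jz jK jC′ _ a) I j jC (here refl) = jC′ jC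
  closed-absent (first j′ jz jK jC′ _ a) I j jC (there q) = closed-absent a (stackInv-push j′ jz jK jC′ I) j jC q
  closed-absent (again j′ jz _ a) I j jC (here refl) = stack-closed-disjoint I j (here refl) jC
  closed-absent (again j′ jz _ a) I j jC (there q) = closed-absent a I j jC q
  closed-absent (last j′ jz _ a) I j jC (here refl) = stack-closed-disjoint I j (here refl) jC
  closed-absent (last j′ jz _ a) I j jC (there q) = closed-absent a (stackInv-pop j′ I) j (there jC) q

  no-1-then-open : ∀ {c Ks Cl u} → Accepts c Ks Cl u → StackInv Ks Cl → ∀ j → j ∈ Ks → ¬ ((zero ∷ j ∷ []) ⊆ u)
  no-1-then-open (done _ _) I j () s
  no-1-then-open (one _ a) I j () s
  no-1-then-open (first j′ jz jK jC _ a) I j jK′ s with ⊆-∷⁻ s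
  ... | inj₁ (e , _) = jz (sym e)
  ... | inj₂ s′ = no-1-then-open a (stackInv-push j′ jz jK jC I) j (there jK′) s′
  no-1-then-open (again j′ jz _ a) I j jK′ s with ⊆-∷⁻ s
  ... | inj₁ (e , _) = jz (sym e)
  ... | inj₂ s′ = no-1-then-open a I j jK′ s′
  no-1-then-open (last j′ jz _ a) I j jK′ s with ⊆-∷⁻ s
  ... | inj₁ (e , _) = jz (sym e)
  ... | inj₂ s′ with jK′
  ... | here refl = closed-absent a (stackInv-pop j′ I) j (here refl) (Any-resp-⊆ s′ (there (here refl)))
  ... | there q = no-1-then-open a (stackInv-pop j′ I) j q s′

  no-lower-then-upper : ∀ {c Ks Cl u} → Accepts c Ks Cl u → StackInv Ks Cl → ∀ k j → Above k j Ks → ¬ ((j ∷ k ∷ []) ⊆ u)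
  no-lower-then-upper (done _ _) I k j ab ()
  no-lower-then-upper (one _ a) I k j () s
  no-lower-then-upper (first j′ jz jK jC _ a) I k j ab s with ⊆-∷⁻ s
  ... | inj₁ (refl , _) = jK (above⇒∈ ab)
  ... | inj₂ s′ = no-lower-then-upper a (stackInv-push j′ jz jK jC I) k j (ab-there ab) s′
  no-lower-then-upper (again j′ jz _ a) I k j ab s with ⊆-∷⁻ s
  ... | inj₁ (refl , _) = distinct-head {x = j} _ (stack-distinct I) (above-∷⇒∈ ab)
  ... | inj₂ s′ = no-lower-then-upper a I k j ab s′
  no-lower-then-upper (last j′ jz _ a) I k j ab s with ⊆-∷⁻ s
  ... | inj₁ (refl , _) = distinct-head {x = j} _ (stack-distinct I) (above-∷⇒∈ ab)
  ... | inj₂ s′ with ab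
  ... | ab-here q = closed-absent a (stackInv-pop j′ I) k (here refl) (Any-resp-⊆ s′ (there (here refl)))
  ... | ab-there ab′ = no-lower-then-upper a (stackInv-pop j′ I) k j ab′ s′

  no-k-open-k : ∀ {c Ks Cl u} → Accepts c Ks Cl u → StackInv Ks Cl → ∀ k j → j ∈ Ks → k ≢ j → ¬ ((k ∷ j ∷ k ∷ []) ⊆ u)
  no-k-open-k (done _ _) I k j jK kj ()
  no-k-open-k (one _ a) I k j () kj s
  no-k-open-k (first j′ jz jK jC _ a) I k j jK′ kj s with ⊆-∷⁻ s
  ... | inj₁ (refl , s′) = no-lower-then-upper a (stackInv-push j′ jz jK jC I) k j (ab-here jK′) s′
  ... | inj₂ s′ = no-k-open-k a (stackInv-push j′ jz jK jC I) k j (there jK′) kj s′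
  no-k-open-k (again j′ jz _ a) I k j jK′ kj s with ⊆-∷⁻ s
  ... | inj₂ s′ = no-k-open-k a I k j jK′ kj s′
  ... | inj₁ (refl , s′) with jK′
  ... | here e = ⊥-elim (kj (sym e))
  ... | there q = no-lower-then-upper a I k j (ab-here q) s′
  no-k-open-k (last j′ jz _ a) I k j jK′ kj s with ⊆-∷⁻ s
  ... | inj₁ (refl , s′) = closed-absent a (stackInv-pop j′ I) k (here refl) (Any-resp-⊆ s′ (there (here refl)))
  ... | inj₂ s′ with jK′
  ... | here refl = closed-absent a (stackInv-pop j′ I) j (here refl) (Any-resp-⊆ s′ (there (here refl)))
  ... | there q = no-k-open-k a (stackInv-pop j′ I) k j q kj s′

  accepts-no-abab : ∀ {c Ks Cl u} → Accepts c Ks Cl u → StackInv Ks Cl → ∀ a b → a ≢ b → a ≢ zero → b ≢ zero → ¬ ((a ∷ b ∷ a ∷ b ∷ []) ⊆ u)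
  accepts-no-abab (done _ _) I a b ab az bz ()
  accepts-no-abab (one _ acc) I a b ab az bz s with ⊆-∷⁻ s
  ... | inj₁ (e , _) = az e
  ... | inj₂ s′ = accepts-no-abab acc I a b ab az bz s′
  accepts-no-abab (first j′ jz jK jC _ acc) I a b ab az bz s with ⊆-∷⁻ s
  ... | inj₁ (refl , s′) = no-k-open-k acc (stackInv-push j′ jz jK jC I) b a (here refl) (λ e → ab (sym e)) s′
  ... | inj₂ s′ = accepts-no-abab acc (stackInv-push j′ jz jK jC I) a b ab az bz s′
  accepts-no-abab (again j′ jz _ acc) I a b ab az bz s with ⊆-∷⁻ s
  ... | inj₁ (refl , s′) = no-k-open-k acc I b a (here refl) (λ e → ab (sym e)) s′
  ... | inj₂ s′ = accepts-no-abab acc I a b ab az bz s′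
  accepts-no-abab (last j′ jz _ acc) I a b ab az bz s with ⊆-∷⁻ s
  ... | inj₁ (refl , s′) = closed-absent acc (stackInv-pop j′ I) a (here refl) (Any-resp-⊆ s′ (there (here refl)))
  ... | inj₂ s′ = accepts-no-abab acc (stackInv-pop j′ I) a b ab az bz s′

  accepts-no-a1a : ∀ {c Ks Cl u} → Accepts c Ks Cl u → StackInv Ks Cl → ∀ a → a ≢ zero → ¬ ((a ∷ zero ∷ a ∷ []) ⊆ u)
  accepts-no-a1a (done _ _) I a az ()
  accepts-no-a1a (one _ acc) I a az s with ⊆-∷⁻ s
  ... | inj₁ (e , _) = az e
  ... | inj₂ s′ = accepts-no-a1a acc I a az s′
  accepts-no-a1a (first j′ jz jK jC _ acc) I a az s with ⊆-∷⁻ s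
  ... | inj₁ (refl , s′) = no-1-then-open acc (stackInv-push j′ jz jK jC I) a (here refl) s′
  ... | inj₂ s′ = accepts-no-a1a acc (stackInv-push j′ jz jK jC I) a az s′
  accepts-no-a1a (again j′ jz _ acc) I a az s with ⊆-∷⁻ s
  ... | inj₁ (refl , s′) = no-1-then-open acc I a (here refl) s′
  ... | inj₂ s′ = accepts-no-a1a acc I a az s′
  accepts-no-a1a (last j′ jz _ acc) I a az s with ⊆-∷⁻ s
  ... | inj₁ (refl , s′) = closed-absent acc (stackInv-pop j′ I) a (here refl) (Any-resp-⊆ s′ (there (here refl)))
  ... | inj₂ s′ = accepts-no-a1a acc (stackInv-pop j′ I) a az s′

  target : Letter → ℕ
  target zero = ℓ zero ∸ 1
  target (suc i) = ℓ (suc i) + 1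

  occ-bump : ∀ c (x j : Letter) u → c j + occ j (x ∷ u) ≡ bump c x j + occ j u
  occ-bump c x j u with j ≟ x | x ≟ j
  ... | yes refl | yes _ = +-suc (c j) (occ j u)
  ... | yes refl | no ne = ⊥-elim (ne refl)
  ... | no ne | yes refl = ⊥-elim (ne refl)
  ... | no _ | no _ = refl

  ClosedFull : (Letter → ℕ) → List Letter → Set
  ClosedFull c Cl = ∀ j → j ∈ Cl → c j ≡ ℓ j + 1

  closedFull-bump : ∀ c Cl x → x ∉ Cl → ClosedFull c Cl → ClosedFull (bump c x) Cl
  closedFull-bump c Cl x xC h j jC = trans (bump-other c x j (λ e → xC (subst (_∈ Cl) e jC))) (h j jC)

  accepts-counts : ∀ {c Ks Cl u} → Accepts c Ks Cl u → StackInv Ks Cl → ClosedFull c Cl → ∀ j → c j + occ j u ≡ target j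
  accepts-counts {c} (done allC e0) I C zero = trans (+-identityʳ _) e0
  accepts-counts {c} (done allC e0) I C (suc i) = trans (+-identityʳ _) (C (suc i) (allC (suc i) (λ ())))
  accepts-counts {c} {u = x ∷ u} (one _ a) I C j = trans (occ-bump c x j u) (accepts-counts a I (closedFull-bump c _ zero (1∉closed I) C) j)
  accepts-counts {c} {u = x ∷ u} (first j′ jz jK jC _ a) I C j = trans (occ-bump c x j u) (accepts-counts a (stackInv-push j′ jz jK jC I) (closedFull-bump c _ j′ jC C) j)
  accepts-counts {c} {u = x ∷ u} (again j′ jz _ a) I C j = trans (occ-bump c x j u) (accepts-counts a I (closedFull-bump c _ j′ (stack-closed-disjoint I j′ (here refl)) C) j)
  accepts-counts {c} {Cl = Cl} {u = x ∷ u} (last j′ jz ej a) I C j = trans (occ-bump c x j u) (accepts-counts a (stackInv-pop j′ I) C′ j)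
    where
    C′ : ClosedFull (bump c j′) (j′ ∷ Cl)
    C′ i (here refl) = trans (bump-same c i) (trans (cong suc ej) (+-comm 1 (ℓ i)))
    C′ i (there q) = closedFull-bump c Cl j′ (stack-closed-disjoint I j′ (here refl)) C i q

  record ReadInv (pre : List Letter) (c : Letter → ℕ) (Ks Cl : List Letter) : Set where
    field
      counts-prefix : ∀ j → c j ≡ occ j pre
      closed-full : ClosedFull c Cl
      open-partial : ∀ j → j ∈ Ks → 1 ≤ c j × c j ≤ ℓ j
      seen-open-or-closed : ∀ j → j ≢ zero → 1 ≤ c j → j ∈ Ks ⊎ j ∈ Cl
      above-read : ∀ k j → Above k j Ks → (j ∷ k ∷ []) ⊆ pre
      stack-inv : StackInv Ks Cl
  open ReadInv

  readInv-init : ReadInv [] (λ _ → 0) [] []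
  readInv-init = record { counts-prefix = λ _ → refl ; closed-full = λ _ () ; open-partial = λ _ () ; seen-open-or-closed = λ _ _ () ; above-read = λ _ _ () ;
                   stack-inv = stackInv-init }

  bump-occ-snoc : ∀ (j x : Letter) pre c → c j ≡ occ j pre → bump c x j ≡ occ j (pre ++ [ x ])
  bump-occ-snoc j x pre c e rewrite occ-++ j pre [ x ] with x ≟ j | j ≟ x
  ... | yes refl | yes _ = trans (cong suc e) (sym (trans (+-suc _ 0) (cong suc (+-identityʳ _))))
  ... | yes refl | no ne = ⊥-elim (ne refl)
  ... | no ne | yes refl = ⊥-elim (ne refl)
  ... | no _ | no _ = trans e (sym (+-identityʳ _))

  readInv-one : ∀ {pre c Cl} → ReadInv pre c [] Cl → ReadInv (pre ++ [ zero ]) (bump c zero) [] Cl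
  readInv-one {pre} {c} {Cl} B = record
    { counts-prefix = λ j → bump-occ-snoc j zero pre c (counts-prefix B j)
    ; closed-full = closedFull-bump c Cl zero (1∉closed (stack-inv B)) (closed-full B)
    ; open-partial = λ _ ()
    ; seen-open-or-closed = λ j jz h → seen-open-or-closed B j jz (subst (1 ≤_) (bump-other c zero j jz) h)
    ; above-read = λ _ _ ()
    ; stack-inv = stack-inv B }

  unseen∉stack : ∀ {pre c Ks Cl x} → ReadInv pre c Ks Cl → c x ≡ 0 → x ∉ Ks
  unseen∉stack {x = x} B c0 q with open-partial B x q
  ... | h , _ rewrite c0 = 1+n≰n h

  unseen∉closed : ∀ {pre c Ks Cl x} → ReadInv pre c Ks Cl → c x ≡ 0 → x ∉ Cl
  unseen∉closed {x = x} B c0 q = 0≢1+n (trans (sym c0) (trans (closed-full B x q) (+-comm (ℓ x) 1)))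

  readInv-first : ∀ {pre c Ks Cl x} → ReadInv pre c Ks Cl → x ≢ zero → c x ≡ 0 →
    ReadInv (pre ++ [ x ]) (bump c x) (x ∷ Ks) Cl
  readInv-first {pre} {c} {Ks} {Cl} {x} B xz c0 = record
    { counts-prefix = λ j → bump-occ-snoc j x pre c (counts-prefix B j)
    ; closed-full = closedFull-bump c Cl x (unseen∉closed B c0) (closed-full B)
    ; open-partial = partial
    ; seen-open-or-closed = seen
    ; above-read = above
    ; stack-inv = stackInv-push x xz (unseen∉stack B c0) (unseen∉closed B c0) (stack-inv B) }
    where
    partial : ∀ j → j ∈ x ∷ Ks → 1 ≤ bump c x j × bump c x j ≤ ℓ j
    partial j (here refl) rewrite bump-same c j | c0 = s≤s z≤n , 1≤ℓ j
    partial j (there q) with j ≟ x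
    ... | yes refl = ⊥-elim (unseen∉stack B c0 q)
    ... | no _ = open-partial B j q
    seen : ∀ j → j ≢ zero → 1 ≤ bump c x j → j ∈ x ∷ Ks ⊎ j ∈ Cl
    seen j jz h with j ≟ x
    ... | yes refl = inj₁ (here refl)
    ... | no _ with seen-open-or-closed B j jz h
    ... | inj₁ q = inj₁ (there q)
    ... | inj₂ q = inj₂ q
    above : ∀ k j → Above k j (x ∷ Ks) → (j ∷ k ∷ []) ⊆ (pre ++ [ x ])
    above k j (ab-here q) = ++⁺ (from∈ (1≤occ⇒∈ pre (subst (1 ≤_) (counts-prefix B j) (proj₁ (open-partial B j q))))) (refl ∷ [])
    above k j (ab-there a) = ++⁺ʳ [ x ] (above-read B k j a)

  readInv-again : ∀ {pre c Ks Cl x} → ReadInv pre c (x ∷ Ks) Cl → c x < ℓ x →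
    ReadInv (pre ++ [ x ]) (bump c x) (x ∷ Ks) Cl
  readInv-again {pre} {c} {Ks} {Cl} {x} B lt = record
    { counts-prefix = λ j → bump-occ-snoc j x pre c (counts-prefix B j)
    ; closed-full = closedFull-bump c Cl x (stack-closed-disjoint (stack-inv B) x (here refl)) (closed-full B)
    ; open-partial = partial
    ; seen-open-or-closed = seen
    ; above-read = λ k j a → ++⁺ʳ [ x ] (above-read B k j a)
    ; stack-inv = stack-inv B }
    where
    partial : ∀ j → j ∈ x ∷ Ks → 1 ≤ bump c x j × bump c x j ≤ ℓ j
    partial j q with j ≟ x
    ... | yes refl = s≤s z≤n , lt
    ... | no _ = open-partial B j q
    seen : ∀ j → j ≢ zero → 1 ≤ bump c x j → j ∈ x ∷ Ks ⊎ j ∈ Cl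
    seen j jz h with j ≟ x
    ... | yes refl = inj₁ (here refl)
    ... | no _ = seen-open-or-closed B j jz h

  readInv-last : ∀ {pre c Ks Cl x} → ReadInv pre c (x ∷ Ks) Cl → c x ≡ ℓ x →
    ReadInv (pre ++ [ x ]) (bump c x) Ks (x ∷ Cl)
  readInv-last {pre} {c} {Ks} {Cl} {x} B cℓ = record
    { counts-prefix = λ j → bump-occ-snoc j x pre c (counts-prefix B j)
    ; closed-full = full
    ; open-partial = partial
    ; seen-open-or-closed = seen
    ; above-read = λ k j a → ++⁺ʳ [ x ] (above-read B k j (ab-there a))
    ; stack-inv = stackInv-pop x (stack-inv B) }
    where
    full : ClosedFull (bump c x) (x ∷ Cl)
    full j (here refl) = trans (bump-same c j) (trans (cong suc cℓ) (+-comm 1 (ℓ j)))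
    full j (there q) = closedFull-bump c Cl x (stack-closed-disjoint (stack-inv B) x (here refl)) (closed-full B) j q
    partial : ∀ j → j ∈ Ks → 1 ≤ bump c x j × bump c x j ≤ ℓ j
    partial j q with j ≟ x
    ... | yes refl = ⊥-elim (distinct-head {x = j} _ (stack-distinct (stack-inv B)) q)
    ... | no _ = open-partial B j (there q)
    seen : ∀ j → j ≢ zero → 1 ≤ bump c x j → j ∈ Ks ⊎ j ∈ x ∷ Cl
    seen j jz h with j ≟ x
    ... | yes refl = inj₂ (here refl)
    ... | no j≢x with seen-open-or-closed B j jz h
    ... | inj₁ (here e) = ⊥-elim (j≢x e)
    ... | inj₁ (there q) = inj₁ q
    ... | inj₂ q = inj₂ (there q)

  module _ (u : List Letter)
           (count₁ : occ zero u ≡ ℓ zero ∸ 1)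
           (count : ∀ j → j ≢ zero → occ j u ≡ ℓ j + 1)
           (no-abab : ∀ a b → a ≢ b → a ≢ zero → b ≢ zero → ¬ ((a ∷ b ∷ a ∷ b ∷ []) ⊆ u))
           (no-a1a : ∀ a → a ≢ zero → ¬ ((a ∷ zero ∷ a ∷ []) ⊆ u)) where

    occ-split : ∀ (pre rest : List Letter) (c : Letter → ℕ) j → u ≡ pre ++ rest → c j ≡ occ j pre → occ j u ≡ c j + occ j rest
    occ-split pre rest c j eu e = trans (cong (occ j) eu) (trans (occ-++ j pre rest) (cong (_+ occ j rest) (sym e)))

    open-recurs : ∀ (pre rest : List Letter) (c : Letter → ℕ) Ks Cl → u ≡ pre ++ rest → ReadInv pre c Ks Cl → ∀ j → j ∈ Ks → j ∈ rest
    open-recurs pre rest c Ks Cl eu B j jK = 1≤occ⇒∈ rest (lem (c j) (occ j rest) (proj₂ (open-partial B j jK)) total)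
      where
      jz : j ≢ zero
      jz e = 1∉stack (stack-inv B) (subst (_∈ Ks) e jK)
      total : c j + occ j rest ≡ ℓ j + 1
      total = trans (sym (occ-split pre rest c j eu (counts-prefix B j))) (count j jz)
      lem : ∀ a o → a ≤ ℓ j → a + o ≡ ℓ j + 1 → 1 ≤ o
      lem a zero le e = ⊥-elim (1+n≰n (≤-trans (≤-reflexive (trans (trans (+-comm 1 (ℓ j)) (sym e)) (+-identityʳ a))) le))
      lem a (suc o) le e = s≤s z≤n

    started∈prefix : ∀ (pre : List Letter) (c : Letter → ℕ) Ks Cl → ReadInv pre c Ks Cl → ∀ j → j ∈ Ks → j ∈ pre
    started∈prefix pre c Ks Cl B j jK = 1≤occ⇒∈ pre (subst (1 ≤_) (counts-prefix B j) (proj₁ (open-partial B j jK)))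

    no-1-while-open : ∀ (pre rest : List Letter) (c : Letter → ℕ) j Ks Cl → u ≡ pre ++ zero ∷ rest → ReadInv pre c (j ∷ Ks) Cl → ⊥
    no-1-while-open pre rest c j Ks Cl eu B with open-recurs pre (zero ∷ rest) c (j ∷ Ks) Cl eu B j (here refl)
    ... | here e = 1∉stack (stack-inv B) (here (sym e))
    ... | there jr = no-a1a j (λ e → 1∉stack (stack-inv B) (here (sym e))) (subst ((j ∷ zero ∷ j ∷ []) ⊆_) (sym eu)
            (++⁺ (from∈ (started∈prefix pre c (j ∷ Ks) Cl B j (here refl))) (refl ∷ from∈ jr)))

    room-for-1 : ∀ (pre rest : List Letter) (c : Letter → ℕ) Cl → u ≡ pre ++ zero ∷ rest → ReadInv pre c [] Cl → suc (c zero) < ℓ zero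
    room-for-1 pre rest c Cl eu B with ℓ zero | total
      where
      total : c zero + suc (occ zero rest) ≡ ℓ zero ∸ 1
      total = trans (sym (trans (occ-split pre (zero ∷ rest) c zero eu (counts-prefix B zero)) (cong (c zero +_) (occ-here zero rest)))) count₁
    ... | zero | e = ⊥-elim (m+1+n≢0 (c zero) e)
    ... | suc l | e = s≤s (subst (suc (c zero) ≤_) e (≤-trans (s≤s (m≤m+n (c zero) (occ zero rest))) (≤-reflexive (sym (+-suc (c zero) (occ zero rest))))))

    seen∉closed : ∀ (pre rest : List Letter) (c : Letter → ℕ) Ks Cl x → u ≡ pre ++ x ∷ rest → ReadInv pre c Ks Cl → x ≢ zero → x ∉ Cl
    seen∉closed pre rest c Ks Cl x eu B xz xC = m+1+n≢m (c x) (sym (trans (closed-full B x xC) (trans (sym (count x xz))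
      (trans (occ-split pre (x ∷ rest) c x eu (counts-prefix B x)) (cong (c x +_) (occ-here x rest))))))

    seen-on-top : ∀ (pre rest : List Letter) (c : Letter → ℕ) k Ks Cl x → u ≡ pre ++ x ∷ rest → ReadInv pre c (k ∷ Ks) Cl → x ≢ zero → x ∈ k ∷ Ks → k ≡ x
    seen-on-top pre rest c k Ks Cl x eu B xz xK with k ≟ x
    ... | yes k≡x = k≡x
    ... | no k≢x with xK | open-recurs pre (x ∷ rest) c (k ∷ Ks) Cl eu B k (here refl)
    ... | here e | _ = ⊥-elim (k≢x (sym e))
    ... | there _ | here e = ⊥-elim (k≢x e)
    ... | there x∈Ks | there k∈rest = ⊥-elim (no-abab x k (λ e → k≢x (sym e)) xz (λ e → 1∉stack (stack-inv B) (here (sym e)))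
            (subst ((x ∷ k ∷ x ∷ k ∷ []) ⊆_) (sym eu) (++⁺ (above-read B k x (ab-here x∈Ks)) (refl ∷ from∈ k∈rest))))

    accepts-suffix : ∀ (rest pre : List Letter) (c : Letter → ℕ) Ks Cl → u ≡ pre ++ rest → ReadInv pre c Ks Cl → Accepts c Ks Cl rest
    accepts-suffix [] pre c (j ∷ Ks) Cl eu B with open-recurs pre [] c (j ∷ Ks) Cl eu B j (here refl)
    ... | ()
    accepts-suffix [] pre c [] Cl eu B = done all-closed count₁-done
      where
      eu′ : u ≡ pre
      eu′ = trans eu (++-identityʳ pre)
      all-closed : ∀ j → j ≢ zero → j ∈ Cl
      all-closed j jz with seen-open-or-closed B j jz (subst (1 ≤_) (sym (trans (counts-prefix B j) (trans (cong (occ j) (sym eu′)) (count j jz)))) (subst (1 ≤_) (+-comm 1 (ℓ j)) (s≤s z≤n)))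
      ... | inj₁ ()
      ... | inj₂ q = q
      count₁-done : c zero ≡ ℓ zero ∸ 1
      count₁-done = trans (counts-prefix B zero) (trans (cong (occ zero) (sym eu′)) count₁)
    accepts-suffix (x ∷ rest) pre c Ks Cl eu B with x ≟ zero
    accepts-suffix (x ∷ rest) pre c (j ∷ Ks) Cl eu B | yes refl = ⊥-elim (no-1-while-open pre rest c j Ks Cl eu B)
    accepts-suffix (x ∷ rest) pre c [] Cl eu B | yes refl =
      one (room-for-1 pre rest c Cl eu B) (accepts-suffix rest (pre ++ [ zero ]) (bump c zero) [] Cl (shift-into-prefix eu) (readInv-one B))
    ... | no xz with c x ≟ℕ 0
    ... | yes c0 = first x xz (unseen∉stack B c0) (unseen∉closed B c0) c0
                     (accepts-suffix rest (pre ++ [ x ]) (bump c x) (x ∷ Ks) Cl (shift-into-prefix eu) (readInv-first B xz c0))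
    ... | no c≢0 with seen-open-or-closed B x xz (n≢0⇒n>0 c≢0)
    ... | inj₂ xC = ⊥-elim (seen∉closed pre rest c Ks Cl x eu B xz xC)
    accepts-suffix (x ∷ rest) pre c [] Cl eu B | no xz | no _ | inj₁ ()
    accepts-suffix (x ∷ rest) pre c (k ∷ Ks) Cl eu B | no xz | no _ | inj₁ xK
      with seen-on-top pre rest c k Ks Cl x eu B xz xK
    ... | refl with m≤n⇒m<n∨m≡n (proj₂ (open-partial B x (here refl)))
    ... | inj₁ lt = again x xz lt (accepts-suffix rest (pre ++ [ x ]) (bump c x) (x ∷ Ks) Cl (shift-into-prefix eu) (readInv-again B lt))
    ... | inj₂ cℓ = last x xz cℓ (accepts-suffix rest (pre ++ [ x ]) (bump c x) Ks (x ∷ Cl) (shift-into-prefix eu) (readInv-last B cℓ))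

    W⇒accepts : Accepts (λ _ → 0) [] [] u
    W⇒accepts = accepts-suffix u [] (λ _ → 0) [] [] refl readInv-init

module DecodeMap (k p : ℕ) (π : Permutation′ (suc k)) (orbits : OrbitListing π (suc p))
                (ℓ : Fin (suc p) → ℕ) (H : ∀ j → OrbitSize π (lead orbits j) (ℓ j))
                (rep : Fin p → Fin (suc k)) where

  open StarMachine k
  open Orbits k p π orbits ℓ H
  open LabelWords p ℓ 1≤ℓ public

  base : Letter → Point
  base zero = zero
  base (suc i) = rep i

  offset : Letter → ℕ
  offset zero = 1
  offset (suc _) = 0

  pointOf : Letter → ℕ → Point
  pointOf j t = iter g (offset j + t) (base j)

  decodeFrom : (Letter → ℕ) → List Letter → List Point
  decodeFrom c [] = []
  decodeFrom c (j ∷ u) = pointOf j (c j) ∷ decodeFrom (bump c j) u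

module Blocks (k p : ℕ) (π : Permutation′ (suc k)) (orbits : OrbitListing π (suc p))
              (ℓ : Fin (suc p) → ℕ) (H : ∀ j → OrbitSize π (lead orbits j) (ℓ j))
              (rep : Fin p → Fin (suc k)) (rep-orbit : ∀ i → Orbits.orbitOf k p π orbits ℓ H (rep i) ≡ suc i) where

  open StarMachine k
  open Orbits k p π orbits ℓ H

  open DecodeMap k p π orbits ℓ H rep public

  orbitOf-base : ∀ j → orbitOf (base j) ≡ j
  orbitOf-base zero = orbitOf-0
  orbitOf-base (suc i) = rep-orbit i

  period-base : ∀ j → Period (base j) (ℓ j)
  period-base j = subst (Period (base j)) (cong ℓ (orbitOf-base j)) (period (base j))

  pointOf-suc : ∀ j t → pointOf j (suc t) ≡ g (pointOf j t)
  pointOf-suc j t = cong (λ z → iter g z (base j)) (+-suc (offset j) t)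

  orbitOf-iter-g : ∀ x i → orbitOf (iter g i x) ≡ orbitOf x
  orbitOf-iter-g x i = sym (inOrbit⇒same-orbitOf (iter-g-inOrbit (period x) i))

  orbitOf-pointOf : ∀ j t → orbitOf (pointOf j t) ≡ j
  orbitOf-pointOf j t = trans (orbitOf-iter-g (base j) (offset j + t)) (orbitOf-base j)

  block : Letter → ℕ → List Point
  block j zero = []
  block j (suc t) = pointOf j t ∷ block j t

  block⁺ : Letter → ℕ → List Point
  block⁺ j zero = []
  block⁺ j (suc t) = pointOf j (suc t) ∷ block⁺ j t

  cycleOf : Letter → List Point
  cycleOf j = pointOf j 0 ∷ block⁺ j (ℓ j ∸ 1)

  block-∈⁻ : ∀ j t {y} → y ∈ block j t → ∃ λ i → i < t × y ≡ pointOf j i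
  block-∈⁻ j (suc t) (here refl) = t , n<1+n t , refl
  block-∈⁻ j (suc t) (there q) with block-∈⁻ j t q
  ... | i , lt , e = i , ≤-trans lt (n≤1+n t) , e

  block-∈⁺ : ∀ j t i → i < t → pointOf j i ∈ block j t
  block-∈⁺ j (suc t) i lt with i ≟ℕ t
  ... | yes refl = here refl
  ... | no ne = there (block-∈⁺ j t i (≤∧≢⇒< (≤-pred lt) ne))

  block-split : ∀ j t i → i < t → ∃ λ A → block j t ≡ A ++ pointOf j i ∷ block j i
  block-split j (suc t) i lt with i ≟ℕ t
  ... | yes refl = [] , refl
  ... | no ne with block-split j t i (≤∧≢⇒< (≤-pred lt) ne)
  ... | A , e = pointOf j t ∷ A , cong (pointOf j t ∷_) e

  block-snoc : ∀ j t → block j (suc t) ≡ block⁺ j t ++ pointOf j 0 ∷ []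
  block-snoc j zero = refl
  block-snoc j (suc t) = cong (pointOf j (suc t) ∷_) (block-snoc j t)

  block⁺-∈⁻ : ∀ j t {y} → y ∈ block⁺ j t → ∃ λ i → 1 ≤ i × i ≤ t × y ≡ pointOf j i
  block⁺-∈⁻ j (suc t) (here refl) = suc t , s≤s z≤n , ≤-refl , refl
  block⁺-∈⁻ j (suc t) (there q) with block⁺-∈⁻ j t q
  ... | i , h1 , h2 , e = i , h1 , ≤-trans h2 (n≤1+n t) , e

  block⁺-∈⁺ : ∀ j t i → 1 ≤ i → i ≤ t → pointOf j i ∈ block⁺ j t
  block⁺-∈⁺ j zero i (s≤s _) ()
  block⁺-∈⁺ j (suc t) i h1 h2 with i ≟ℕ suc t
  ... | yes refl = here refl
  ... | no ne = there (block⁺-∈⁺ j t i h1 (≤-pred (≤∧≢⇒< h2 ne)))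

  block-orbitOf : ∀ j t {y} → y ∈ block j t → orbitOf y ≡ j
  block-orbitOf j t q with block-∈⁻ j t q
  ... | i , _ , refl = orbitOf-pointOf j i

  cycleOf-orbitOf : ∀ j {y} → y ∈ cycleOf j → orbitOf y ≡ j
  cycleOf-orbitOf j (here refl) = orbitOf-pointOf j 0
  cycleOf-orbitOf j (there q) with block⁺-∈⁻ j _ q
  ... | i , _ , _ , refl = orbitOf-pointOf j i

  iter-g-injective : ∀ {x l} → Period x l → ∀ a b → a < l → b < l → iter g a x ≡ iter g b x → a ≡ b
  iter-g-injective px a b al bl e with <-cmp a b
  ... | tri< lt _ _ = ⊥-elim (iter-g-distinct px a b lt bl e)
  ... | tri≈ _ eq _ = eq
  ... | tri> _ _ gt = ⊥-elim (iter-g-distinct px b a gt al (sym e))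

  pointOf-injective : ∀ i a b → a < ℓ (suc i) → b < ℓ (suc i) → pointOf (suc i) a ≡ pointOf (suc i) b → a ≡ b
  pointOf-injective i a b al bl e = iter-g-injective (period-base (suc i)) a b al bl e

  pointOf₀-injective : ∀ a b → suc a < ℓ zero → suc b < ℓ zero → pointOf zero a ≡ pointOf zero b → a ≡ b
  pointOf₀-injective a b al bl e = suc-injective (iter-g-injective (period-base zero) (suc a) (suc b) al bl e)

  pointOf₀≢0 : ∀ a → suc a < ℓ zero → pointOf zero a ≢ zero
  pointOf₀≢0 a al e with iter-g-injective (period-base zero) 0 (suc a) (1≤ℓ zero) al (sym e)
  ... | ()

  pointOf-period : ∀ i → pointOf (suc i) (ℓ (suc i)) ≡ pointOf (suc i) 0
  pointOf-period i = iter-g-period (period-base (suc i))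

  orbit⇒pointOf : ∀ i {y} → orbitOf y ≡ suc i → ∃ λ a → a < ℓ (suc i) × pointOf (suc i) a ≡ y
  orbit⇒pointOf i {y} e with same-orbitOf⇒inOrbit {base (suc i)} {y} (trans (orbitOf-base (suc i)) (sym e))
  ... | t , et with inOrbit⇒iter-g (period-base (suc i)) t
  ... | a , al , ea = a , al , trans ea et

  orbit₀⇒pointOf : ∀ {y} → orbitOf y ≡ zero → y ≢ zero → ∃ λ a → suc a < ℓ zero × pointOf zero a ≡ y
  orbit₀⇒pointOf {y} e y≢0 with same-orbitOf⇒inOrbit {zero} {y} (trans orbitOf-0 (sym e))
  ... | t , et with inOrbit⇒iter-g (period-base zero) t
  ... | zero , al , ea = ⊥-elim (y≢0 (trans (sym et) (sym ea)))
  ... | suc a , al , ea = a , al , trans ea et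

  cycleOf-∈⁺ : ∀ i a → a < ℓ (suc i) → pointOf (suc i) a ∈ cycleOf (suc i)
  cycleOf-∈⁺ i zero al = here refl
  cycleOf-∈⁺ i (suc a) al = there (block⁺-∈⁺ (suc i) _ (suc a) (s≤s z≤n) (∸-monoˡ-≤ 1 al))

  cycleOf-full : ∀ i {y} → orbitOf y ≡ suc i → y ∈ cycleOf (suc i)
  cycleOf-full i e with orbit⇒pointOf i e
  ... | a , al , refl = cycleOf-∈⁺ i a al

  -- The state reached by decoding: each started, unfinished orbit j contributes the points
  -- used so far, most recent first, to the cycle of 0; each finished orbit is a closed cycle.
  openList : (Letter → ℕ) → List Letter → List Point
  openList c [] = block zero (c zero)
  openList c (j ∷ Ks) = block j (c j) ++ openList c Ks

  closedCycles : List Letter → List (List Point)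
  closedCycles Cl = map cycleOf Cl

  stateOf : (Letter → ℕ) → List Letter → List Letter → State
  stateOf c Ks Cl = openList c Ks , closedCycles Cl

  openList-∈⁻ : ∀ c Ks {y} → y ∈ openList c Ks → y ∈ block (orbitOf y) (c (orbitOf y)) × (orbitOf y ≡ zero ⊎ orbitOf y ∈ Ks)
  openList-∈⁻ c [] {y} q = subst (λ j → y ∈ block j (c j)) (sym (block-orbitOf zero _ q)) q , inj₁ (block-orbitOf zero _ q)
  openList-∈⁻ c (j ∷ Ks) {y} q with ∈-++⁻ (block j (c j)) q
  ... | inj₁ r = subst (λ j → y ∈ block j (c j)) (sym (block-orbitOf j _ r)) r , inj₂ (here (block-orbitOf j _ r))
  ... | inj₂ r with openList-∈⁻ c Ks r
  ... | r1 , inj₁ e = r1 , inj₁ e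
  ... | r1 , inj₂ r2 = r1 , inj₂ (there r2)

  openList-∈⁺ : ∀ c Ks j {y} → j ∈ Ks → y ∈ block j (c j) → y ∈ openList c Ks
  openList-∈⁺ c (j ∷ Ks) .j (here refl) q = ∈-++⁺ˡ {ys = (openList c Ks)} q
  openList-∈⁺ c (j′ ∷ Ks) j (there jK) q = ∈-++⁺ʳ (block j′ (c j′)) (openList-∈⁺ c Ks j jK q)

  openList-∈⁺₀ : ∀ c Ks {y} → y ∈ block zero (c zero) → y ∈ openList c Ks
  openList-∈⁺₀ c [] q = q
  openList-∈⁺₀ c (j ∷ Ks) q = ∈-++⁺ʳ (block j (c j)) (openList-∈⁺₀ c Ks q)

  closedCycles-∈⁻ : ∀ Cl {y} → y ∈ concat (closedCycles Cl) → orbitOf y ∈ Cl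
  closedCycles-∈⁻ (j ∷ Cl) q with ∈-++⁻ (cycleOf j) q
  ... | inj₁ r = here (cycleOf-orbitOf j r)
  ... | inj₂ r = there (closedCycles-∈⁻ Cl r)

  closedCycles-∈⁺ : ∀ Cl j {y} → j ∈ Cl → y ∈ cycleOf j → y ∈ concat (closedCycles Cl)
  closedCycles-∈⁺ (j ∷ Cl) .j (here refl) q = ∈-++⁺ˡ {ys = (concat (closedCycles Cl))} q
  closedCycles-∈⁺ (j′ ∷ Cl) j (there jC) q = ∈-++⁺ʳ (cycleOf j′) (closedCycles-∈⁺ Cl j jC q)

  openList-bump : ∀ c Ks j → j ∉ Ks → j ≢ zero → openList (bump c j) Ks ≡ openList c Ks
  openList-bump c [] j jK jz = cong (block zero) (bump-other c j zero (λ e → jz (sym e)))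
  openList-bump c (j′ ∷ Ks) j jK jz = cong₂ _++_ (cong (block j′) (bump-other c j j′ (λ e → jK (here (sym e))))) (openList-bump c Ks j (λ q → jK (there q)) jz)

  block-distinct⇒injective : ∀ j t → Distinct (block j t) → ∀ a b → a < t → b < t → pointOf j a ≡ pointOf j b → a ≡ b
  block-distinct⇒injective j (suc t) U a b al bl e with a ≟ℕ t | b ≟ℕ t
  ... | yes refl | yes refl = refl
  ... | yes refl | no nb = ⊥-elim (distinct-head {x = pointOf j a} (block j a) U (subst (_∈ block j a) (sym e) (block-∈⁺ j a b (≤∧≢⇒< (≤-pred bl) nb))))
  ... | no na | yes refl = ⊥-elim (distinct-head {x = pointOf j b} (block j b) U (subst (_∈ block j b) e (block-∈⁺ j b a (≤∧≢⇒< (≤-pred al) na))))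
  ... | no na | no nb = block-distinct⇒injective j t (distinct-tail {x = pointOf j t} (block j t) U) a b (≤∧≢⇒< (≤-pred al) na) (≤∧≢⇒< (≤-pred bl) nb) e

  Started : (Letter → ℕ) → List Letter → Set
  Started c Ks = ∀ j → j ∈ Ks → 1 ≤ c j

  openList-head : ∀ c Ks {h T} → Started c Ks → openList c Ks ≡ h ∷ T →
    (Ks ≡ [] × ∃ λ t → c zero ≡ suc t × h ≡ pointOf zero t) ⊎ (∃ λ j → ∃ λ Ks′ → ∃ λ t → Ks ≡ j ∷ Ks′ × c j ≡ suc t × h ≡ pointOf j t)
  openList-head c [] st e with c zero in eq
  openList-head c [] st () | zero
  openList-head c [] st refl | suc t = inj₁ (refl , t , refl , refl)
  openList-head c (j ∷ Ks) st e with c j in eq | st j (here refl)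
  ... | suc t | _ with e
  ... | refl = inj₂ (j , Ks , t , refl , eq , refl)

  openList-empty : ∀ c Ks → Started c Ks → openList c Ks ≡ [] → Ks ≡ [] × c zero ≡ 0
  openList-empty c [] st e with c zero in eq
  ... | zero = refl , refl
  openList-empty c [] st () | suc t
  openList-empty c (j ∷ Ks) st e with c j in eq | st j (here refl)
  openList-empty c (j ∷ Ks) st () | suc t | _

module Encoding (k p : ℕ) (π : Permutation′ (suc k)) (orbits : OrbitListing π (suc p))
                (ℓ : Fin (suc p) → ℕ) (H : ∀ j → OrbitSize π (lead orbits j) (ℓ j))
                (rep : Fin p → Fin (suc k)) (rep-orbit : ∀ i → Orbits.orbitOf k p π orbits ℓ H (rep i) ≡ suc i) where

  open StarMachine k
  open Orbits k p π orbits ℓ H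
  open Blocks k p π orbits ℓ H rep rep-orbit

  record EncInv (c : Letter → ℕ) (Ks Cl : List Letter) (v : List Point) : Set where
    field
      mergeFree : MergeFree v (stateOf c Ks Cl)
      distinct : Distinct (zero ∷ points (stateOf c Ks Cl))
      nonzero : AllNonZero v
      represents : Represents f (run v (stateOf c Ks Cl))
      covers-nonzero : ∀ x → x ≢ zero → x ∈ points (run v (stateOf c Ks Cl))
      stackInv : StackInv Ks Cl
      started : Started c Ks
      unseen-or-listed : ∀ j → j ≢ zero → c j ≡ 0 ⊎ (j ∈ Ks ⊎ j ∈ Cl)
      first-is-rep : ∀ j → j ≢ zero → c j ≡ 0 → ∀ x → firstIn j v ≡ just x → x ≡ base j
  open EncInv

  chainOff-head : ∀ v σ x L → ChainOff v σ x L zero → x ∉ v → (L ≡ [] × σ x ≡ zero) ⊎ (∃ λ h → ∃ λ T → L ≡ h ∷ T × σ x ≡ h)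
  chainOff-head v σ x [] w n = inj₁ (refl , w n)
  chainOff-head v σ x (h ∷ T) (w , _) n = inj₂ (h , T , refl , w n)

  lead≢0 : ∀ j → j ≢ zero → lead orbits j ≢ zero
  lead≢0 j jz e = jz (lead-inj (trans e (sym lead-0)))

  encode-end : ∀ c Ks Cl → EncInv c Ks Cl [] → Accepts c Ks Cl []
  encode-end c (j ∷ Ks) Cl A = ⊥-elim (1∉stack (stackInv A) (here (sym (trans (sym (orbitOf-pointOf j 0)) (openChain-orbitOf (openList c (j ∷ Ks)) (proj₁ (represents A)) m)))))
    where
    m : pointOf j 0 ∈ openList c (j ∷ Ks)
    m = openList-∈⁺ c (j ∷ Ks) j (here refl) (block-∈⁺ j (c j) 0 (started A j (here refl)))
  encode-end c [] Cl A = done all-closed c0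
    where
    all-closed : ∀ j → j ≢ zero → j ∈ Cl
    all-closed j jz with ∈-++⁻ (openList c []) (covers-nonzero A (lead orbits j) (lead≢0 j jz))
    ... | inj₁ q = ⊥-elim (jz (trans (sym (orbitOf-lead j)) (block-orbitOf zero _ q)))
    ... | inj₂ q = subst (_∈ Cl) (orbitOf-lead j) (closedCycles-∈⁻ Cl q)
    U = distinct A
    ch = proj₁ (represents A)
    c0 : c zero ≡ ℓ zero ∸ 1
    c0 with c zero in eq
    ... | zero = sym (cong (_∸ 1) (≤-antisym (period-minimal (period-base zero) 1 (s≤s z≤n) (subst (λ n → Chain f zero (block zero n) zero) eq ch)) (1≤ℓ zero)))
    ... | suc t = sym (cong (_∸ 1) (≤-antisym up lo))
      where
      ch′ : Chain f zero (block zero (suc t)) zero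
      ch′ = subst (λ n → Chain f zero (block zero n) zero) eq ch
      ret2 : iter f (suc (suc t)) zero ≡ zero
      ret2 = trans (iter-suc-inner f (suc t) zero) (trans (cong (iter f (suc t)) (proj₁ ch′)) (iter-f∘iter-g (suc t) zero))
      up : ℓ zero ≤ suc (suc t)
      up = period-minimal (period-base zero) (suc (suc t)) (s≤s z≤n) ret2
      lo : suc (suc t) ≤ ℓ zero
      lo with ℓ zero ≤? suc t
      ... | no nle = ≰⇒> nle
      ... | yes le with ℓ zero | 1≤ℓ zero | iter-g-period (period-base zero)
      ... | suc i | _ | gr = ⊥-elim (distinct-head (openList c [] ++ concat (closedCycles Cl)) U (∈-++⁺ˡ {ys = _} zin))
        where
        zin : zero ∈ openList c []
        zin = subst (_∈ openList c []) gr (subst (λ n → pointOf zero i ∈ block zero n) (sym eq) (block-∈⁺ zero (suc t) i le))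

  pointOf-period′ : ∀ j → j ≢ zero → pointOf j (ℓ j) ≡ pointOf j 0
  pointOf-period′ zero jz = ⊥-elim (jz refl)
  pointOf-period′ (suc i) jz = pointOf-period i

  block-complete : ∀ j → j ≢ zero → ∀ n → Distinct (block j n) → f (pointOf j 0) ∈ block j n → 1 ≤ n → n ≡ ℓ j
  block-complete zero jz n Ub m n1 = ⊥-elim (jz refl)
  block-complete (suc i0) jz n Ub m n1 = ≤-antisym le ge
    where
    j = suc i0
    fd : f (pointOf j 0) ≡ pointOf j (ℓ j ∸ 1)
    fd = f-as-iter-g (period-base j)
    ge : ℓ j ≤ n
    ge with block-∈⁻ j n m
    ... | r , r<n , er with n ≤? ℓ j ∸ 1
    ... | yes le′ = ⊥-elim (<-irrefl refl (≤-trans (≤-trans (s≤s (≤-reflexive r≡)) r<n) le′))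
      where
      r<ℓ : r < ℓ j
      r<ℓ = ≤-trans r<n (≤-trans le′ (≤-pred (≤-trans (pred< (ℓ j) (1≤ℓ j)) (n≤1+n _))))
      r≡ : ℓ j ∸ 1 ≡ r
      r≡ = pointOf-injective i0 (ℓ j ∸ 1) r (pred< (ℓ j) (1≤ℓ j)) r<ℓ (trans (sym fd) er)
    ... | no nle with ℓ j | 1≤ℓ j | ≰⇒> nle
    ... | suc l | _ | lt = lt
    le : n ≤ ℓ j
    le with suc (ℓ j) ≤? n
    ... | yes lt = ⊥-elim (1+n≰n (≤-trans (1≤ℓ j) (≤-reflexive (block-distinct⇒injective j n Ub (ℓ j) 0 lt n1 (pointOf-period i0)))))
    ... | no nlt = ≤-pred (≰⇒> nlt)

  1≤⇒suc : ∀ {n} → 1 ≤ n → ∃ λ t → n ≡ suc t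
  1≤⇒suc {suc t} _ = t , refl

  open-top-letter : ∀ c k Ks′ x X Y t → c k ≡ suc t → openList c (k ∷ Ks′) ≡ X ++ x ∷ Y → IsCycle f (x ∷ X) → k ≡ orbitOf x
  open-top-letter c k Ks′ x [] Y t eq eL hC =
    trans (sym (orbitOf-pointOf k t)) (cong orbitOf (proj₁ (∷-injective (trans (cong (λ n → block k n ++ openList c Ks′) (sym eq)) eL))))
  open-top-letter c k Ks′ x (h ∷ X′) Y t eq eL hC =
    trans (sym (orbitOf-pointOf k t)) (trans (cong orbitOf (proj₁ (∷-injective (trans (cong (λ n → block k n ++ openList c Ks′) (sym eq)) eL))))
      (cycle-same-orbitOf (x ∷ h ∷ X′) hC (there (here refl)) (here refl)))

  top-block-closed : ∀ c j Ks′ x X Y → j ≢ zero → j ≡ orbitOf x → openList c (j ∷ Ks′) ≡ X ++ x ∷ Y →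
    Distinct (block j (c j) ++ openList c Ks′) → x ∉ X → IsCycle f (x ∷ X) → ∀ i → i < c j → x ≡ pointOf j i →
    c j ≡ ℓ j × x ≡ pointOf j (c j) × X ≡ block⁺ j (ℓ j ∸ 1) × Y ≡ openList c Ks′
  top-block-closed c j Ks′ x X Y jz jx e1 UL′ nX hC i i<c ex with block-split j (c j) i i<c
  ... | A , eA = by-cases (++-∷-cases X A e2)
    where
    Ub : Distinct (block j (c j))
    Ub = distinct-++⁻ˡ (block j (c j)) (openList c Ks′) UL′
    UXY : Distinct (X ++ x ∷ Y)
    UXY = subst Distinct e1 UL′
    T = block j i ++ openList c Ks′
    eAT : block j (c j) ++ openList c Ks′ ≡ A ++ x ∷ T
    eAT = trans (cong (_++ openList c Ks′) eA) (trans (++-assoc A (pointOf j i ∷ block j i) (openList c Ks′)) (cong (λ z → A ++ z ∷ T) (sym ex)))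
    e2 : X ++ x ∷ Y ≡ A ++ x ∷ T
    e2 = trans (sym e1) eAT
    by-cases : (X ≡ A × x ≡ x × Y ≡ T) ⊎ ((∃ λ M → X ≡ A ++ x ∷ M × T ≡ M ++ x ∷ Y) ⊎ (∃ λ M → A ≡ X ++ x ∷ M × Y ≡ M ++ x ∷ T)) →
           c j ≡ ℓ j × x ≡ pointOf j (c j) × X ≡ block⁺ j (ℓ j ∸ 1) × Y ≡ openList c Ks′
    by-cases (inj₂ (inj₁ (M , eX , _))) = ⊥-elim (nX (subst (x ∈_) (sym eX) (∈-++⁺ʳ A (here refl))))
    by-cases (inj₂ (inj₂ (M , eA2 , _))) = ⊥-elim (distinct-disjoint A (x ∷ T) (subst Distinct eAT UL′) (subst (x ∈_) (sym eA2) (∈-++⁺ʳ X (here refl))) (here refl))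
    by-cases (inj₁ (eX , _ , eY)) = by-index i i<c ex eA eY
      where
      by-index : ∀ i → i < c j → x ≡ pointOf j i → block j (c j) ≡ A ++ pointOf j i ∷ block j i → Y ≡ block j i ++ openList c Ks′ →
             c j ≡ ℓ j × x ≡ pointOf j (c j) × X ≡ block⁺ j (ℓ j ∸ 1) × Y ≡ openList c Ks′
      by-index (suc i′) _ ex eA eY = ⊥-elim (clash (cycle-full-orbit (x ∷ X) hC (here refl) (trans (orbitOf-pointOf j 0) jx)))
        where
        d0Y : pointOf j 0 ∈ Y
        d0Y = subst (pointOf j 0 ∈_) (sym eY) (∈-++⁺ˡ {ys = (openList c Ks′)} (block-∈⁺ j (suc i′) 0 (s≤s z≤n)))
        clash : pointOf j 0 ∈ x ∷ X → ⊥
        clash (here e) = distinct-head Y (distinct-++⁻ʳ X (x ∷ Y) UXY) (subst (_∈ Y) e d0Y)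
        clash (there q) = distinct-disjoint X (x ∷ Y) UXY q (there d0Y)
      by-index zero i<c ex eA eY = cℓ , trans ex (trans (sym (pointOf-period′ j jz)) (cong (pointOf j) (sym cℓ))) , eXb , eY
        where
        inB : ∀ {y} → y ∈ x ∷ X → y ∈ block j (c j)
        inB (here e) = subst (_ ∈_) (sym eA) (∈-++⁺ʳ A (here (trans e ex)))
        inB (there q) = subst (_ ∈_) (sym eA) (∈-++⁺ˡ {ys = (pointOf j 0 ∷ [])} (subst (_ ∈_) eX q))
        cℓ : c j ≡ ℓ j
        cℓ = block-complete j jz (c j) Ub (inB (cycle-closed f (x ∷ X) hC (pointOf j 0) (here (sym ex)))) i<c
        tt′ = 1≤⇒suc i<c
        eXb : X ≡ block⁺ j (ℓ j ∸ 1)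
        eXb = trans eX (trans (∷ʳ-injectiveˡ A (block⁺ j (proj₁ tt′)) (trans (sym eA) (trans (cong (block j) (proj₂ tt′)) (block-snoc j (proj₁ tt′)))))
                (cong (block⁺ j) (cong (_∸ 1) (trans (sym (proj₂ tt′)) cℓ))))

  split-closes-top : ∀ c Ks Cl x X Y → Distinct (zero ∷ openList c Ks ++ concat (closedCycles Cl)) → Started c Ks →
    openList c Ks ≡ X ++ x ∷ Y → x ∉ X → IsCycle f (x ∷ X) →
    orbitOf x ≢ zero × ∃ λ Ks′ → Ks ≡ orbitOf x ∷ Ks′ × c (orbitOf x) ≡ ℓ (orbitOf x) ×
      x ≡ pointOf (orbitOf x) (c (orbitOf x)) × X ≡ block⁺ (orbitOf x) (ℓ (orbitOf x) ∸ 1) × Y ≡ openList c Ks′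
  split-closes-top c Ks Cl x X Y U st eL nX hC = jz , main Ks st eL UL (openList-∈⁻ c Ks xL)
    where
    Fl = openList c Ks ++ concat (closedCycles Cl)
    UL : Distinct (openList c Ks)
    UL = distinct-++⁻ˡ (openList c Ks) (concat (closedCycles Cl)) (distinct-tail {x = zero} Fl U)
    xL : x ∈ openList c Ks
    xL = subst (x ∈_) (sym eL) (∈-++⁺ʳ X (here refl))
    jz : orbitOf x ≢ zero
    jz e = distinct-head Fl U (∈-++⁺ˡ {ys = _} (subst (zero ∈_) (sym eL) (inXY (cycle-full-orbit (x ∷ X) hC (here refl) (trans orbitOf-0 (sym e))))))
      where
      inXY : zero ∈ x ∷ X → zero ∈ X ++ x ∷ Y
      inXY (here e′) = ∈-++⁺ʳ X (here e′)
      inXY (there q) = ∈-++⁺ˡ {ys = (x ∷ Y)} q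
    j = orbitOf x
    main : ∀ Ks → Started c Ks → openList c Ks ≡ X ++ x ∷ Y → Distinct (openList c Ks) → x ∈ block j (c j) × (j ≡ zero ⊎ j ∈ Ks) →
      ∃ λ Ks′ → Ks ≡ orbitOf x ∷ Ks′ × c j ≡ ℓ j × x ≡ pointOf j (c j) × X ≡ block⁺ j (ℓ j ∸ 1) × Y ≡ openList c Ks′
    main Ks st eL UL (_ , inj₁ e) = ⊥-elim (jz e)
    main [] st eL UL (_ , inj₂ ())
    main (k ∷ Ks′) st eL UL (xb , inj₂ _) = Ks′ , cong (_∷ Ks′) ek , rest
      where
      ek : k ≡ j
      ek = open-top-letter c k Ks′ x X Y (proj₁ (1≤⇒suc (st k (here refl)))) (proj₂ (1≤⇒suc (st k (here refl)))) eL hC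
      e1 : openList c (j ∷ Ks′) ≡ X ++ x ∷ Y
      e1 = subst (λ k′ → openList c (k′ ∷ Ks′) ≡ X ++ x ∷ Y) ek eL
      UL′ : Distinct (block j (c j) ++ openList c Ks′)
      UL′ = subst (λ k′ → Distinct (openList c (k′ ∷ Ks′))) ek UL
      rest : c j ≡ ℓ j × x ≡ pointOf j (c j) × X ≡ block⁺ j (ℓ j ∸ 1) × Y ≡ openList c Ks′
      rest with block-∈⁻ j (c j) xb
      ... | i , i<c , ex = top-block-closed c j Ks′ x X Y jz refl e1 UL′ nX hC i i<c ex

  cycleOf-full′ : ∀ j → j ≢ zero → ∀ {y} → orbitOf y ≡ j → y ∈ cycleOf j
  cycleOf-full′ zero jz e = ⊥-elim (jz refl)
  cycleOf-full′ (suc i) jz e = cycleOf-full i e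

  pointOf0-base : ∀ j → j ≢ zero → pointOf j 0 ≡ base j
  pointOf0-base zero jz = ⊥-elim (jz refl)
  pointOf0-base (suc i) jz = refl

  orbitOf-f : ∀ x → orbitOf (f x) ≡ orbitOf x
  orbitOf-f x = sym (inOrbit⇒same-orbitOf (1 , refl))

  encInv-step : ∀ {c Ks Cl} c′ Ks′ Cl′ x v′ s′ → EncInv c Ks Cl (x ∷ v′) → step x (stateOf c Ks Cl) ≡ s′ → MergeFree v′ s′ →
    stateOf c′ Ks′ Cl′ ≡ s′ → StackInv Ks′ Cl′ → Started c′ Ks′ →
    (∀ j → j ≢ zero → c′ j ≡ 0 ⊎ (j ∈ Ks′ ⊎ j ∈ Cl′)) →
    (∀ j → j ≢ zero → c′ j ≡ 0 → ∀ y → firstIn j v′ ≡ just y → y ≡ base j) → EncInv c′ Ks′ Cl′ v′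
  encInv-step {c} {Ks} {Cl} c′ Ks′ Cl′ x v′ s′ A eS h′ eSt l3 s3 s4 f4 = record
    { mergeFree = subst (MergeFree v′) (sym eSt) h′
    ; distinct = subst (λ s → Distinct (zero ∷ points s)) (trans eS (sym eSt)) (step-distinct x (openList c Ks) (closedCycles Cl) xz (distinct A))
    ; nonzero = tl (nonzero A)
    ; represents = subst (λ s → Represents f (run v′ s)) (trans eS (sym eSt)) (represents A)
    ; covers-nonzero = λ y yz → subst (λ s → y ∈ points (run v′ s)) (trans eS (sym eSt)) (covers-nonzero A y yz)
    ; stackInv = l3 ; started = s3 ; unseen-or-listed = s4 ; first-is-rep = f4 }
    where
    xz : x ≢ zero
    xz with nonzero A
    ... | h ∷ _ = h
    tl : AllNonZero (x ∷ v′) → AllNonZero v′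
    tl (_ ∷ t) = t

  module Extend {c : Letter → ℕ} {Ks Cl : List Letter} {x : Point} {v′ : List Point} (A : EncInv c Ks Cl (x ∷ v′))
                (eS : step x (stateOf c Ks Cl) ≡ (x ∷ openList c Ks , closedCycles Cl))
                (h′ : MergeFree v′ (x ∷ openList c Ks , closedCycles Cl)) where
    s′ : State
    s′ = (x ∷ openList c Ks , closedCycles Cl)
    xz : x ≢ zero
    xz with nonzero A
    ... | h ∷ _ = h
    nz′ : AllNonZero v′
    nz′ with nonzero A
    ... | _ ∷ t = t
    rf′ : Represents f (run v′ s′)
    rf′ = subst (λ s → Represents f (run v′ s)) eS (represents A)
    U′ : Distinct (zero ∷ points s′)
    U′ = subst (λ s → Distinct (zero ∷ points s)) eS (step-distinct x (openList c Ks) (closedCycles Cl) xz (distinct A))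
    Uf : Distinct (zero ∷ points (run v′ s′))
    Uf = run-distinct v′ s′ nz′ U′
    wch : ChainOff v′ f x (openList c Ks) zero
    wch = proj₂ (represents-backward v′ s′ f h′ rf′)
    doneCyc : ∀ {C} → C ∈ proj₂ (run v′ s′) → IsCycle f C
    doneCyc CD = All.lookup (proj₁ (proj₂ rf′)) CD
    x=gfx : ∀ {y} → f x ≡ y → x ≡ g y
    x=gfx e = trans (sym (g∘f x)) (cong g e)

    extend-letter1 : orbitOf x ≡ zero → Ks ≡ [] × x ≡ pointOf zero (c zero)
    extend-letter1 ejz with chainOff-head v′ f x (openList c Ks) wch xv
      where
      xv : x ∉ v′
      xv q with reused-closes v′ s′ h′ U′ nz′ x (here refl) q
      ... | C , CD , xC = distinct-head (points (run v′ s′)) Uf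
            (∈-++⁺ʳ (proj₁ (run v′ s′)) (∈-concat⁺′ (cycle-full-orbit C (doneCyc CD) xC (trans orbitOf-0 (sym ejz))) CD))
    ... | inj₁ (eL0 , fx0) with openList-empty c Ks (started A) eL0
    ... | eK , c0 = eK , trans (x=gfx fx0) (cong (pointOf zero) (sym c0))
    extend-letter1 ejz | inj₂ (h , T , eL1 , fxh) with openList-head c Ks (started A) eL1
    ... | inj₁ (eK , t , ct , eh) = eK , trans (x=gfx fxh) (trans (cong g eh) (trans (sym (pointOf-suc zero t)) (cong (pointOf zero) (sym ct))))
    ... | inj₂ (k′ , Ks′ , t , refl , ct , eh) = ⊥-elim (1∉stack (stackInv A) (here (sym (trans (sym (orbitOf-pointOf k′ t)) (trans (cong orbitOf (sym eh)) (trans (cong orbitOf (sym fxh)) (trans (orbitOf-f x) ejz)))))))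

    extend-open : orbitOf x ≢ zero → orbitOf x ∈ Ks → ∃ λ Ks′ → Ks ≡ orbitOf x ∷ Ks′ × x ≡ pointOf (orbitOf x) (c (orbitOf x))
    extend-open jnz jK with chainOff-head v′ f x (openList c Ks) wch xv
      where
      m0 : pointOf (orbitOf x) 0 ∈ openList c Ks
      m0 = openList-∈⁺ c Ks (orbitOf x) jK (block-∈⁺ (orbitOf x) (c (orbitOf x)) 0 (started A (orbitOf x) jK))
      xv : x ∉ v′
      xv q with used-separated v′ s′ h′ U′ nz′ [] x (openList c Ks) (pointOf (orbitOf x) 0) refl m0 q
      ... | C , CD , xC , nC = nC (cycle-full-orbit C (doneCyc CD) xC (orbitOf-pointOf (orbitOf x) 0))
    ... | inj₁ (_ , fx0) = ⊥-elim (jnz (trans (sym (orbitOf-f x)) (trans (cong orbitOf fx0) orbitOf-0)))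
    ... | inj₂ (h , T , eL1 , fxh) with openList-head c Ks (started A) eL1
    ... | inj₁ (refl , _) = ⊥-elim (jK′ jK)
      where
      jK′ : orbitOf x ∉ []
      jK′ ()
    ... | inj₂ (k′ , Ks′ , t , refl , ct , eh) = Ks′ , cong (_∷ Ks′) ekj , trans (x=gfx fxh) (trans (cong g eh) (trans (sym (pointOf-suc k′ t)) (trans (cong (pointOf k′) (sym ct)) (cong (λ z → pointOf z (c z)) ekj))))
      where
      ekj : k′ ≡ orbitOf x
      ekj = trans (sym (orbitOf-pointOf k′ t)) (trans (cong orbitOf (sym eh)) (trans (cong orbitOf (sym fxh)) (orbitOf-f x)))

  Encodes : List Point → Set
  Encodes v = ∀ c Ks Cl → EncInv c Ks Cl v → Accepts c Ks Cl (map orbitOf v) × v ≡ decodeFrom c (map orbitOf v)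

  encode-last : ∀ {c Ks Cl x v′} X Y → Encodes v′ → EncInv c Ks Cl (x ∷ v′) → openList c Ks ≡ X ++ x ∷ Y → x ∉ X →
    step x (stateOf c Ks Cl) ≡ (Y , (x ∷ X) ∷ closedCycles Cl) → MergeFree v′ (Y , (x ∷ X) ∷ closedCycles Cl) →
    Accepts c Ks Cl (map orbitOf (x ∷ v′)) × x ∷ v′ ≡ decodeFrom c (map orbitOf (x ∷ v′))
  encode-last {c} {Ks} {Cl} {x} {v′} X Y ih A eL nX eS h′ with split-closes-top c Ks Cl x X Y (distinct A) (started A) eL nX
    (All.head (proj₁ (represents-backward v′ (Y , (x ∷ X) ∷ closedCycles Cl) f h′ (subst (λ s → Represents f (run v′ s)) eS (represents A)))))
  ... | jz , Ks′ , refl , cℓ , ex , eX , eY = last j jz cℓ (proj₁ IH) , cong₂ _∷_ ex (proj₂ IH)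
    where
    j = orbitOf x
    jK′ : j ∉ Ks′
    jK′ = distinct-head {x = j} _ (stack-distinct (stackInv A))
    ex0 : x ≡ pointOf j 0
    ex0 = trans ex (trans (cong (pointOf j) cℓ) (pointOf-period′ j jz))
    eSt : stateOf (bump c j) Ks′ (j ∷ Cl) ≡ (Y , (x ∷ X) ∷ closedCycles Cl)
    eSt = cong₂ _,_ (trans (openList-bump c Ks′ j jK′ jz) (sym eY)) (cong (_∷ closedCycles Cl) (cong₂ _∷_ (sym ex0) (sym eX)))
    s4 : ∀ i → i ≢ zero → bump c j i ≡ 0 ⊎ (i ∈ Ks′ ⊎ i ∈ j ∷ Cl)
    s4 i iz with i ≟ j
    ... | yes refl = inj₂ (inj₂ (here refl))
    ... | no ne with unseen-or-listed A i iz
    ... | inj₁ e = inj₁ e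
    ... | inj₂ (inj₁ (here e)) = ⊥-elim (ne e)
    ... | inj₂ (inj₁ (there q)) = inj₂ (inj₁ q)
    ... | inj₂ (inj₂ q) = inj₂ (inj₂ (there q))
    f4 : ∀ i → i ≢ zero → bump c j i ≡ 0 → ∀ y → firstIn i v′ ≡ just y → y ≡ base i
    f4 i iz ci y ey with i ≟ j
    ... | yes refl = ⊥-elim (1+n≢0 ci)
    ... | no ne = first-is-rep A i iz ci y (trans (firstIn-skip i x v′ (λ e → ne (sym e))) ey)
    A′ : EncInv (bump c j) Ks′ (j ∷ Cl) v′
    A′ = encInv-step (bump c j) Ks′ (j ∷ Cl) x v′ _ A eS h′ eSt (stackInv-pop j (stackInv A))
           (λ i iK → subst (1 ≤_) (sym (bump-other c j i (λ e → jK′ (subst (_∈ Ks′) e iK)))) (started A i (there iK))) s4 f4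
    IH = ih (bump c j) Ks′ (j ∷ Cl) A′

  encode-one : ∀ {c Ks Cl x v′} → Encodes v′ → EncInv c Ks Cl (x ∷ v′) →
    step x (stateOf c Ks Cl) ≡ (x ∷ openList c Ks , closedCycles Cl) → MergeFree v′ (x ∷ openList c Ks , closedCycles Cl) →
    orbitOf x ≡ zero → Accepts c Ks Cl (map orbitOf (x ∷ v′)) × x ∷ v′ ≡ decodeFrom c (map orbitOf (x ∷ v′))
  encode-one {c} {Ks} {Cl} {x} {v′} ih A eS h′ ejz with Extend.extend-letter1 A eS h′ ejz
  ... | refl , ex rewrite ejz = one cond (proj₁ IH) , cong₂ _∷_ ex (proj₂ IH)
    where
    xz : x ≢ zero
    xz = Extend.xz A eS h′
    cond : suc (c zero) < ℓ zero
    cond with ℓ zero ≤? suc (c zero)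
    ... | no nle = ≰⇒> nle
    ... | yes le with m≤n⇒m<n∨m≡n le
    ... | inj₂ eq = ⊥-elim (xz (trans ex (trans (cong (λ n → iter g n zero) (sym eq)) (iter-g-period (period-base zero)))))
    ... | inj₁ lt with ℓ zero | 1≤ℓ zero | iter-g-period (period-base zero)
    ... | suc i | _ | gr = ⊥-elim (distinct-head (openList c [] ++ concat (closedCycles Cl)) (distinct A) (∈-++⁺ˡ {ys = _} zin))
      where
      zin : zero ∈ openList c []
      zin = subst (_∈ openList c []) gr (block-∈⁺ zero (c zero) i (≤-pred lt))
    eSt : stateOf (bump c zero) [] Cl ≡ (x ∷ openList c [] , closedCycles Cl)
    eSt = cong (_, closedCycles Cl) (trans (cong (block zero) (bump-same c zero)) (cong (_∷ block zero (c zero)) (sym ex)))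
    s4 : ∀ i → i ≢ zero → bump c zero i ≡ 0 ⊎ (i ∈ [] ⊎ i ∈ Cl)
    s4 i iz with unseen-or-listed A i iz
    ... | inj₁ e = inj₁ (trans (bump-other c zero i iz) e)
    ... | inj₂ (inj₁ ())
    ... | inj₂ (inj₂ q) = inj₂ (inj₂ q)
    f4 : ∀ i → i ≢ zero → bump c zero i ≡ 0 → ∀ y → firstIn i v′ ≡ just y → y ≡ base i
    f4 i iz ci y ey = first-is-rep A i iz (trans (sym (bump-other c zero i iz)) ci) y (trans (firstIn-skip i x v′ (λ e → iz (trans (sym e) ejz))) ey)
    A′ : EncInv (bump c zero) [] Cl v′
    A′ = encInv-step (bump c zero) [] Cl x v′ _ A eS h′ eSt (stackInv A) (λ _ ()) s4 f4
    IH = ih (bump c zero) [] Cl A′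

  encode-first : ∀ {c Ks Cl x v′} → Encodes v′ → EncInv c Ks Cl (x ∷ v′) → x ∉ concat (closedCycles Cl) →
    step x (stateOf c Ks Cl) ≡ (x ∷ openList c Ks , closedCycles Cl) → MergeFree v′ (x ∷ openList c Ks , closedCycles Cl) →
    orbitOf x ≢ zero → c (orbitOf x) ≡ 0 → Accepts c Ks Cl (map orbitOf (x ∷ v′)) × x ∷ v′ ≡ decodeFrom c (map orbitOf (x ∷ v′))
  encode-first {c} {Ks} {Cl} {x} {v′} ih A nD eS h′ jnz c0 = first j jnz jK jC c0 (proj₁ IH) , cong₂ _∷_ ex′ (proj₂ IH)
    where
    j = orbitOf x
    ex : x ≡ base j
    ex = first-is-rep A j jnz c0 x (firstIn-hit j x v′ refl)
    ex0 : x ≡ pointOf j 0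
    ex0 = trans ex (sym (pointOf0-base j jnz))
    ex′ : x ≡ pointOf j (c j)
    ex′ = trans ex0 (cong (pointOf j) (sym c0))
    jK : j ∉ Ks
    jK q = 1+n≰n (≤-trans (started A j q) (≤-reflexive c0))
    jC : j ∉ Cl
    jC q = nD (closedCycles-∈⁺ Cl j q (cycleOf-full′ j jnz refl))
    eSt : stateOf (bump c j) (j ∷ Ks) Cl ≡ (x ∷ openList c Ks , closedCycles Cl)
    eSt = cong (_, closedCycles Cl) (trans (cong₂ (λ n L → block j n ++ L) (bump-same c j) (openList-bump c Ks j jK jnz))
            (trans (cong (λ n → pointOf j n ∷ block j n ++ openList c Ks) c0) (cong (_∷ openList c Ks) (sym ex0))))
    si3′ : Started (bump c j) (j ∷ Ks)
    si3′ i (here refl) = subst (1 ≤_) (sym (bump-same c i)) (s≤s z≤n)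
    si3′ i (there q) = subst (1 ≤_) (sym (bump-other c j i (λ e → jK (subst (_∈ Ks) e q)))) (started A i q)
    s4 : ∀ i → i ≢ zero → bump c j i ≡ 0 ⊎ (i ∈ j ∷ Ks ⊎ i ∈ Cl)
    s4 i iz with i ≟ j
    ... | yes refl = inj₂ (inj₁ (here refl))
    ... | no ne with unseen-or-listed A i iz
    ... | inj₁ e = inj₁ e
    ... | inj₂ (inj₁ q) = inj₂ (inj₁ (there q))
    ... | inj₂ (inj₂ q) = inj₂ (inj₂ q)
    f4 : ∀ i → i ≢ zero → bump c j i ≡ 0 → ∀ y → firstIn i v′ ≡ just y → y ≡ base i
    f4 i iz ci y ey with i ≟ j
    ... | yes refl = ⊥-elim (1+n≢0 ci)
    ... | no ne = first-is-rep A i iz ci y (trans (firstIn-skip i x v′ (λ e → ne (sym e))) ey)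
    A′ : EncInv (bump c j) (j ∷ Ks) Cl v′
    A′ = encInv-step (bump c j) (j ∷ Ks) Cl x v′ _ A eS h′ eSt (stackInv-push j jnz jK jC (stackInv A)) si3′ s4 f4
    IH = ih (bump c j) (j ∷ Ks) Cl A′

  encode-again : ∀ {c Ks Cl x v′} → Encodes v′ → EncInv c Ks Cl (x ∷ v′) → x ∉ openList c Ks →
    step x (stateOf c Ks Cl) ≡ (x ∷ openList c Ks , closedCycles Cl) → MergeFree v′ (x ∷ openList c Ks , closedCycles Cl) →
    orbitOf x ≢ zero → orbitOf x ∈ Ks → Accepts c Ks Cl (map orbitOf (x ∷ v′)) × x ∷ v′ ≡ decodeFrom c (map orbitOf (x ∷ v′))
  encode-again {c} {Ks} {Cl} {x} {v′} ih A nL eS h′ jnz jK with Extend.extend-open A eS h′ jnz jK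
  ... | Ks′ , refl , ex = again j jnz cond (proj₁ IH) , cong₂ _∷_ ex (proj₂ IH)
    where
    j = orbitOf x
    jK′ : j ∉ Ks′
    jK′ = distinct-head {x = j} _ (stack-distinct (stackInv A))
    Ub : Distinct (block j (c j))
    Ub = distinct-++⁻ˡ (block j (c j)) (openList c Ks′) (distinct-++⁻ˡ (openList c (j ∷ Ks′)) (concat (closedCycles Cl)) (distinct-tail {x = zero} _ (distinct A)))
    cpos : 1 ≤ c j
    cpos = started A j (here refl)
    cond : c j < ℓ j
    cond with c j <? ℓ j
    ... | yes lt = lt
    ... | no nlt with m≤n⇒m<n∨m≡n (≮⇒≥ nlt)
    ... | inj₂ eq = ⊥-elim (nL (subst (_∈ openList c (j ∷ Ks′)) (sym (trans ex (trans (cong (pointOf j) (sym eq)) (pointOf-period′ j jnz))))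
                      (openList-∈⁺ c (j ∷ Ks′) j (here refl) (block-∈⁺ j (c j) 0 cpos))))
    ... | inj₁ lt = ⊥-elim (1+n≰n (≤-trans (1≤ℓ j) (≤-reflexive (block-distinct⇒injective j (c j) Ub (ℓ j) 0 lt cpos (pointOf-period′ j jnz)))))
    eSt : stateOf (bump c j) (j ∷ Ks′) Cl ≡ (x ∷ openList c (j ∷ Ks′) , closedCycles Cl)
    eSt = cong (_, closedCycles Cl) (trans (cong₂ (λ n L → block j n ++ L) (bump-same c j) (openList-bump c Ks′ j jK′ jnz))
            (cong (_∷ block j (c j) ++ openList c Ks′) (sym ex)))
    si3′ : Started (bump c j) (j ∷ Ks′)
    si3′ i (here refl) = subst (1 ≤_) (sym (bump-same c i)) (s≤s z≤n)
    si3′ i (there q) = subst (1 ≤_) (sym (bump-other c j i (λ e → jK′ (subst (_∈ Ks′) e q)))) (started A i (there q))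
    s4 : ∀ i → i ≢ zero → bump c j i ≡ 0 ⊎ (i ∈ j ∷ Ks′ ⊎ i ∈ Cl)
    s4 i iz with i ≟ j
    ... | yes refl = inj₂ (inj₁ (here refl))
    ... | no ne = unseen-or-listed A i iz
    f4 : ∀ i → i ≢ zero → bump c j i ≡ 0 → ∀ y → firstIn i v′ ≡ just y → y ≡ base i
    f4 i iz ci y ey with i ≟ j
    ... | yes refl = ⊥-elim (1+n≢0 ci)
    ... | no ne = first-is-rep A i iz ci y (trans (firstIn-skip i x v′ (λ e → ne (sym e))) ey)
    A′ : EncInv (bump c j) (j ∷ Ks′) Cl v′
    A′ = encInv-step (bump c j) (j ∷ Ks′) Cl x v′ _ A eS h′ eSt (stackInv A) si3′ s4 f4
    IH = ih (bump c j) (j ∷ Ks′) Cl A′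

  encode-accepts : ∀ v → Encodes v
  encode-accepts [] c Ks Cl A = encode-end c Ks Cl A , refl
  encode-accepts (x ∷ v) c Ks Cl A with mergeFreeStep x v (openList c Ks) (closedCycles Cl) (mergeFree A)
  ... | mf-split X Y eL nX eS h′ = encode-last X Y (encode-accepts v) A eL nX eS h′
  ... | mf-extend nL nD eS h′ with orbitOf x ≟ zero
  ... | yes x∈O₁ = encode-one (encode-accepts v) A eS h′ x∈O₁
  ... | no jnz with unseen-or-listed A (orbitOf x) jnz
  ... | inj₁ c0 = encode-first (encode-accepts v) A nD eS h′ jnz c0
  ... | inj₂ (inj₁ jK) = encode-again (encode-accepts v) A nL eS h′ jnz jK
  ... | inj₂ (inj₂ jC) = ⊥-elim (nD (closedCycles-∈⁺ Cl (orbitOf x) jC (cycleOf-full′ (orbitOf x) jnz refl)))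

module Decoding (k p : ℕ) (π : Permutation′ (suc k)) (orbits : OrbitListing π (suc p))
                (ℓ : Fin (suc p) → ℕ) (H : ∀ j → OrbitSize π (lead orbits j) (ℓ j))
                (rep : Fin p → Fin (suc k)) (rep-orbit : ∀ i → Orbits.orbitOf k p π orbits ℓ H (rep i) ≡ suc i) where

  open StarMachine k
  open Orbits k p π orbits ℓ H
  open Blocks k p π orbits ℓ H rep rep-orbit
  open Encoding k p π orbits ℓ H rep rep-orbit

  extend-step : ∀ x L D → x ∉ L → x ∉ concat D → NoMergeStep x (L , D) (x ∷ L , D)
  extend-step x L D nL nD rewrite cutAt-none x L nL | findCycle-none x D nD = refl , refl

  split-step : ∀ x X Y D → x ∉ X → NoMergeStep x (X ++ x ∷ Y , D) (Y , (x ∷ X) ∷ D)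
  split-step x X Y D nX rewrite cutAt-found x X Y nX = refl , refl

  record DecodeRun (c : Letter → ℕ) (Ks Cl : List Letter) (u : List Letter) : Set where
    field
      mergeFree : MergeFree (decodeFrom c u) (stateOf c Ks Cl)
      nonzero : AllNonZero (decodeFrom c u)
      finalCounts : Letter → ℕ
      finalClosed : List Letter
      final : run (decodeFrom c u) (stateOf c Ks Cl) ≡ stateOf finalCounts [] finalClosed
      all-closed : ∀ j → j ≢ zero → j ∈ finalClosed
      final-count₀ : finalCounts zero ≡ ℓ zero ∸ 1
      final-stackInv : StackInv [] finalClosed
  open DecodeRun

  pointOf-injective′ : ∀ j → j ≢ zero → ∀ a b → a < ℓ j → b < ℓ j → pointOf j a ≡ pointOf j b → a ≡ b
  pointOf-injective′ zero jz = ⊥-elim (jz refl)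
  pointOf-injective′ (suc i) jz = pointOf-injective i

  decodeRun-step : ∀ {c Ks Cl Ks′ Cl′} j u → NoMergeStep (pointOf j (c j)) (stateOf c Ks Cl) (stateOf (bump c j) Ks′ Cl′) →
    pointOf j (c j) ≢ zero → DecodeRun (bump c j) Ks′ Cl′ u → DecodeRun c Ks Cl (j ∷ u)
  decodeRun-step {c} {Ks} {Cl} j u (eS , em) xz O = record
    { mergeFree = trans (cong₂ _+_ em (cong (merges (decodeFrom (bump c j) u)) eS)) (mergeFree O)
    ; nonzero = xz ∷ nonzero O
    ; finalCounts = finalCounts O ; finalClosed = finalClosed O
    ; final = trans (cong (run (decodeFrom (bump c j) u)) eS) (final O)
    ; all-closed = all-closed O ; final-count₀ = final-count₀ O ; final-stackInv = final-stackInv O }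

  orbitOf≢⇒≢0 : ∀ {x} j → j ≢ zero → orbitOf x ≡ j → x ≢ zero
  orbitOf≢⇒≢0 j jz e refl = jz (trans (sym e) orbitOf-0)

  pointOf≢0 : ∀ j {t} → j ≢ zero → pointOf j t ≢ zero
  pointOf≢0 j jz = orbitOf≢⇒≢0 j jz (orbitOf-pointOf j _)

  decode-one : ∀ {c Cl} → suc (c zero) < ℓ zero → StackInv [] Cl →
    NoMergeStep (pointOf zero (c zero)) (stateOf c [] Cl) (stateOf (bump c zero) [] Cl)
  decode-one {c} {Cl} cond I = eS , proj₂ ps
    where
    x = pointOf zero (c zero)
    nL : x ∉ openList c []
    nL q with block-∈⁻ zero (c zero) q
    ... | i , i<c , e = <-irrefl (sym (pointOf₀-injective (c zero) i cond (≤-trans (s≤s i<c) (<⇒≤ cond)) e)) i<c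
    nD : x ∉ concat (closedCycles Cl)
    nD q = 1∉closed I (subst (_∈ Cl) (orbitOf-pointOf zero (c zero)) (closedCycles-∈⁻ Cl q))
    ps = extend-step x (openList c []) (closedCycles Cl) nL nD
    eS : step x (stateOf c [] Cl) ≡ stateOf (bump c zero) [] Cl
    eS = trans (proj₁ ps) (cong (_, closedCycles Cl) (cong (block zero) (sym (bump-same c zero))))

  decode-first : ∀ {c Ks Cl} j → j ≢ zero → j ∉ Ks → j ∉ Cl → c j ≡ 0 →
    NoMergeStep (pointOf j (c j)) (stateOf c Ks Cl) (stateOf (bump c j) (j ∷ Ks) Cl)
  decode-first {c} {Ks} {Cl} j jz jK jC c0 = eS , proj₂ ps
    where
    x = pointOf j (c j)
    nL : x ∉ openList c Ks
    nL q with proj₂ (openList-∈⁻ c Ks q)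
    ... | inj₁ e = jz (trans (sym (orbitOf-pointOf j (c j))) e)
    ... | inj₂ r = jK (subst (_∈ Ks) (orbitOf-pointOf j (c j)) r)
    nD : x ∉ concat (closedCycles Cl)
    nD q = jC (subst (_∈ Cl) (orbitOf-pointOf j (c j)) (closedCycles-∈⁻ Cl q))
    ps = extend-step x (openList c Ks) (closedCycles Cl) nL nD
    eS : step x (stateOf c Ks Cl) ≡ stateOf (bump c j) (j ∷ Ks) Cl
    eS = trans (proj₁ ps) (cong (_, closedCycles Cl) (sym (trans (cong₂ (λ n L → block j n ++ L) (bump-same c j) (openList-bump c Ks j jK jz))
           (cong (λ n → pointOf j (c j) ∷ block j n ++ openList c Ks) c0))))

  decode-again : ∀ {c Ks Cl} j → j ≢ zero → c j < ℓ j → StackInv (j ∷ Ks) Cl →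
    NoMergeStep (pointOf j (c j)) (stateOf c (j ∷ Ks) Cl) (stateOf (bump c j) (j ∷ Ks) Cl)
  decode-again {c} {Ks} {Cl} j jz lt I = eS , proj₂ ps
    where
    x = pointOf j (c j)
    jK : j ∉ Ks
    jK = distinct-head {x = j} _ (stack-distinct I)
    dinj : ∀ a b → a < ℓ j → b < ℓ j → pointOf j a ≡ pointOf j b → a ≡ b
    dinj = pointOf-injective′ j jz
    nL : x ∉ openList c (j ∷ Ks)
    nL q with ∈-++⁻ (block j (c j)) q
    ... | inj₁ r with block-∈⁻ j (c j) r
    ... | i , i<c , e = <-irrefl (sym (dinj (c j) i lt (≤-trans i<c (<⇒≤ lt)) e)) i<c
    nL q | inj₂ r with proj₂ (openList-∈⁻ c Ks r)
    ... | inj₁ e = jz (trans (sym (orbitOf-pointOf j (c j))) e)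
    ... | inj₂ r′ = jK (subst (_∈ Ks) (orbitOf-pointOf j (c j)) r′)
    nD : x ∉ concat (closedCycles Cl)
    nD q = stack-closed-disjoint I j (here refl) (subst (_∈ Cl) (orbitOf-pointOf j (c j)) (closedCycles-∈⁻ Cl q))
    ps = extend-step x (openList c (j ∷ Ks)) (closedCycles Cl) nL nD
    eS : step x (stateOf c (j ∷ Ks) Cl) ≡ stateOf (bump c j) (j ∷ Ks) Cl
    eS = trans (proj₁ ps) (cong (_, closedCycles Cl) (sym (cong₂ (λ n L → block j n ++ L) (bump-same c j) (openList-bump c Ks j jK jz))))

  decode-last : ∀ {c Ks Cl} j → j ≢ zero → c j ≡ ℓ j → StackInv (j ∷ Ks) Cl →
    NoMergeStep (pointOf j (c j)) (stateOf c (j ∷ Ks) Cl) (stateOf (bump c j) Ks (j ∷ Cl))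
  decode-last {c} {Ks} {Cl} j jz eq I = eS , proj₂ ss
    where
    x = pointOf j (c j)
    jK : j ∉ Ks
    jK = distinct-head {x = j} _ (stack-distinct I)
    tℓ = 1≤⇒suc (1≤ℓ j)
    t = proj₁ tℓ
    ex : x ≡ pointOf j 0
    ex = trans (cong (pointOf j) eq) (pointOf-period′ j jz)
    nX : pointOf j 0 ∉ block⁺ j t
    nX q with block⁺-∈⁻ j t q
    ... | i , i1 , it , e = 1+n≰n (subst (1 ≤_) (sym (pointOf-injective′ j jz 0 i (1≤ℓ j) (≤-trans (s≤s it) (≤-reflexive (sym (proj₂ tℓ)))) e)) i1)
    eL : openList c (j ∷ Ks) ≡ block⁺ j t ++ x ∷ openList c Ks
    eL = begin
      block j (c j) ++ openList c Ks                   ≡⟨ cong (λ n → block j n ++ openList c Ks) (trans eq (proj₂ tℓ)) ⟩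
      block j (suc t) ++ openList c Ks                 ≡⟨ cong (_++ openList c Ks) (block-snoc j t) ⟩
      (block⁺ j t ++ [ pointOf j 0 ]) ++ openList c Ks ≡⟨ ++-assoc (block⁺ j t) [ pointOf j 0 ] (openList c Ks) ⟩
      block⁺ j t ++ pointOf j 0 ∷ openList c Ks        ≡⟨ cong (λ y → block⁺ j t ++ y ∷ openList c Ks) (sym ex) ⟩
      block⁺ j t ++ x ∷ openList c Ks                  ∎
      where open ≡-Reasoning
    ss : NoMergeStep x (openList c (j ∷ Ks) , closedCycles Cl) (openList c Ks , (x ∷ block⁺ j t) ∷ closedCycles Cl)
    ss = subst (λ L → NoMergeStep x (L , closedCycles Cl) (openList c Ks , (x ∷ block⁺ j t) ∷ closedCycles Cl)) (sym eL)
           (split-step x (block⁺ j t) (openList c Ks) (closedCycles Cl) (subst (_∉ block⁺ j t) (sym ex) nX))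
    eS : step x (stateOf c (j ∷ Ks) Cl) ≡ stateOf (bump c j) Ks (j ∷ Cl)
    eS = trans (proj₁ ss) (cong₂ _,_ (sym (openList-bump c Ks j jK jz)) (cong (_∷ closedCycles Cl) (cong₂ _∷_ ex (cong (block⁺ j) (cong (_∸ 1) (sym (proj₂ tℓ)))))))

  decode-run : ∀ {c Ks Cl u} → Accepts c Ks Cl u → StackInv Ks Cl → DecodeRun c Ks Cl u
  decode-run {c} {Cl = Cl} (done all-closed c0) I = record
    { mergeFree = refl ; nonzero = [] ; finalCounts = c ; finalClosed = Cl ; final = refl
    ; all-closed = all-closed ; final-count₀ = c0 ; final-stackInv = I }
  decode-run {c} (one cond a) I = decodeRun-step zero _ (decode-one {c} cond I) (pointOf₀≢0 _ cond) (decode-run a I)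
  decode-run {c} (first j jz jK jC c0 a) I =
    decodeRun-step j _ (decode-first {c} j jz jK jC c0) (pointOf≢0 j jz) (decode-run a (stackInv-push j jz jK jC I))
  decode-run {c} (again j jz lt a) I = decodeRun-step j _ (decode-again {c} j jz lt I) (pointOf≢0 j jz) (decode-run a I)
  decode-run {c} (last j jz eq a) I = decodeRun-step j _ (decode-last {c} j jz eq I) (pointOf≢0 j jz) (decode-run a (stackInv-pop j I))

  block₀-chain : ∀ n x → f x ≡ iter g n zero → Chain f x (block zero n) zero
  block₀-chain zero x e = e
  block₀-chain (suc n) x e = e , block₀-chain n (pointOf zero n) (f∘g (iter g n zero))

  block⁺-chain : ∀ i n x → f x ≡ iter g n (rep i) → Chain f x (block⁺ (suc i) n) (rep i)
  block⁺-chain i zero x e = e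
  block⁺-chain i (suc n) x e = e , block⁺-chain i n _ (f∘g (iter g n (rep i)))

  cycleOf-isCycle : ∀ j → j ≢ zero → IsCycle f (cycleOf j)
  cycleOf-isCycle zero jz = ⊥-elim (jz refl)
  cycleOf-isCycle (suc i) jz = block⁺-chain i (ℓ (suc i) ∸ 1) (rep i) (f-as-iter-g (period-base (suc i)))

  closedCycles-areCycles : ∀ Cl → zero ∉ Cl → All (IsCycle f) (closedCycles Cl)
  closedCycles-areCycles [] _ = []
  closedCycles-areCycles (j ∷ Cl) zC = cycleOf-isCycle j (λ e → zC (here (sym e))) ∷ closedCycles-areCycles Cl (λ q → zC (there q))

  final-covers : ∀ c Cl → (∀ j → j ≢ zero → j ∈ Cl) → c zero ≡ ℓ zero ∸ 1 →
    ∀ x → x ≢ zero → x ∈ points (stateOf c [] Cl)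
  final-covers c Cl aC c0 x xz with orbitOf x ≟ zero
  ... | yes e with orbit₀⇒pointOf e xz
  ... | a , al , ea =
    ∈-++⁺ˡ {ys = concat (closedCycles Cl)} (subst (_∈ block zero (c zero)) ea (block-∈⁺ zero (c zero) a (subst (a <_) (sym c0) (∸-monoˡ-≤ 1 al))))
  final-covers c Cl aC c0 x xz | no ne =
    ∈-++⁺ʳ (block zero (c zero)) (closedCycles-∈⁺ Cl (orbitOf x) (aC (orbitOf x) ne) (cycleOf-full′ (orbitOf x) ne refl))

  final-represents : ∀ c Cl → StackInv [] Cl → (∀ j → j ≢ zero → j ∈ Cl) →
    c zero ≡ ℓ zero ∸ 1 → Represents f (stateOf c [] Cl)
  final-represents c Cl I aC c0 =
    block₀-chain (c zero) zero (trans (f-as-iter-g (period-base zero)) (cong (λ n → iter g n zero) (sym c0))) ,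
    closedCycles-areCycles Cl (1∉closed I) , oth
    where
    oth : ∀ x → x ∉ zero ∷ points (stateOf c [] Cl) → f x ≡ x
    oth x h with x ≟ zero
    ... | yes e = ⊥-elim (h (here e))
    ... | no xz = ⊥-elim (h (there (final-covers c Cl aC c0 x xz)))

  decode-correct : ∀ u → Accepts (λ _ → 0) [] [] u →
    AllNonZero (decodeFrom (λ _ → 0) u) × (∀ x → prod (decodeFrom (λ _ → 0) u) x ≡ f x) × (∀ x → x ≢ zero → x ∈ decodeFrom (λ _ → 0) u)
  decode-correct u acc = nonzero O , pe , inw
    where
    O = decode-run acc stackInv-init
    w = decodeFrom (λ _ → 0) u
    sf = run w ([] , [])
    Rp : Represents (λ x → prod w x) sf
    Rp = run-represents w (λ x → x) [] [] (nonzero O) (distinct-singleton zero) represents-id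
    Rf : Represents f sf
    Rf = subst (Represents f) (sym (final O)) (final-represents (finalCounts O) (finalClosed O) (final-stackInv O) (all-closed O) (final-count₀ O))
    pe : ∀ x → prod w x ≡ f x
    pe = represents-unique (λ x → prod w x) f (proj₁ sf) (proj₂ sf) Rp Rf
    inw : ∀ x → x ≢ zero → x ∈ w
    inw x xz with run-points⁻ w ([] , []) x (subst (λ s → x ∈ points s) (sym (final O)) (final-covers (finalCounts O) (finalClosed O) (all-closed O) (final-count₀ O) x xz))
    ... | inj₁ ()
    ... | inj₂ q = q

module Bijection (k p : ℕ) (π : Permutation′ (suc k)) (orbits : OrbitListing π (suc p))
            (ℓ : Fin (suc p) → ℕ) (H : ∀ j → OrbitSize π (lead orbits j) (ℓ j)) where

  open StarMachine k
  open Orbits k p π orbits ℓ H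
  open LabelWords p ℓ 1≤ℓ

  minimal⇒mergeFree : ∀ (w : List Point) → length w ≡ suc k + suc p ∸ 2 → Represents f (run w ([] , [])) → (∀ x → x ≢ zero → x ∈ w) → MergeFree w ([] , [])
  minimal⇒mergeFree w len represents-w covers-w = excess≡0 (merges w ([] , [])) pot′ (+-mono-≤ kb pb)
    where
    sf = run w ([] , [])
    covers-nonzero : ∀ x → x ≢ zero → x ∈ points sf
    covers-nonzero x xz = run-points-new w ([] , []) x (covers-w x xz)
    kb : k ≤ length (points sf)
    kb = nonzero⊆⇒k≤length (points sf) covers-nonzero
    pb : p ≤ length (proj₂ sf)
    pb = p≤#cycles (proj₁ sf) (proj₂ sf) represents-w covers-nonzero
    lw : length w ≡ k + p
    lw = trans len (cong (_∸ 1) (+-suc k p))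
    pot′ : k + p ≡ size sf + 2 * merges w ([] , [])
    pot′ = trans (sym (trans (+-identityʳ (length w)) lw)) (size-run w [] [])

  prod-represents : ∀ (w : List Point) → AllNonZero w → (∀ x → prod w x ≡ f x) → Represents f (run w ([] , []))
  prod-represents w nonzero-w pe = represents-resp (λ x → prod w x) f (proj₁ (run w ([] , []))) (proj₂ (run w ([] , []))) pe
    (run-represents w (λ x → x) [] [] nonzero-w (distinct-singleton zero) represents-id)

  firstReps : List Point → Fin p → Point
  firstReps w i = fromMaybe (lead orbits (suc i)) (firstIn (suc i) w)

  repVec : List Point → Vec Point p
  repVec w = tabulate (firstReps w)

  firstReps-orbit : ∀ w i → orbitOf (firstReps w i) ≡ suc i
  firstReps-orbit w i with firstIn (suc i) w in e
  ... | just x = proj₁ (firstIn-spec (suc i) w e)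
  ... | nothing = orbitOf-lead (suc i)

  repVec-inOrbit : ∀ w i → InOrbit π (lead orbits (suc i)) (Vec.lookup (repVec w) i)
  repVec-inOrbit w i = subst (InOrbit π (lead orbits (suc i))) (sym (lookup∘tabulate (firstReps w) i))
    (subst (λ j → InOrbit π (lead orbits j) (firstReps w i)) (firstReps-orbit w i) (inOrbitOf (firstReps w i)))

  decodePoints : (Fin p → Point) → List Letter → List Point
  decodePoints rep u = DecodeMap.decodeFrom k p π orbits ℓ H rep (λ _ → 0) u

  module Encode (w : List Point) (F : IsMinTransStarFact π (suc p) w) where
    nonzero-w : AllNonZero w
    nonzero-w = proj₁ F
    len = proj₁ (proj₂ F)
    pe = proj₁ (proj₂ (proj₂ F))
    tr = proj₂ (proj₂ (proj₂ F))
    covers-w = transitive⇒covers w tr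
    represents-w = prod-represents w nonzero-w pe
    module E = Encoding k p π orbits ℓ H (firstReps w) (firstReps-orbit w)
    initial : E.EncInv (λ _ → 0) [] [] w
    initial = record
      { mergeFree = minimal⇒mergeFree w len represents-w covers-w
      ; distinct = distinct-singleton zero
      ; nonzero = nonzero-w
      ; represents = represents-w
      ; covers-nonzero = λ x xz → run-points-new w ([] , []) x (covers-w x xz)
      ; stackInv = stackInv-init
      ; started = λ _ ()
      ; unseen-or-listed = λ _ _ → inj₁ refl
      ; first-is-rep = first-is-rep₀ }
      where
      first-is-rep₀ : ∀ j → j ≢ zero → 0 ≡ 0 → ∀ x → firstIn j w ≡ just x → x ≡ DecodeMap.base k p π orbits ℓ H (firstReps w) j
      first-is-rep₀ zero jz _ x e = ⊥-elim (jz refl)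
      first-is-rep₀ (suc i) jz _ x e rewrite e = refl
    res = E.encode-accepts w (λ _ → 0) [] [] initial
    acc = proj₁ res
    u = map orbitOf w
    isW : IsW (suc k) p ℓ u
    isW = trans (length-map orbitOf w) len ,
          accepts-counts acc stackInv-init (λ _ ()) zero ,
          occj ,
          accepts-no-abab acc stackInv-init ,
          accepts-no-a1a acc stackInv-init
      where
      occj : ∀ j → j ≢ zero → occ j u ≡ ℓ j + 1
      occj zero jz = ⊥-elim (jz refl)
      occj (suc i) _ = accepts-counts acc stackInv-init (λ _ ()) (suc i)

  decodeFrom-cong : ∀ rep cb′ → (∀ i → rep i ≡ cb′ i) → ∀ c u → DecodeMap.decodeFrom k p π orbits ℓ H rep c u ≡ DecodeMap.decodeFrom k p π orbits ℓ H cb′ c u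
  decodeFrom-cong rep cb′ e c [] = refl
  decodeFrom-cong rep cb′ e c (zero ∷ u) = cong (_ ∷_) (decodeFrom-cong rep cb′ e _ u)
  decodeFrom-cong rep cb′ e c (suc i ∷ u) = cong₂ _∷_ (cong (iter g (c (suc i))) (e i)) (decodeFrom-cong rep cb′ e _ u)

  length-decode : ∀ rep c u → length (DecodeMap.decodeFrom k p π orbits ℓ H rep c u) ≡ length u
  length-decode rep c [] = refl
  length-decode rep c (j ∷ u) = cong suc (length-decode rep _ u)

  map-orbitOf-decode : ∀ rep (rep-orbit : ∀ i → orbitOf (rep i) ≡ suc i) c u → map orbitOf (DecodeMap.decodeFrom k p π orbits ℓ H rep c u) ≡ u
  map-orbitOf-decode rep rep-orbit c [] = refl
  map-orbitOf-decode rep rep-orbit c (j ∷ u) = cong₂ _∷_ (Blocks.orbitOf-pointOf k p π orbits ℓ H rep rep-orbit j (c j)) (map-orbitOf-decode rep rep-orbit _ u)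

  firstIn-decode : ∀ rep (rep-orbit : ∀ i → orbitOf (rep i) ≡ suc i) c u j → c j ≡ 0 → j ∈ u →
    firstIn j (DecodeMap.decodeFrom k p π orbits ℓ H rep c u) ≡ just (DecodeMap.pointOf k p π orbits ℓ H rep j 0)
  firstIn-decode rep rep-orbit c (j′ ∷ u) j c0 ju with j′ ≟ j
  ... | yes refl = trans (firstIn-hit j _ _ (Blocks.orbitOf-pointOf k p π orbits ℓ H rep rep-orbit j (c j))) (cong (λ n → just (DecodeMap.pointOf k p π orbits ℓ H rep j n)) c0)
  ... | no ne with ju
  ... | here e = ⊥-elim (ne (sym e))
  ... | there ju′ = trans (firstIn-skip j _ _ (λ e → ne (trans (sym (Blocks.orbitOf-pointOf k p π orbits ℓ H rep rep-orbit j′ (c j′))) e)))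
                     (firstIn-decode rep rep-orbit (bump c j′) u j (trans (bump-other c j′ j (λ e → ne (sym e))) c0) ju′)

  module Decode (u : List Letter) (c : Vec Point p) (T : IsW (suc k) p ℓ u × (∀ i → InOrbit π (lead orbits (suc i)) (Vec.lookup c i))) where
    isW = proj₁ T
    orbs = proj₂ T
    rep-orbit : ∀ i → orbitOf (Vec.lookup c i) ≡ suc i
    rep-orbit i = orbitOf-unique (suc i) (Vec.lookup c i) (orbs i)
    module BW = Decoding k p π orbits ℓ H (Vec.lookup c) rep-orbit
    acc : Accepts (λ _ → 0) [] [] u
    acc = W⇒accepts u (proj₁ (proj₂ isW)) (proj₁ (proj₂ (proj₂ isW))) (proj₁ (proj₂ (proj₂ (proj₂ isW)))) (proj₂ (proj₂ (proj₂ (proj₂ isW))))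
    w : List Point
    w = decodePoints (Vec.lookup c) u
    good = BW.decode-correct u acc
    F : IsMinTransStarFact π (suc p) w
    F = proj₁ good , trans (length-decode (Vec.lookup c) (λ _ → 0) u) (proj₁ isW) , proj₁ (proj₂ good) , covers⇒transitive w (proj₂ (proj₂ good))
    repVec-decode : repVec w ≡ c
    repVec-decode = trans (tabulate-cong (λ i → cong (fromMaybe (lead orbits (suc i))) (firstIn-decode (Vec.lookup c) rep-orbit (λ _ → 0) u (suc i) refl (inu i))))
                     (tabulate∘lookup c)
      where
      inu : ∀ i → suc i ∈ u
      inu i = 1≤occ⇒∈ u (subst (1 ≤_) (sym (proj₁ (proj₂ (proj₂ isW)) (suc i) (λ ()))) (subst (1 ≤_) (+-comm 1 (ℓ (suc i))) (s≤s z≤n)))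

  encode : Σ (List Point) (IsMinTransStarFact π (suc p)) → TargetCarrier π orbits ℓ
  encode (w , F) = (map orbitOf w , repVec w) , Encode.isW w F , repVec-inOrbit w

  decode : TargetCarrier π orbits ℓ → Σ (List Point) (IsMinTransStarFact π (suc p))
  decode ((u , c) , T) = Decode.w u c T , Decode.F u c T

  encode-cong : ∀ {x y} → proj₁ x ≡ proj₁ y → proj₁ (encode x) ≡ proj₁ (encode y)
  encode-cong = cong (λ w → map orbitOf w , repVec w)

  decode-cong : ∀ {x y} → proj₁ x ≡ proj₁ y → proj₁ (decode x) ≡ proj₁ (decode y)
  decode-cong = cong (λ uc → decodePoints (Vec.lookup (proj₂ uc)) (proj₁ uc))

  encode∘decode : ∀ y → proj₁ (encode (decode y)) ≡ proj₁ y
  encode∘decode ((u , c) , T) =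
    cong₂ _,_ (map-orbitOf-decode (Vec.lookup c) (Decode.rep-orbit u c T) (λ _ → 0) u) (Decode.repVec-decode u c T)

  decode∘encode : ∀ x → proj₁ (decode (encode x)) ≡ proj₁ x
  decode∘encode (w , F) =
    trans (decodeFrom-cong (Vec.lookup (repVec w)) (firstReps w) (lookup∘tabulate (firstReps w)) (λ _ → 0) (map orbitOf w))
          (sym (proj₂ (Encode.res w F)))

proposition2p4 : (k p : ℕ) (π : Permutation′ (suc k)) (L : OrbitListing π (suc p))
    (ℓ : Fin (suc p) → ℕ) → (∀ j → OrbitSize π (lead L j) (ℓ j)) →
    Inverse (FSetoid π (suc p)) (TargetSetoid π L ℓ)
proposition2p4 k p π L ℓ H = record
  { to        = encode
  ; from      = decode
  ; to-cong   = λ {x} {y} → encode-cong {x} {y}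
  ; from-cong = λ {x} {y} → decode-cong {x} {y}
  ; inverse   = (λ {y} {x} e → trans (encode-cong {x} {decode y} e) (encode∘decode y))
              , (λ {x} {y} e → trans (decode-cong {y} {encode x} e) (decode∘encode x))
  }
  where open Bijection k p π L ℓ H
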